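{- Let $p$ be a prime and let $G$ be a finite non-abelian group such that $G/Z(G)\cong \mathbb{Z}_p\times\mathbb{Z}_p$. Put $z=|Z(G)|$ and $n=\frac{(p-1)z}{p}$. Then $\mathrm{Spec}(\Gamma_G)=\{[0]^{(p+1)(n-1)},[-n]^{p},[np]^1\}$, $\mathrm{L\text{ - }Spec}(\Gamma_G)=\{[0]^1,[np]^{(p+1)(n-1)},[(p+1)n]^{p}\}$, $\mathrm{Q\text{ - }Spec}(\Gamma_G)=\{[np]^{(p+1)(n-1)},[n(p-1)]^{p},[2np]^1\}$, and $E(\Gamma_G)=LE(\Gamma_G)=SE(\Gamma_G)=2np$.
   Context: For a finite non-abelian group $G$ with center $Z(G)$, the non-commuting conjugacy class graph (NCCC-graph) $\Gamma_G$ is the simple undirected graph whose vertices are the conjugacy classes $x^G$ of the elements $x\in G\setminus Z(G)$, two distinct vertices $x^G,y^G$ being adjacent iff $x'y'\neq y'x'$ for all $x'\in x^G$, $y'\in y^G$. For a simple graph $\mathcal G$ with adjacency matrix $A$ and diagonal degree matrix $D$, put $L=D-A$ (Laplacian) and $Q=D+A$ (signless Laplacian). $\mathrm{Spec}$, $\mathrm{L\text{ - }Spec}$, $\mathrm{Q\text{ - }Spec}$ denote the multisets of eigenvalues of $A$, $L$, $Q$, written $\{[\lambda_1]^{k_1},[\lambda_2]^{k_2},\dots\}$ meaning $\lambda_i$ occurs with multiplicity $k_i$ (an exponent $0$ means the value does not occur; if listed values coincide, multiplicities add). Let $\Delta(\mathcal G)=2|e(\mathcal G)|/|v(\mathcal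 G)|$ (number of edges $e$, number of vertices $v$). The energy is $E(\mathcal G)=\sum_{\alpha\in\mathrm{Spec}}|\alpha|$, the Laplacian energy $LE(\mathcal G)=\sum_{\beta\in \mathrm{L\text{ - }Spec}}|\beta-\Delta(\mathcal G)|$, the signless Laplacian energy $SE(\mathcal G)=\sum_{\gamma\in\mathrm{Q\text{ - }Spec}}|\gamma-\Delta(\mathcal G)|$ (sums with multiplicity). -}

module Defs where

open import Data.Nat as ℕ using (ℕ; zero; suc; _∸_)
open import Data.Nat.DivMod using (_mod_)
open import Data.Nat.Primality using (Prime; prime⇒nonZero)
open import Data.Fin as Fin using (Fin; toℕ; punchIn)
open import Data.Fin.Properties using (all?; any?)
open import Data.Integer as ℤ using (ℤ; +_; -_)
open import Data.Rational as ℚ using (ℚ; 0ℚ; _/_)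
open import Data.List as List using (List; []; _∷_; _++_; replicate; length)
open import Data.Product using (Σ; ∃; ∃-syntax; _×_; _,_)
open import Data.Bool using (if_then_else_)
open import Function.Bundles using (_⇔_)
open import Relation.Nullary using (¬_; Dec; does; ¬?)
open import Relation.Nullary.Decidable using (_×-dec_; _→-dec_)
open import Relation.Binary.PropositionalEquality using (_≡_; _≢_)

Matrix : ℕ → Set
Matrix m = Fin m → Fin m → ℤ

ΣFin : ∀ {n} → (Fin n → ℤ) → ℤ
ΣFin {zero}  f = + 0
ΣFin {suc n} f = f Fin.zero ℤ.+ ΣFin (λ i → f (Fin.suc i))

sign : ℕ → ℤ
sign zero    = + 1
sign (suc k) = - sign k

det : ∀ {m} → Matrix m → ℤ
det {zero}  M = + 1
det {suc m} M =
  ΣFin (λ j → sign (toℕ j) ℤ.* M Fin.zero j ℤ.* det (λ i k → M (Fin.suc i) (punchIn j k)))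

δ : ∀ {m} → Fin m → Fin m → ℤ
δ i j = if does (i Fin.≟ j) then + 1 else + 0

charPolyAt : ∀ {m} → Matrix m → ℤ → ℤ
charPolyAt M t = det (λ i j → t ℤ.* δ i j ℤ.- M i j)

prodℤ : List ℤ → ℤ
prodℤ = List.foldr ℤ._*_ (+ 1)

-- HasSpectrum M λs : the multiset λs (a list, order irrelevant) is the
-- spectrum of M, i.e. det(xI - M) = ∏_{λ ∈ λs} (x - λ) as polynomials.
-- (Equality of integer polynomials is tested on all integer points,
-- which is equivalent since ℤ is an infinite integral domain.)
HasSpectrum : ∀ {m} → Matrix m → List ℤ → Set
HasSpectrum {m} M λs =
  (length λs ≡ m) × (∀ (t : ℤ) → charPolyAt M t ≡ prodℤ (List.map (λ l → t ℤ.- l) λs))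

-- multiset notation {[λ₁]^k₁, ...}
multiset : List (ℤ × ℕ) → List ℤ
multiset []            = []
multiset ((l , k) ∷ r) = replicate k l ++ multiset r

degree : ∀ {m} → Matrix m → Fin m → ℤ
degree A i = ΣFin (λ j → A i j)

laplacian : ∀ {m} → Matrix m → Matrix m
laplacian A i j = δ i j ℤ.* degree A i ℤ.- A i j

signlessLaplacian : ∀ {m} → Matrix m → Matrix m
signlessLaplacian A i j = δ i j ℤ.* degree A i ℤ.+ A i j

-- Δ = 2|e| / |v|  (sum of degrees divided by number of vertices)
avgDegree : ∀ {m} → Matrix m → ℚ
avgDegree {zero}  A = 0ℚ
avgDegree {suc m} A = ΣFin (λ i → degree A i) / suc m

ℤtoℚ : ℤ → ℚ
ℤtoℚ k = k / 1

sumℚ : List ℚ → ℚ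
sumℚ = List.foldr ℚ._+_ 0ℚ

Energy : ∀ {m} → Matrix m → ℚ → Set
Energy A e = Σ (List ℤ) λ αs → HasSpectrum A αs ×
  (sumℚ (List.map (λ a → ℚ.∣ ℤtoℚ a ∣) αs) ≡ e)

LaplacianEnergy : ∀ {m} → Matrix m → ℚ → Set
LaplacianEnergy A e = Σ (List ℤ) λ βs → HasSpectrum (laplacian A) βs ×
  (sumℚ (List.map (λ b → ℚ.∣ ℤtoℚ b ℚ.- avgDegree A ∣) βs) ≡ e)

SignlessLaplacianEnergy : ∀ {m} → Matrix m → ℚ → Set
SignlessLaplacianEnergy A e = Σ (List ℤ) λ γs → HasSpectrum (signlessLaplacian A) γs ×
  (sumℚ (List.map (λ c → ℚ.∣ ℤtoℚ c ℚ.- avgDegree A ∣) γs) ≡ e)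

-- Finite groups: carrier Fin N, equality ≡, operations _∙_, _⁻¹
-- (the group axioms are assumed separately via Algebra.Structures.IsGroup)

module FinGroup {N : ℕ} (_∙_ : Fin N → Fin N → Fin N) (ε : Fin N) (_⁻¹ : Fin N → Fin N) where

  Central : Fin N → Set
  Central x = ∀ y → x ∙ y ≡ y ∙ x

  central? : ∀ x → Dec (Central x)
  central? x = all? (λ y → (x ∙ y) Fin.≟ (y ∙ x))

  centerSize : ℕ
  centerSize = List.length (List.filter central? (List.allFin N))

  Abelian : Set
  Abelian = ∀ x y → x ∙ y ≡ y ∙ x

  Conj : Fin N → Fin N → Set
  Conj x y = ∃[ g ] (y ≡ (g ∙ x) ∙ (g ⁻¹))

  conj? : ∀ x y → Dec (Conj x y)
  conj? x y = any? (λ g → y Fin.≟ ((g ∙ x) ∙ (g ⁻¹)))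

  -- a choice of one representative for each conjugacy class outside Z(G);
  -- the vertices of Γ_G are indexed by Fin m
  record ClassReps (m : ℕ) : Set where
    field
      rep        : Fin m → Fin N
      nonCentral : ∀ i → ¬ Central (rep i)
      distinct   : ∀ i j → Conj (rep i) (rep j) → i ≡ j
      cover      : ∀ x → ¬ Central x → ∃[ i ] Conj (rep i) x

  module _ {m : ℕ} (R : ClassReps m) where
    open ClassReps R

    Adjacent : Fin m → Fin m → Set
    Adjacent i j = (i ≢ j) × (∀ x y → Conj (rep i) x → Conj (rep j) y → x ∙ y ≢ y ∙ x)

    adjacent? : ∀ i j → Dec (Adjacent i j)
    adjacent? i j = ¬? (i Fin.≟ j) ×-dec
      all? (λ x → all? (λ y → conj? (rep i) x →-dec (conj? (rep j) y →-dec ¬? ((x ∙ y) Fin.≟ (y ∙ x)))))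

    adjMatrix : Matrix m
    adjMatrix i j = if does (adjacent? i j) then + 1 else + 0

  -- G/Z(G) ≅ ℤ_p × ℤ_p : a surjective homomorphism onto ℤ_p × ℤ_p whose
  -- kernel is exactly Z(G)
  module _ (p : ℕ) (pp : Prime p) where
    private instance _ = prime⇒nonZero pp

    _⊕_ : Fin p × Fin p → Fin p × Fin p → Fin p × Fin p
    (a , b) ⊕ (c , d) = ((toℕ a ℕ.+ toℕ c) mod p) , ((toℕ b ℕ.+ toℕ d) mod p)

    record CentralQuotientIsZp×Zp : Set where
      field
        φ          : Fin N → Fin p × Fin p
        hom        : ∀ x y → φ (x ∙ y) ≡ φ x ⊕ φ y
        surjective : ∀ c → ∃[ x ] φ x ≡ c
        kernel     : ∀ x → (φ x ≡ φ ε) ⇔ Central x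

nParam : (p : ℕ) → Prime p → ℕ → ℕ
nParam p pp z = ((p ∸ 1) ℕ.* z) ℕ./ p
  where instance _ = prime⇒nonZero pp

-- Write φ g = (g₁ , g₂) ∈ ℤₚ² for the image of g in G/Z(G). If e₁, e₂ lift the standard
-- basis, their commutator κ is central and every g is e₁^g₁ e₂^g₂ times a central element,
-- so g h and h g differ by κ^(g₂ h₁ - h₂ g₁). As G is non-abelian κ has order p, hence g and
-- h commute iff φ g and φ h are linearly dependent. Commuting is therefore an equivalence
-- relation on G ∖ Z(G) with p + 1 classes, one for each line of ℤₚ²; every noncentral
-- conjugacy class has p elements, and each line contains n = (p - 1)z/p of them. Thus Γ_G is
-- the complete (p + 1)-partite graph with parts of size n. Its characteristic polynomials
-- come from det (s·I + β·J + γ·R) for the 0/1 matrix R of an equivalence relation, which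
-- merging two equivalent indices reduces, one factor s at a time, to the case R = I.

module Submission where

open import Defs
open import Data.Nat using (ℕ)
open import Data.Nat.Primality using (Prime)
open import Data.Fin using (Fin)
open import Relation.Binary.PropositionalEquality using (_≡_)
open import Algebra.Structures using (IsGroup)

module FinSum where

  open import Data.Bool using (Bool; if_then_else_)
  open import Data.Nat using (zero; suc)
  open import Data.Fin as Fin using (Fin; zero; suc; punchIn)
  open import Data.Fin.Properties using (punchInᵢ≢i; punchIn-injective)
  open import Data.Fin.Permutation using (permutation)
  open import Data.Integer using (ℤ; +_; _+_; _*_; _-_; -_)
  open import Data.Integer.Properties using (+-*-semiring; *-comm; *-zeroˡ; +-identityʳ; +-identityˡ)
  open import Data.Integer.Tactic.RingSolver using (solve-∀)
  open import Algebra.Properties.Semiring.Sum +-*-semiring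
    using (sum; ∑-distrib-+; ∑-comm; sum-remove; sum-permute; *-distribˡ-sum)
  open import Data.List using (length; filter; tabulate)
  open import Function.Base using (_∘_)
  open import Relation.Binary.PropositionalEquality
  open import Relation.Nullary using (¬_; Dec; yes; no; does; ¬?)
  open import Relation.Nullary.Negation using (contradiction)
  open import Relation.Unary using (Pred; Decidable)
  open ≡-Reasoning

  -- With these definitions δ i j and adjMatrix R i j of Defs are definitionally χ of the
  -- decision procedures they are built from.
  ind : Bool → ℤ
  ind b = if b then + 1 else + 0

  χ : ∀ {p} {P : Set p} → Dec P → ℤ
  χ d = ind (does d)

  χ-yes : ∀ {p} {P : Set p} (d : Dec P) → P → χ d ≡ + 1
  χ-yes (yes _) _  = refl
  χ-yes (no ¬p) p  = contradiction p ¬p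

  χ-no : ∀ {p} {P : Set p} (d : Dec P) → ¬ P → χ d ≡ + 0
  χ-no (yes p) ¬p = contradiction p ¬p
  χ-no (no _)  _  = refl

  χ-cong : ∀ {p q} {P : Set p} {Q : Set q} (d : Dec P) (e : Dec Q) → (P → Q) → (Q → P) → χ d ≡ χ e
  χ-cong (yes p) e P→Q Q→P = sym (χ-yes e (P→Q p))
  χ-cong (no ¬p) e P→Q Q→P = sym (χ-no e (¬p ∘ Q→P))

  χ-¬ : ∀ {p} {P : Set p} (d : Dec P) → χ (¬? d) ≡ + 1 - χ d
  χ-¬ (yes _) = refl
  χ-¬ (no _)  = refl

  δ-refl : ∀ {m} (i : Fin m) → δ i i ≡ + 1
  δ-refl i = χ-yes (i Fin.≟ i) refl

  δ-≢ : ∀ {m} {i j : Fin m} → i ≢ j → δ i j ≡ + 0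
  δ-≢ {i = i} {j} = χ-no (i Fin.≟ j)

  δ-punchIn : ∀ {m} (v : Fin (suc m)) (a b : Fin m) → δ (punchIn v a) (punchIn v b) ≡ δ a b
  δ-punchIn v a b = χ-cong (punchIn v a Fin.≟ punchIn v b) (a Fin.≟ b) (punchIn-injective v a b) (cong (punchIn v))

  ΣFin≗sum : ∀ {n} (f : Fin n → ℤ) → ΣFin f ≡ sum f
  ΣFin≗sum {zero}  f = refl
  ΣFin≗sum {suc n} f = cong (_+_ (f zero)) (ΣFin≗sum (f ∘ suc))

  ΣFin-cong : ∀ {n} {f g : Fin n → ℤ} → (∀ i → f i ≡ g i) → ΣFin f ≡ ΣFin g
  ΣFin-cong {zero}  f≗g = refl
  ΣFin-cong {suc n} f≗g = cong₂ _+_ (f≗g zero) (ΣFin-cong (f≗g ∘ suc))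

  ΣFin-+ : ∀ {n} (f g : Fin n → ℤ) → ΣFin (λ i → f i + g i) ≡ ΣFin f + ΣFin g
  ΣFin-+ f g = begin
    ΣFin (λ i → f i + g i)  ≡⟨ ΣFin≗sum (λ i → f i + g i) ⟩
    sum (λ i → f i + g i)   ≡⟨ ∑-distrib-+ f g ⟩
    sum f + sum g           ≡⟨ sym (cong₂ _+_ (ΣFin≗sum f) (ΣFin≗sum g)) ⟩
    ΣFin f + ΣFin g         ∎

  ΣFin-*ˡ : ∀ {n} (c : ℤ) (f : Fin n → ℤ) → ΣFin (λ i → c * f i) ≡ c * ΣFin f
  ΣFin-*ˡ c f = begin
    ΣFin (λ i → c * f i)  ≡⟨ ΣFin≗sum (λ i → c * f i) ⟩
    sum (λ i → c * f i)   ≡⟨ sym (*-distribˡ-sum c f) ⟩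
    c * sum f             ≡⟨ sym (cong (c *_) (ΣFin≗sum f)) ⟩
    c * ΣFin f            ∎

  ΣFin-*ʳ : ∀ {n} (c : ℤ) (f : Fin n → ℤ) → ΣFin (λ i → f i * c) ≡ ΣFin f * c
  ΣFin-*ʳ c f = begin
    ΣFin (λ i → f i * c)  ≡⟨ ΣFin-cong (λ i → *-comm (f i) c) ⟩
    ΣFin (λ i → c * f i)  ≡⟨ ΣFin-*ˡ c f ⟩
    c * ΣFin f            ≡⟨ *-comm c (ΣFin f) ⟩
    ΣFin f * c            ∎

  ΣFin-- : ∀ {n} (f g : Fin n → ℤ) → ΣFin (λ i → f i - g i) ≡ ΣFin f - ΣFin g
  ΣFin-- f g = begin
    ΣFin (λ i → f i - g i)             ≡⟨ ΣFin-cong (λ i → a-b≡a+[-1]b (f i) (g i)) ⟩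
    ΣFin (λ i → f i + - + 1 * g i)     ≡⟨ ΣFin-+ f (λ i → - + 1 * g i) ⟩
    ΣFin f + ΣFin (λ i → - + 1 * g i)  ≡⟨ cong (_+_ (ΣFin f)) (ΣFin-*ˡ (- + 1) g) ⟩
    ΣFin f + - + 1 * ΣFin g            ≡⟨ sym (a-b≡a+[-1]b (ΣFin f) (ΣFin g)) ⟩
    ΣFin f - ΣFin g                    ∎
    where
    a-b≡a+[-1]b : ∀ a b → a - b ≡ a + - + 1 * b
    a-b≡a+[-1]b = solve-∀

  ΣFin-zero : ∀ {n} (f : Fin n → ℤ) → (∀ i → f i ≡ + 0) → ΣFin f ≡ + 0
  ΣFin-zero {zero}  f f≗0 = refl
  ΣFin-zero {suc n} f f≗0 = cong₂ _+_ (f≗0 zero) (ΣFin-zero (f ∘ suc) (f≗0 ∘ suc))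

  ΣFin-const : ∀ n (c : ℤ) → ΣFin {n} (λ _ → c) ≡ + n * c
  ΣFin-const zero    c = sym (*-zeroˡ c)
  ΣFin-const (suc n) c = trans (cong (_+_ c) (ΣFin-const n c)) (sucn*c (+ n) c)
    where
    sucn*c : ∀ n c → c + n * c ≡ (+ 1 + n) * c
    sucn*c = solve-∀

  ΣFin-swap : ∀ {m n} (f : Fin m → Fin n → ℤ) →
              ΣFin (λ i → ΣFin (f i)) ≡ ΣFin (λ j → ΣFin (λ i → f i j))
  ΣFin-swap f = begin
    ΣFin (λ i → ΣFin (f i))            ≡⟨ ΣFin-cong (λ i → ΣFin≗sum (f i)) ⟩
    ΣFin (λ i → sum (f i))             ≡⟨ ΣFin≗sum (λ i → sum (f i)) ⟩
    sum (λ i → sum (f i))              ≡⟨ ∑-comm f ⟩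
    sum (λ j → sum (λ i → f i j))      ≡⟨ sym (ΣFin≗sum (λ j → sum (λ i → f i j))) ⟩
    ΣFin (λ j → sum (λ i → f i j))     ≡⟨ sym (ΣFin-cong (λ j → ΣFin≗sum (λ i → f i j))) ⟩
    ΣFin (λ j → ΣFin (λ i → f i j))    ∎

  ΣFin-punchIn : ∀ {n} (c : Fin (suc n)) (f : Fin (suc n) → ℤ) → ΣFin f ≡ f c + ΣFin (f ∘ punchIn c)
  ΣFin-punchIn c f = begin
    ΣFin f                    ≡⟨ ΣFin≗sum f ⟩
    sum f                     ≡⟨ sum-remove f ⟩
    f c + sum (f ∘ punchIn c) ≡⟨ sym (cong (_+_ (f c)) (ΣFin≗sum (f ∘ punchIn c))) ⟩
    f c + ΣFin (f ∘ punchIn c) ∎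

  ΣFin-single : ∀ {n} (c : Fin n) (f : Fin n → ℤ) → (∀ j → j ≢ c → f j ≡ + 0) → ΣFin f ≡ f c
  ΣFin-single {suc n} c f f≗0 = begin
    ΣFin f                      ≡⟨ ΣFin-punchIn c f ⟩
    f c + ΣFin (f ∘ punchIn c)  ≡⟨ cong (_+_ (f c)) (ΣFin-zero _ (λ j → f≗0 (punchIn c j) (punchInᵢ≢i c j))) ⟩
    f c + + 0                   ≡⟨ +-identityʳ (f c) ⟩
    f c                         ∎

  ΣFin-permute : ∀ {n} (f g : Fin n → Fin n) → (∀ x → f (g x) ≡ x) → (∀ x → g (f x) ≡ x) →
                   (h : Fin n → ℤ) → ΣFin (h ∘ f) ≡ ΣFin h
  ΣFin-permute f g fg gf h = begin
    ΣFin (h ∘ f)  ≡⟨ ΣFin≗sum (h ∘ f) ⟩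
    sum (h ∘ f)   ≡⟨ sym (sum-permute h (permutation f g fg gf)) ⟩
    sum h         ≡⟨ sym (ΣFin≗sum h) ⟩
    ΣFin h        ∎

  length-filter-tabulate : ∀ {n a p} {A : Set a} {P : Pred A p} (P? : Decidable P) (f : Fin n → A) →
                           + length (filter P? (tabulate f)) ≡ ΣFin (λ i → χ (P? (f i)))
  length-filter-tabulate {zero}  P? f = refl
  length-filter-tabulate {suc n} P? f with P? (f zero)
  ... | yes _ = cong (_+_ (+ 1)) (length-filter-tabulate P? (f ∘ suc))
  ... | no  _ = trans (length-filter-tabulate P? (f ∘ suc)) (sym (+-identityˡ _))

module Determinant where

  open FinSum
  open import Data.Nat using (zero; suc)
  open import Data.Fin as Fin using (Fin; zero; suc; toℕ; punchIn)
  open import Data.Fin.Properties using (suc-injective)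
  open import Data.Integer using (ℤ; +_; -_; _+_; _*_)
  open import Data.Integer.Properties using (*-zeroʳ; +-identityʳ; *-identityˡ; *-comm; *-distribˡ-+)
  open import Data.Integer.Tactic.RingSolver using (solve-∀)
  open import Data.Vec.Functional using (updateAt)
  open import Data.Vec.Functional.Properties using (updateAt-updates; updateAt-minimal)
  open import Function.Base using (_∘_; _$_; const)
  open import Relation.Binary.PropositionalEquality
  open import Relation.Nullary.Negation using (contradiction)
  open ≡-Reasoning

  minor : ∀ {m} → Fin (suc m) → Fin (suc m) → Matrix (suc m) → Matrix m
  minor i j M a b = M (punchIn i a) (punchIn j b)

  transpose : ∀ {m} → Matrix m → Matrix m
  transpose M i j = M j i

  det-cong : ∀ {m} {M N : Matrix m} → (∀ i j → M i j ≡ N i j) → det M ≡ det N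
  det-cong {zero}  M≗N = refl
  det-cong {suc m} M≗N = ΣFin-cong λ j →
    cong₂ (λ x y → sign (toℕ j) * x * y) (M≗N zero j) (det-cong (λ a b → M≗N (suc a) (punchIn j b)))

  sign*sign : ∀ n → sign n * sign n ≡ + 1
  sign*sign zero    = refl
  sign*sign (suc n) = trans (neg*neg (sign n) (sign n)) (sign*sign n)
    where
    neg*neg : ∀ a b → (- a) * (- b) ≡ a * b
    neg*neg = solve-∀

  sign-cancel : ∀ n {x y : ℤ} → x ≡ sign n * y → y ≡ sign n * x
  sign-cancel n {x} {y} x≡sy = begin
    y                        ≡⟨ sym (*-identityˡ y) ⟩
    + 1 * y                  ≡⟨ cong (_* y) (sym (sign*sign n)) ⟩
    sign n * sign n * y      ≡⟨ reassoc (sign n) y ⟩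
    sign n * (sign n * y)    ≡⟨ cong (sign n *_) (sym x≡sy) ⟩
    sign n * x               ∎
    where
    reassoc : ∀ s y → s * s * y ≡ s * (s * y)
    reassoc = solve-∀

  -- Expanding every minor once more, both expansions become the same double sum over the
  -- entries M 0 (1+j) and M (1+i) 0 and the minors D i j without rows 0, 1+i and columns 0, 1+j.
  det-laplace-col₀ : ∀ {m} (M : Matrix (suc m)) →
                     det M ≡ ΣFin (λ i → sign (toℕ i) * M i zero * det (minor i zero M))
  det-laplace-col₀ {zero}  M = refl
  det-laplace-col₀ {suc m} M = cong (_+_ (sign 0 * M zero zero * det (minor zero zero M))) (begin
      ΣFin (λ j → - sign (toℕ j) * M zero (suc j) * det (minor zero (suc j) M))
    ≡⟨ ΣFin-cong (λ j → cong (- sign (toℕ j) * M zero (suc j) *_) (det-laplace-col₀ (minor zero (suc j) M))) ⟩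
      ΣFin (λ j → - sign (toℕ j) * M zero (suc j) * ΣFin (λ i → sign (toℕ i) * M (suc i) zero * D i j))
    ≡⟨ ΣFin-cong (λ j → sym (ΣFin-*ˡ (- sign (toℕ j) * M zero (suc j)) (λ i → sign (toℕ i) * M (suc i) zero * D i j))) ⟩
      ΣFin (λ j → ΣFin (λ i → - sign (toℕ j) * M zero (suc j) * (sign (toℕ i) * M (suc i) zero * D i j)))
    ≡⟨ ΣFin-swap (λ j i → - sign (toℕ j) * M zero (suc j) * (sign (toℕ i) * M (suc i) zero * D i j)) ⟩
      ΣFin (λ i → ΣFin (λ j → - sign (toℕ j) * M zero (suc j) * (sign (toℕ i) * M (suc i) zero * D i j)))
    ≡⟨ ΣFin-cong (λ i → ΣFin-cong (λ j → exchange (sign (toℕ j)) (M zero (suc j)) (sign (toℕ i)) (M (suc i) zero) (D i j))) ⟩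
      ΣFin (λ i → ΣFin (λ j → - sign (toℕ i) * M (suc i) zero * (sign (toℕ j) * M zero (suc j) * D i j)))
    ≡⟨ ΣFin-cong (λ i → ΣFin-*ˡ (- sign (toℕ i) * M (suc i) zero) (λ j → sign (toℕ j) * M zero (suc j) * D i j)) ⟩
      ΣFin (λ i → - sign (toℕ i) * M (suc i) zero * det (minor (suc i) zero M))
    ∎)
    where
    D : Fin (suc m) → Fin (suc m) → ℤ
    D i j = det (λ a b → M (suc (punchIn i a)) (suc (punchIn j b)))
    exchange : ∀ s a t b d → (- s) * a * (t * b * d) ≡ (- t) * b * (s * a * d)
    exchange = solve-∀

  det-transpose : ∀ {m} (M : Matrix m) → det (transpose M) ≡ det M
  det-transpose {zero}  M = refl
  det-transpose {suc m} M = trans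
    (ΣFin-cong (λ j → cong (sign (toℕ j) * M j zero *_) (det-transpose (minor j zero M))))
    (sym (det-laplace-col₀ M))

  det-linear-row : ∀ {m} (r : Fin m) (M N P : Matrix m) (c : ℤ) →
                   (∀ i j → i ≢ r → N i j ≡ M i j) → (∀ i j → i ≢ r → P i j ≡ M i j) →
                   (∀ j → M r j ≡ N r j + c * P r j) → det M ≡ det N + c * det P
  det-linear-row {suc m} zero M N P c N≗M P≗M Mr = begin
      ΣFin (λ j → sign (toℕ j) * M zero j * det (minor zero j M))
    ≡⟨ ΣFin-cong (λ j → cong₂ (λ x y → sign (toℕ j) * x * y) (Mr j) (det-cong (λ a b → sym (N≗M (suc a) (punchIn j b) λ ())))) ⟩
      ΣFin (λ j → sign (toℕ j) * (N zero j + c * P zero j) * det (minor zero j N))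
    ≡⟨ ΣFin-cong (λ j → trans (distrib (sign (toℕ j)) (N zero j) c (P zero j) (det (minor zero j N)))
         (cong (λ y → sign (toℕ j) * N zero j * det (minor zero j N) + c * (sign (toℕ j) * P zero j * y))
           (det-cong (λ a b → trans (N≗M (suc a) (punchIn j b) λ ()) (sym (P≗M (suc a) (punchIn j b) λ ())))))) ⟩
      ΣFin (λ j → sign (toℕ j) * N zero j * det (minor zero j N) + c * (sign (toℕ j) * P zero j * det (minor zero j P)))
    ≡⟨ ΣFin-+ (λ j → sign (toℕ j) * N zero j * det (minor zero j N)) (λ j → c * (sign (toℕ j) * P zero j * det (minor zero j P))) ⟩
      det N + ΣFin (λ j → c * (sign (toℕ j) * P zero j * det (minor zero j P)))
    ≡⟨ cong (_+_ (det N)) (ΣFin-*ˡ c (λ j → sign (toℕ j) * P zero j * det (minor zero j P))) ⟩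
      det N + c * det P
    ∎
    where
    distrib : ∀ s n c p d → s * (n + c * p) * d ≡ s * n * d + c * (s * p * d)
    distrib = solve-∀
  det-linear-row {suc m} (suc r) M N P c N≗M P≗M Mr = begin
      ΣFin (λ j → sign (toℕ j) * M zero j * det (minor zero j M))
    ≡⟨ ΣFin-cong (λ j → cong (sign (toℕ j) * M zero j *_) (det-linear-row r (minor zero j M) (minor zero j N) (minor zero j P) c
         (λ a b a≢r → N≗M (suc a) (punchIn j b) (a≢r ∘ suc-injective))
         (λ a b a≢r → P≗M (suc a) (punchIn j b) (a≢r ∘ suc-injective))
         (λ b → Mr (punchIn j b)))) ⟩
      ΣFin (λ j → sign (toℕ j) * M zero j * (det (minor zero j N) + c * det (minor zero j P)))
    ≡⟨ ΣFin-cong (λ j → distrib (sign (toℕ j)) (M zero j) (det (minor zero j N)) c (det (minor zero j P))) ⟩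
      ΣFin (λ j → sign (toℕ j) * M zero j * det (minor zero j N) + c * (sign (toℕ j) * M zero j * det (minor zero j P)))
    ≡⟨ ΣFin-+ (λ j → sign (toℕ j) * M zero j * det (minor zero j N)) (λ j → c * (sign (toℕ j) * M zero j * det (minor zero j P))) ⟩
      ΣFin (λ j → sign (toℕ j) * M zero j * det (minor zero j N)) + ΣFin (λ j → c * (sign (toℕ j) * M zero j * det (minor zero j P)))
    ≡⟨ cong₂ _+_ (ΣFin-cong (λ j → cong (λ x → sign (toℕ j) * x * det (minor zero j N)) (sym (N≗M zero j λ ()))))
                 (trans (ΣFin-*ˡ c (λ j → sign (toℕ j) * M zero j * det (minor zero j P)))
                        (cong (c *_) (ΣFin-cong (λ j → cong (λ x → sign (toℕ j) * x * det (minor zero j P)) (sym (P≗M zero j λ ())))))) ⟩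
      det N + c * det P
    ∎
    where
    distrib : ∀ s a dn c dp → s * a * (dn + c * dp) ≡ s * a * dn + c * (s * a * dp)
    distrib = solve-∀

  moveToTop : ∀ {m} → Fin (suc m) → Fin (suc m) → Fin (suc m)
  moveToTop r zero    = r
  moveToTop r (suc a) = punchIn r a

  -- The position of row r once row punchIn r k has been deleted.
  punchOutOf : ∀ {n} → Fin (suc (suc n)) → Fin (suc n) → Fin (suc n)
  punchOutOf zero    k       = zero
  punchOutOf (suc r) zero    = r
  punchOutOf {suc n} (suc r) (suc k) = suc (punchOutOf r k)

  punchIn-punchOutOf : ∀ {n} (r : Fin (suc (suc n))) (k : Fin (suc n)) → punchIn (punchIn r k) (punchOutOf r k) ≡ r
  punchIn-punchOutOf zero    k       = refl
  punchIn-punchOutOf (suc r) zero    = refl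
  punchIn-punchOutOf {suc n} (suc r) (suc k) = cong suc (punchIn-punchOutOf r k)

  punchIn-punchIn-punchOutOf : ∀ {n} (r : Fin (suc (suc n))) (k : Fin (suc n)) (a : Fin n) →
                               punchIn (punchIn r k) (punchIn (punchOutOf r k) a) ≡ punchIn r (punchIn k a)
  punchIn-punchIn-punchOutOf zero    k       a       = refl
  punchIn-punchIn-punchOutOf (suc r) zero    a       = refl
  punchIn-punchIn-punchOutOf {suc n} (suc r) (suc k) zero    = refl
  punchIn-punchIn-punchOutOf {suc n} (suc r) (suc k) (suc a) = cong suc (punchIn-punchIn-punchOutOf r k a)

  sign-punchOutOf : ∀ {n} (r : Fin (suc (suc n))) (k : Fin (suc n)) →
                    sign (suc (toℕ k)) * sign (toℕ (punchOutOf r k)) ≡ sign (toℕ r) * sign (toℕ (punchIn r k))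
  sign-punchOutOf zero    k       = *-comm (sign (suc (toℕ k))) (+ 1)
  sign-punchOutOf (suc r) zero    = neg1*s (sign (toℕ r))
    where
    neg1*s : ∀ s → (- + 1) * s ≡ (- s) * + 1
    neg1*s = solve-∀
  sign-punchOutOf {suc n} (suc r) (suc k) = begin
    (- (- sign (toℕ k))) * (- sign (toℕ (punchOutOf r k)))  ≡⟨ neg-neg*neg (sign (toℕ k)) (sign (toℕ (punchOutOf r k))) ⟩
    (- sign (toℕ k)) * sign (toℕ (punchOutOf r k))          ≡⟨ sign-punchOutOf r k ⟩
    sign (toℕ r) * sign (toℕ (punchIn r k))                 ≡⟨ sym (neg*neg (sign (toℕ r)) (sign (toℕ (punchIn r k)))) ⟩
    (- sign (toℕ r)) * (- sign (toℕ (punchIn r k)))         ∎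
    where
    neg-neg*neg : ∀ a b → (- (- a)) * (- b) ≡ (- a) * b
    neg-neg*neg = solve-∀
    neg*neg : ∀ a b → (- a) * (- b) ≡ a * b
    neg*neg = solve-∀

  minor-moveToTop : ∀ {m} (M : Matrix (suc (suc m))) r k a b →
                    minor (suc k) zero (M ∘ moveToTop r) a b ≡ minor (punchIn r k) zero M (moveToTop (punchOutOf r k) a) b
  minor-moveToTop M r k zero    b = cong (λ x → M x (suc b)) (sym (punchIn-punchOutOf r k))
  minor-moveToTop M r k (suc a) b = cong (λ x → M x (suc b)) (sym (punchIn-punchIn-punchOutOf r k a))

  det-moveToTop : ∀ {m} (M : Matrix (suc m)) (r : Fin (suc m)) → det (M ∘ moveToTop r) ≡ sign (toℕ r) * det M
  det-moveToTop M zero = trans (det-cong {M = M ∘ moveToTop zero} {N = M} λ { zero j → refl ; (suc a) j → refl }) (sym (*-identityˡ (det M)))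
  det-moveToTop {zero}  M (suc ())
  det-moveToTop {suc m} M r = begin
      det (M ∘ moveToTop r)
    ≡⟨ det-laplace-col₀ (M ∘ moveToTop r) ⟩
      sign 0 * M r zero * det (minor r zero M) + ΣFin (λ k → sign (suc (toℕ k)) * M (punchIn r k) zero * det (minor (suc k) zero (M ∘ moveToTop r)))
    ≡⟨ cong₂ _+_ (sign-twice (sign (toℕ r)) (M r zero) (det (minor r zero M)) (sign*sign (toℕ r))) (ΣFin-cong term) ⟩
      sign (toℕ r) * T r + ΣFin (λ k → sign (toℕ r) * T (punchIn r k))
    ≡⟨ cong (_+_ (sign (toℕ r) * T r)) (ΣFin-*ˡ (sign (toℕ r)) (T ∘ punchIn r)) ⟩
      sign (toℕ r) * T r + sign (toℕ r) * ΣFin (T ∘ punchIn r)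
    ≡⟨ sym (*-distribˡ-+ (sign (toℕ r)) (T r) (ΣFin (T ∘ punchIn r))) ⟩
      sign (toℕ r) * (T r + ΣFin (T ∘ punchIn r))
    ≡⟨ cong (sign (toℕ r) *_) (sym (trans (det-laplace-col₀ M) (ΣFin-punchIn r T))) ⟩
      sign (toℕ r) * det M
    ∎
    where
    T : Fin (suc (suc m)) → ℤ
    T l = sign (toℕ l) * M l zero * det (minor l zero M)
    sign-twice : ∀ s x d → s * s ≡ + 1 → + 1 * x * d ≡ s * (s * x * d)
    sign-twice s x d s*s≡1 = trans (cong (λ u → u * x * d) (sym s*s≡1)) (reassoc s x d)
      where
      reassoc : ∀ s x d → s * s * x * d ≡ s * (s * x * d)
      reassoc = solve-∀
    term : ∀ k → sign (suc (toℕ k)) * M (punchIn r k) zero * det (minor (suc k) zero (M ∘ moveToTop r))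
                 ≡ sign (toℕ r) * T (punchIn r k)
    term k = begin
        sign (suc (toℕ k)) * M (punchIn r k) zero * det (minor (suc k) zero (M ∘ moveToTop r))
      ≡⟨ cong (sign (suc (toℕ k)) * M (punchIn r k) zero *_)
           (trans (det-cong (minor-moveToTop M r k)) (det-moveToTop Y (punchOutOf r k))) ⟩
        sign (suc (toℕ k)) * M (punchIn r k) zero * (sign (toℕ (punchOutOf r k)) * det Y)
      ≡⟨ regroup (sign (suc (toℕ k))) (M (punchIn r k) zero) (sign (toℕ (punchOutOf r k))) (det Y) ⟩
        sign (suc (toℕ k)) * sign (toℕ (punchOutOf r k)) * M (punchIn r k) zero * det Y
      ≡⟨ cong (λ s → s * M (punchIn r k) zero * det Y) (sign-punchOutOf r k) ⟩
        sign (toℕ r) * sign (toℕ (punchIn r k)) * M (punchIn r k) zero * det Y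
      ≡⟨ reassoc (sign (toℕ r)) (sign (toℕ (punchIn r k))) (M (punchIn r k) zero) (det Y) ⟩
        sign (toℕ r) * T (punchIn r k)
      ∎
      where
      Y = minor (punchIn r k) zero M
      regroup : ∀ a x b y → a * x * (b * y) ≡ a * b * x * y
      regroup = solve-∀
      reassoc : ∀ c d x y → c * d * x * y ≡ c * (d * x * y)
      reassoc = solve-∀

  det-equal-rows₀₁ : ∀ {m} (M : Matrix (suc (suc m))) → (∀ j → M zero j ≡ M (suc zero) j) → det M ≡ + 0
  det-equal-rows₀₁ {m} M M₀≗M₁ = begin
      det M
    ≡⟨ det-laplace-col₀ M ⟩
      + 1 * M zero zero * det (minor zero zero M) + (- + 1 * M (suc zero) zero * det (minor (suc zero) zero M) + ΣFin rest)
    ≡⟨ cong₂ (λ x y → + 1 * M zero zero * det (minor zero zero M) + (- + 1 * x * y + ΣFin rest))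
         (sym (M₀≗M₁ zero)) (det-cong {M = minor (suc zero) zero M} {N = minor zero zero M} λ { zero b → M₀≗M₁ (suc b) ; (suc a) b → refl }) ⟩
      + 1 * M zero zero * det (minor zero zero M) + (- + 1 * M zero zero * det (minor zero zero M) + ΣFin rest)
    ≡⟨ cong (λ y → + 1 * M zero zero * det (minor zero zero M) + (- + 1 * M zero zero * det (minor zero zero M) + y)) (rest≡0 m M M₀≗M₁) ⟩
      + 1 * M zero zero * det (minor zero zero M) + (- + 1 * M zero zero * det (minor zero zero M) + + 0)
    ≡⟨ cancel (M zero zero) (det (minor zero zero M)) ⟩
      + 0
    ∎
    where
    rest : Fin m → ℤ
    rest k = sign (toℕ (suc (suc k))) * M (suc (suc k)) zero * det (minor (suc (suc k)) zero M)
    cancel : ∀ x d → + 1 * x * d + (- + 1 * x * d + + 0) ≡ + 0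
    cancel = solve-∀
    rest≡0 : ∀ m (M : Matrix (suc (suc m))) → (∀ j → M zero j ≡ M (suc zero) j) →
             ΣFin (λ k → sign (toℕ (suc (suc k))) * M (suc (suc k)) zero * det (minor (suc (suc k)) zero M)) ≡ + 0
    rest≡0 zero    M M₀≗M₁ = refl
    rest≡0 (suc m) M M₀≗M₁ = ΣFin-zero _ λ k → trans
      (cong (sign (toℕ (suc (suc k))) * M (suc (suc k)) zero *_) (det-equal-rows₀₁ (minor (suc (suc k)) zero M) (M₀≗M₁ ∘ suc)))
      (*-zeroʳ (sign (toℕ (suc (suc k))) * M (suc (suc k)) zero))

  det-equal-rows₀ : ∀ {m} (M : Matrix (suc m)) (j : Fin m) → (∀ k → M zero k ≡ M (suc j) k) → det M ≡ + 0
  det-equal-rows₀ {suc m} M j M₀≗Mⱼ = begin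
    det M
      ≡⟨ sign-cancel (toℕ (suc j)) (det-moveToTop M (suc j)) ⟩
    sign (toℕ (suc j)) * det (M ∘ moveToTop (suc j))
      ≡⟨ cong (sign (toℕ (suc j)) *_) (det-equal-rows₀₁ (M ∘ moveToTop (suc j)) (sym ∘ M₀≗Mⱼ)) ⟩
    sign (toℕ (suc j)) * + 0
      ≡⟨ *-zeroʳ (sign (toℕ (suc j))) ⟩
    + 0 ∎

  det-equal-rows : ∀ {m} (M : Matrix m) {i j : Fin m} → i ≢ j → (∀ k → M i k ≡ M j k) → det M ≡ + 0
  det-equal-rows M {zero}  {zero}  i≢j Mᵢ≗Mⱼ = contradiction refl i≢j
  det-equal-rows M {zero}  {suc j} i≢j Mᵢ≗Mⱼ = det-equal-rows₀ M j Mᵢ≗Mⱼ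
  det-equal-rows M {suc i} {zero}  i≢j Mᵢ≗Mⱼ = det-equal-rows₀ M i (sym ∘ Mᵢ≗Mⱼ)
  det-equal-rows {suc m} M {suc i} {suc j} i≢j Mᵢ≗Mⱼ = ΣFin-zero _ λ k → trans
    (cong (sign (toℕ k) * M zero k *_) (det-equal-rows (minor zero k M) (i≢j ∘ cong suc) (Mᵢ≗Mⱼ ∘ punchIn k)))
    (*-zeroʳ (sign (toℕ k) * M zero k))

  det-add-row : ∀ {m} {u v : Fin m} → u ≢ v → (M N : Matrix m) (c : ℤ) →
                (∀ i j → i ≢ v → N i j ≡ M i j) → (∀ j → N v j ≡ M v j + c * M u j) → det N ≡ det M
  det-add-row {u = u} {v} u≢v M N c N≗M Nᵥ = begin
    det N
      ≡⟨ det-linear-row v N M P c (λ i j i≢v → sym (N≗M i j i≢v))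
                            (λ i j i≢v → trans (cong (_$ j) (updateAt-minimal i v M i≢v)) (sym (N≗M i j i≢v)))
                            (λ j → trans (Nᵥ j) (cong (λ x → M v j + c * x) (sym (cong (_$ j) (updateAt-updates v M))))) ⟩
    det M + c * det P
      ≡⟨ cong (λ x → det M + c * x) (det-equal-rows P u≢v (λ k → cong (_$ k) (trans (updateAt-minimal u v M u≢v) (sym (updateAt-updates v M))))) ⟩
    det M + c * + 0
      ≡⟨ trans (cong (_+_ (det M)) (*-zeroʳ c)) (+-identityʳ (det M)) ⟩
    det M ∎
    where
    P : Matrix _
    P = updateAt M v (const (M u))

  det-add-col : ∀ {m} {u v : Fin m} → u ≢ v → (M N : Matrix m) (c : ℤ) →
                (∀ i j → j ≢ v → N i j ≡ M i j) → (∀ i → N i v ≡ M i v + c * M i u) → det N ≡ det M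
  det-add-col u≢v M N c N≗M Nᵥ = begin
    det N              ≡⟨ sym (det-transpose N) ⟩
    det (transpose N)  ≡⟨ det-add-row u≢v (transpose M) (transpose N) c (λ i j → N≗M j i) Nᵥ ⟩
    det (transpose M)  ≡⟨ det-transpose M ⟩
    det M              ∎

  det-sparse-row : ∀ {m} (M : Matrix (suc m)) (r c : Fin (suc m)) → (∀ j → j ≢ c → M r j ≡ + 0) →
                   det M ≡ sign (toℕ r) * (sign (toℕ c) * M r c * det (minor r c M))
  det-sparse-row M r c Mᵣ≗0 = begin
    det M
      ≡⟨ sign-cancel (toℕ r) (det-moveToTop M r) ⟩
    sign (toℕ r) * det (M ∘ moveToTop r)
      ≡⟨ cong (sign (toℕ r) *_) (ΣFin-single c _ λ j j≢c →
                                                                trans (cong (λ x → sign (toℕ j) * x * det (minor r j M)) (Mᵣ≗0 j j≢c))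
                                                                      (cong (_* det (minor r j M)) (*-zeroʳ (sign (toℕ j))))) ⟩
    sign (toℕ r) * (sign (toℕ c) * M r c * det (minor r c M)) ∎

module ClassMatrix where

  open FinSum
  open Determinant
  open import Data.Bool using (Bool; true; false)
  open import Data.Bool.Properties as Bool using ()
  open import Data.Nat as ℕ using (ℕ; zero; suc; _∸_)
  open import Data.Nat.Properties as ℕ using ()
  open import Data.Fin as Fin using (Fin; zero; suc; toℕ; punchIn; punchOut)
  open import Data.Fin.Properties using (punchInᵢ≢i; punchIn-injective; punchIn-punchOut; any?)
  open import Data.Integer as ℤ using (ℤ; +_; -_; _+_; _*_; _-_; _^_)
  open import Data.Integer.Properties using (*-identityˡ; *-identityʳ; *-assoc; *-distribˡ-+; *-cancelʳ-≡; +-injective)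
  open import Data.Integer.Tactic.RingSolver using (solve-∀)
  open import Data.Product using (∃₂; _×_; _,_; proj₁; proj₂)
  open import Data.Sum using (_⊎_; inj₁; inj₂)
  open import Data.Vec.Functional using (updateAt)
  open import Data.Vec.Functional.Properties using (updateAt-updates; updateAt-minimal)
  open import Function.Base using (_∘_; _$_; const)
  open import Relation.Binary.Structures using (IsEquivalence)
  open import Relation.Binary.PropositionalEquality
  open import Relation.Nullary using (¬_; yes; no; ¬?)
  open import Relation.Nullary.Decidable using (_×-dec_; decidable-stable)
  open ≡-Reasoning

  classMatrix : ∀ {m} (s β γ : ℤ) (r : Fin m → Fin m → Bool) (w : Fin m → ℤ) → Matrix m
  classMatrix s β γ r w i j = s * δ i j + w j * (β + γ * ind (r i j))

  restrict : ∀ {m} (v : Fin (suc m)) → (Fin (suc m) → Fin (suc m) → Bool) → Fin m → Fin m → Bool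
  restrict v r a b = r (punchIn v a) (punchIn v b)

  -- Deleting index v and adding its weight to index u.
  mergeWeight : ∀ {m} (u v : Fin (suc m)) → (Fin (suc m) → ℤ) → Fin m → ℤ
  mergeWeight u v w b = w (punchIn v b) + δ (punchIn v b) u * w v

  ΣFin-mergeWeight : ∀ {m} {u v : Fin (suc m)} → u ≢ v → (f w : Fin (suc m) → ℤ) → f u ≡ f v →
                     ΣFin (λ b → f (punchIn v b) * mergeWeight u v w b) ≡ ΣFin (λ j → f j * w j)
  ΣFin-mergeWeight {m} {u} {v} u≢v f w fᵤ≡fᵥ = begin
      ΣFin (λ b → f (punchIn v b) * (w (punchIn v b) + δ (punchIn v b) u * w v))
    ≡⟨ ΣFin-cong (λ b → *-distribˡ-+ (f (punchIn v b)) (w (punchIn v b)) (δ (punchIn v b) u * w v)) ⟩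
      ΣFin (λ b → f (punchIn v b) * w (punchIn v b) + f (punchIn v b) * (δ (punchIn v b) u * w v))
    ≡⟨ ΣFin-+ (λ b → f (punchIn v b) * w (punchIn v b)) (λ b → f (punchIn v b) * (δ (punchIn v b) u * w v)) ⟩
      S + ΣFin (λ b → f (punchIn v b) * (δ (punchIn v b) u * w v))
    ≡⟨ cong (_+_ S) (ΣFin-single u′ (λ b → f (punchIn v b) * (δ (punchIn v b) u * w v)) only-u′) ⟩
      S + f (punchIn v u′) * (δ (punchIn v u′) u * w v)
    ≡⟨ cong (λ x → S + f x * (δ x u * w v)) v↑u′≡u ⟩
      S + f u * (δ u u * w v)
    ≡⟨ cong₂ (λ x y → S + x * (y * w v)) fᵤ≡fᵥ (δ-refl u) ⟩
      S + f v * (+ 1 * w v)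
    ≡⟨ reorder S (f v) (w v) ⟩
      f v * w v + S
    ≡⟨ sym (ΣFin-punchIn v (λ j → f j * w j)) ⟩
      ΣFin (λ j → f j * w j)
    ∎
    where
    S = ΣFin (λ b → f (punchIn v b) * w (punchIn v b))
    reorder : ∀ s a b → s + a * (+ 1 * b) ≡ a * b + s
    reorder = solve-∀
    u′ : Fin m
    u′ = punchOut (u≢v ∘ sym)
    v↑u′≡u : punchIn v u′ ≡ u
    v↑u′≡u = punchIn-punchOut (u≢v ∘ sym)
    only-u′ : ∀ b → b ≢ u′ → f (punchIn v b) * (δ (punchIn v b) u * w v) ≡ + 0
    only-u′ b b≢u′ = trans (cong (λ x → f (punchIn v b) * (x * w v)) (δ-≢ (b≢u′ ∘ punchIn-injective v b u′ ∘ v↑b≡v↑u′)))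
                           (a*[0*c] (f (punchIn v b)) (w v))
      where
      v↑b≡v↑u′ : punchIn v b ≡ u → punchIn v b ≡ punchIn v u′
      v↑b≡v↑u′ e = trans e (sym v↑u′≡u)
      a*[0*c] : ∀ a c → a * (+ 0 * c) ≡ + 0
      a*[0*c] = solve-∀

  -- Subtracting row u from row v and then adding column v to column u leaves s in
  -- position (v , v) as the only nonzero entry of row v; the complementary minor is
  -- again a class matrix, with v merged into u.
  module _ {m} (s β γ : ℤ) (r : Fin (suc m) → Fin (suc m) → Bool) (w : Fin (suc m) → ℤ)
           {u v : Fin (suc m)} (u≢v : u ≢ v)
           (rᵤ≗rᵥ : ∀ j → r u j ≡ r v j) (r·ᵤ≗r·ᵥ : ∀ i → r i u ≡ r i v) where

    private
      M₀ M₁ M₂ : Matrix (suc m)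
      M₀ = classMatrix s β γ r w
      M₁ = updateAt M₀ v (const (λ j → M₀ v j + - + 1 * M₀ u j))
      M₂ i = updateAt (M₁ i) u (const (M₁ i u + + 1 * M₁ i v))

      M₁-v : ∀ j → M₁ v j ≡ s * δ v j - s * δ u j
      M₁-v j = begin
        M₁ v j
          ≡⟨ cong (_$ j) (updateAt-updates v M₀) ⟩
        s * δ v j + w j * (β + γ * ind (r v j)) + - + 1 * (s * δ u j + w j * (β + γ * ind (r u j)))
          ≡⟨ cong (λ b → s * δ v j + w j * (β + γ * ind (r v j)) + - + 1 * (s * δ u j + w j * (β + γ * ind b))) (rᵤ≗rᵥ j) ⟩
        s * δ v j + w j * (β + γ * ind (r v j)) + - + 1 * (s * δ u j + w j * (β + γ * ind (r v j)))
          ≡⟨ cancel s (δ v j) (δ u j) (w j * (β + γ * ind (r v j))) ⟩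
        s * δ v j - s * δ u j ∎
        where
        cancel : ∀ s a b x → s * a + x + - + 1 * (s * b + x) ≡ s * a - s * b
        cancel = solve-∀

      rowᵥ : ℤ → ℤ → ℤ → ℤ
      rowᵥ a b c = s * a - s * b + c * s

      rowᵥ-cong : ∀ {a b c a′ b′ c′} → a ≡ a′ → b ≡ b′ → c ≡ c′ → rowᵥ a b c ≡ rowᵥ a′ b′ c′
      rowᵥ-cong refl refl refl = refl

      M₂-v : ∀ j → M₂ v j ≡ rowᵥ (δ v j) (δ u j) (δ j u)
      M₂-v j with j Fin.≟ u
      ... | yes refl = begin
        M₂ v j
          ≡⟨ updateAt-updates j (M₁ v) ⟩
        M₁ v j + + 1 * M₁ v v
          ≡⟨ cong₂ (λ x y → x + + 1 * y) (M₁-v j) (M₁-v v) ⟩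
        s * δ v j - s * δ j j + + 1 * (s * δ v v - s * δ j v)
          ≡⟨ cong₂ (λ x y → s * δ v j - s * δ j j + + 1 * (s * x - s * y)) (δ-refl v) (δ-≢ u≢v) ⟩
        s * δ v j - s * δ j j + + 1 * (s * + 1 - s * + 0)
          ≡⟨ simplify (s * δ v j - s * δ j j) s ⟩
        s * δ v j - s * δ j j + + 1 * s ∎
        where
        simplify : ∀ x s → x + + 1 * (s * + 1 - s * + 0) ≡ x + + 1 * s
        simplify = solve-∀
      ... | no  j≢u  = begin
        M₂ v j                                                 ≡⟨ updateAt-minimal j u (M₁ v) j≢u ⟩
        M₁ v j                                                 ≡⟨ M₁-v j ⟩
        s * δ v j - s * δ u j                                  ≡⟨ sym (x+0*s (s * δ v j - s * δ u j) s) ⟩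
        s * δ v j - s * δ u j + + 0 * s                        ∎
        where
        x+0*s : ∀ x s → x + + 0 * s ≡ x
        x+0*s = solve-∀

      M₂-vv : M₂ v v ≡ s
      M₂-vv = trans (M₂-v v) (trans (rowᵥ-cong (δ-refl v) (δ-≢ u≢v) (δ-≢ (u≢v ∘ sym))) (simplify s))
        where
        simplify : ∀ s → s * + 1 - s * + 0 + + 0 * s ≡ s
        simplify = solve-∀

      M₂-v≢v : ∀ j → j ≢ v → M₂ v j ≡ + 0
      M₂-v≢v j j≢v with j Fin.≟ u
      ... | yes refl = trans (M₂-v j) (trans (rowᵥ-cong (δ-≢ (u≢v ∘ sym)) (δ-refl j) (δ-refl j)) (cancel s))
        where
        cancel : ∀ s → s * + 0 - s * + 1 + + 1 * s ≡ + 0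
        cancel = solve-∀
      ... | no j≢u = trans (M₂-v j) (trans (rowᵥ-cong (δ-≢ (j≢v ∘ sym)) (δ-≢ (j≢u ∘ sym)) (δ-≢ j≢u)) (cancel s))
        where
        cancel : ∀ s → s * + 0 - s * + 0 + + 0 * s ≡ + 0
        cancel = solve-∀

      M₂-off-v : ∀ i j → i ≢ v → M₂ i j ≡ M₀ i j + δ j u * M₀ i v
      M₂-off-v i j i≢v with j Fin.≟ u
      ... | yes refl = trans (updateAt-updates j (M₁ i)) (cong₂ (λ x y → x + + 1 * y) (M₁-off-v j) (M₁-off-v v))
        where
        M₁-off-v : ∀ k → M₁ i k ≡ M₀ i k
        M₁-off-v k = cong (_$ k) (updateAt-minimal i v M₀ i≢v)
      ... | no  j≢u  = trans (updateAt-minimal j u (M₁ i) j≢u) (trans (cong (_$ j) (updateAt-minimal i v M₀ i≢v)) (sym (x+0*y (M₀ i j) (M₀ i v))))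
        where
        x+0*y : ∀ x y → x + + 0 * y ≡ x
        x+0*y = solve-∀

      δ*M₀-v : ∀ i j → i ≢ v → δ j u * M₀ i v ≡ δ j u * (w v * (β + γ * ind (r i j)))
      δ*M₀-v i j i≢v with j Fin.≟ u
      ... | yes refl = cong (+ 1 *_) (begin
        s * δ i v + w v * (β + γ * ind (r i v))
          ≡⟨ cong₂ (λ d b → s * d + w v * (β + γ * ind b)) (δ-≢ i≢v) (sym (r·ᵤ≗r·ᵥ i)) ⟩
        s * + 0 + w v * (β + γ * ind (r i j))
          ≡⟨ s*0+x s (w v * (β + γ * ind (r i j))) ⟩
        w v * (β + γ * ind (r i j)) ∎)
        where
        s*0+x : ∀ s x → s * + 0 + x ≡ x
        s*0+x = solve-∀
      ... | no  _    = 0*x≡0*y (M₀ i v) (w v * (β + γ * ind (r i j)))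
        where
        0*x≡0*y : ∀ x y → + 0 * x ≡ + 0 * y
        0*x≡0*y = solve-∀

      M₂-minor : ∀ a b → M₂ (punchIn v a) (punchIn v b) ≡ classMatrix s β γ (restrict v r) (mergeWeight u v w) a b
      M₂-minor a b = begin
        M₂ i j
          ≡⟨ M₂-off-v i j (punchInᵢ≢i v a) ⟩
        M₀ i j + δ j u * M₀ i v
          ≡⟨ cong (_+_ (M₀ i j)) (δ*M₀-v i j (punchInᵢ≢i v a)) ⟩
        s * δ i j + w j * K + δ j u * (w v * K)
          ≡⟨ collect s (δ i j) (w j) (δ j u) (w v) K ⟩
        s * δ i j + (w j + δ j u * w v) * K
          ≡⟨ cong (λ d → s * d + (w j + δ j u * w v) * K) (δ-punchIn v a b) ⟩
        s * δ a b + (w j + δ j u * w v) * K ∎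
        where
        i = punchIn v a
        j = punchIn v b
        K = β + γ * ind (r i j)
        collect : ∀ s d x e y k → s * d + x * k + e * (y * k) ≡ s * d + (x + e * y) * k
        collect = solve-∀

    det-classMatrix-merge : det (classMatrix s β γ r w) ≡ s * det (classMatrix s β γ (restrict v r) (mergeWeight u v w))
    det-classMatrix-merge = begin
      det M₀
        ≡⟨ sym (det-add-row u≢v M₀ M₁ (- + 1) (λ i j i≢v → cong (_$ j) (updateAt-minimal i v M₀ i≢v))
                                                                                             (λ j → cong (_$ j) (updateAt-updates v M₀))) ⟩
      det M₁
        ≡⟨ sym (det-add-col (u≢v ∘ sym) M₁ M₂ (+ 1) (λ i j j≢u → updateAt-minimal j u (M₁ i) j≢u)
                                                                                                   (λ i → updateAt-updates u (M₁ i))) ⟩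
      det M₂
        ≡⟨ det-sparse-row M₂ v v M₂-v≢v ⟩
      sign (toℕ v) * (sign (toℕ v) * M₂ v v * det (minor v v M₂))
        ≡⟨ cong (λ x → sign (toℕ v) * (sign (toℕ v) * x * det (minor v v M₂))) M₂-vv ⟩
      sign (toℕ v) * (sign (toℕ v) * s * det (minor v v M₂))
        ≡⟨ sign-twice (sign (toℕ v)) s (det (minor v v M₂)) (sign*sign (toℕ v)) ⟩
      s * det (minor v v M₂)
        ≡⟨ cong (s *_) (det-cong M₂-minor) ⟩
      s * det (classMatrix s β γ (restrict v r) (mergeWeight u v w)) ∎
      where
      sign-twice : ∀ σ s d → σ * σ ≡ + 1 → σ * (σ * s * d) ≡ s * d
      sign-twice σ s d σ²≡1 = trans (reassoc σ s d) (trans (cong (λ x → x * s * d) σ²≡1) (cong (_* d) (*-identityˡ s)))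
        where
        reassoc : ∀ σ s d → σ * (σ * s * d) ≡ σ * σ * s * d
        reassoc = solve-∀

  ΣFin-mergeWeight₁ : ∀ {m} {u v : Fin (suc m)} → u ≢ v → (w : Fin (suc m) → ℤ) → ΣFin (mergeWeight u v w) ≡ ΣFin w
  ΣFin-mergeWeight₁ {u = u} {v} u≢v w = begin
    ΣFin (mergeWeight u v w)                     ≡⟨ ΣFin-cong (λ b → sym (*-identityˡ (mergeWeight u v w b))) ⟩
    ΣFin (λ b → + 1 * mergeWeight u v w b)       ≡⟨ ΣFin-mergeWeight u≢v (const (+ 1)) w refl ⟩
    ΣFin (λ j → + 1 * w j)                       ≡⟨ ΣFin-cong (λ j → *-identityˡ (w j)) ⟩
    ΣFin w                                       ∎

  total : ∀ {m} → Fin m → Fin m → Bool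
  total _ _ = true

  det-classMatrix-total : ∀ m (x y : ℤ) (w : Fin (suc m) → ℤ) →
                          det (classMatrix x y (+ 0) total w) ≡ x ^ m * (x + y * ΣFin w)
  det-classMatrix-total zero    x y w = trans (cong (λ d → + 1 * (x * d + w zero * (y + + 0 * + 1)) * + 1 + + 0) (δ-refl {1} zero)) (simplify x y (w zero))
    where
    simplify : ∀ x y w → + 1 * (x * + 1 + w * (y + + 0 * + 1)) * + 1 + + 0 ≡ + 1 * (x + y * (w + + 0))
    simplify = solve-∀
  det-classMatrix-total (suc m) x y w = begin
    det (classMatrix x y (+ 0) total w)
      ≡⟨ det-classMatrix-merge x y (+ 0) total w 1≢0 (λ _ → refl) (λ _ → refl) ⟩
    x * det (classMatrix x y (+ 0) total w′)
      ≡⟨ cong (x *_) (det-classMatrix-total m x y w′) ⟩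
    x * (x ^ m * (x + y * ΣFin w′))
      ≡⟨ cong (λ S → x * (x ^ m * (x + y * S))) (ΣFin-mergeWeight₁ 1≢0 w) ⟩
    x * (x ^ m * (x + y * ΣFin w))
      ≡⟨ sym (*-assoc x (x ^ m) (x + y * ΣFin w)) ⟩
    x ^ suc m * (x + y * ΣFin w) ∎
    where
    1≢0 : suc zero ≢ zero
    1≢0 ()
    w′ = mergeWeight (suc zero) zero w

  sameClassPair? : ∀ {m} (r : Fin m → Fin m → Bool) →
                   (∃₂ λ u v → u ≢ v × r u v ≡ true) ⊎ (∀ u v → r u v ≡ true → u ≡ v)
  sameClassPair? r with any? (λ u → any? (λ v → ¬? (u Fin.≟ v) ×-dec (r u v Bool.≟ true)))
  ... | yes (u , v , u≢v , ruv) = inj₁ (u , v , u≢v , ruv)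
  ... | no  ∄pair               = inj₂ λ u v ruv → decidable-stable (u Fin.≟ v) (λ u≢v → ∄pair (u , v , u≢v , ruv))

  -- r has q + 1 classes, each of total weight W. Merging two related indices peels off a
  -- factor s (det-classMatrix-merge) until r is discrete, when the matrix is (s + γW)·I + βW·J.
  module _ (q : ℕ) (s β γ W : ℤ) (W≢0 : W ≢ + 0) where

    private
      x y G : ℤ
      x = s + γ * W
      y = β * W
      G = x ^ q * (x + y * + suc q)

    det-classMatrix-discrete : ∀ {m} (r : Fin m → Fin m → Bool) (w : Fin m → ℤ) →
      (∀ i → r i i ≡ true) → (∀ u v → r u v ≡ true → u ≡ v) →
      (∀ i → ΣFin (λ j → ind (r i j) * w j) ≡ W) → ΣFin w ≡ + suc q * W →
      m ≡ suc q × det (classMatrix s β γ r w) ≡ G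
    det-classMatrix-discrete {m} r w r-refl r-discrete classWeight totalWeight =
      m≡1+q , trans (det-cong classMatrix≗) (det-total m≡1+q)
      where
      ind≗δ : ∀ i j → ind (r i j) ≡ δ i j
      ind≗δ i j with i Fin.≟ j
      ... | yes refl = cong ind (r-refl i)
      ... | no  i≢j  = cong ind (Bool.¬-not (i≢j ∘ r-discrete i j))
      w≗W : ∀ i → w i ≡ W
      w≗W i = begin
        w i
          ≡⟨ sym (*-identityˡ (w i)) ⟩
        + 1 * w i
          ≡⟨ cong (_* w i) (sym (trans (ind≗δ i i) (δ-refl i))) ⟩
        ind (r i i) * w i
          ≡⟨ sym (ΣFin-single i (λ j → ind (r i j) * w j) (λ j j≢i → cong (_* w j) (trans (ind≗δ i j) (δ-≢ (j≢i ∘ sym))))) ⟩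
        ΣFin (λ j → ind (r i j) * w j)
          ≡⟨ classWeight i ⟩
        W ∎
      m≡1+q : m ≡ suc q
      m≡1+q = +-injective (*-cancelʳ-≡ (+ m) (+ suc q) W {{ℤ.≢-nonZero W≢0}}
                (trans (sym (ΣFin-const m W)) (trans (sym (ΣFin-cong w≗W)) totalWeight)))
      classMatrix≗ : ∀ i j → classMatrix s β γ r w i j ≡ classMatrix x y (+ 0) total (const (+ 1)) i j
      classMatrix≗ i j = trans (cong₂ (λ a b → s * δ i j + a * (β + γ * b)) (w≗W j) (ind≗δ i j)) (regroup s (δ i j) W β γ)
        where
        regroup : ∀ s d W β γ → s * d + W * (β + γ * d) ≡ (s + γ * W) * d + + 1 * (β * W + + 0 * + 1)
        regroup = solve-∀
      det-total : ∀ {m} → m ≡ suc q → det (classMatrix {m} x y (+ 0) total (const (+ 1))) ≡ x ^ q * (x + y * + suc q)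
      det-total refl = trans (det-classMatrix-total q x y (const (+ 1)))
                             (cong (λ S → x ^ q * (x + y * S)) (trans (ΣFin-const (suc q) (+ 1)) (*-identityʳ (+ suc q))))

    det-classMatrix : ∀ {m} (r : Fin m → Fin m → Bool) (w : Fin m → ℤ) → IsEquivalence (λ i j → r i j ≡ true) →
      (∀ i → ΣFin (λ j → ind (r i j) * w j) ≡ W) → ΣFin w ≡ + suc q * W →
      suc q ℕ.≤ m × det (classMatrix s β γ r w) ≡ s ^ (m ∸ suc q) * G
    det-classMatrix {m} r w r-equiv classWeight totalWeight with sameClassPair? r
    ... | inj₂ r-discrete = ℕ.≤-reflexive (sym m≡1+q) , (begin
        det (classMatrix s β γ r w)   ≡⟨ det≡ ⟩
        G                             ≡⟨ sym (*-identityˡ G) ⟩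
        s ^ 0 * G                     ≡⟨ cong (λ k → s ^ k * G) (sym (ℕ.n∸n≡0 (suc q))) ⟩
        s ^ (suc q ∸ suc q) * G       ≡⟨ cong (λ k → s ^ (k ∸ suc q) * G) (sym m≡1+q) ⟩
        s ^ (m ∸ suc q) * G           ∎)
      where
      discrete = det-classMatrix-discrete r w (λ i → IsEquivalence.refl r-equiv) r-discrete classWeight totalWeight
      m≡1+q = proj₁ discrete
      det≡ = proj₂ discrete
    det-classMatrix {suc m} r w r-equiv classWeight totalWeight | inj₁ (u , v , u≢v , ruv) =
      ℕ.m≤n⇒m≤1+n (proj₁ IH) ,
      (begin
        det (classMatrix s β γ r w)
          ≡⟨ det-classMatrix-merge s β γ r w u≢v rᵤ≗rᵥ r·ᵤ≗r·ᵥ ⟩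
        s * det (classMatrix s β γ (restrict v r) (mergeWeight u v w))
          ≡⟨ cong (s *_) (proj₂ IH) ⟩
        s * (s ^ (m ∸ suc q) * G)
          ≡⟨ sym (*-assoc s (s ^ (m ∸ suc q)) G) ⟩
        s ^ suc (m ∸ suc q) * G
          ≡⟨ cong (λ k → s ^ k * G) (sym (ℕ.+-∸-assoc 1 (proj₁ IH))) ⟩
        s ^ (suc m ∸ suc q) * G ∎)
      where
      module R = IsEquivalence r-equiv
      bool-ext : ∀ {a b : Bool} → (a ≡ true → b ≡ true) → (b ≡ true → a ≡ true) → a ≡ b
      bool-ext {true}  a→b b→a = sym (a→b refl)
      bool-ext {false} {true}  a→b b→a = b→a refl
      bool-ext {false} {false} a→b b→a = refl
      rᵤ≗rᵥ : ∀ j → r u j ≡ r v j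
      rᵤ≗rᵥ j = bool-ext (R.trans (R.sym ruv)) (R.trans ruv)
      r·ᵤ≗r·ᵥ : ∀ i → r i u ≡ r i v
      r·ᵤ≗r·ᵥ i = bool-ext (λ riu → R.trans riu ruv) (λ riv → R.trans riv (R.sym ruv))
      restrict-isEquivalence : IsEquivalence (λ a b → restrict v r a b ≡ true)
      restrict-isEquivalence = record { refl = R.refl ; sym = R.sym ; trans = R.trans }
      IH = det-classMatrix (restrict v r) (mergeWeight u v w) restrict-isEquivalence
             (λ a → trans (ΣFin-mergeWeight u≢v (λ j → ind (r (punchIn v a) j)) w (cong ind (r·ᵤ≗r·ᵥ (punchIn v a)))) (classWeight (punchIn v a)))
             (trans (ΣFin-mergeWeight₁ u≢v w) totalWeight)

module CompleteMultipartiteGraphs where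

  open FinSum
  open Determinant using (det-cong)
  open ClassMatrix using (classMatrix; det-classMatrix)
  open import Data.Bool using (Bool; true)
  open import Data.Nat as ℕ using (ℕ; zero; suc; _∸_; NonZero)
  open import Data.Nat.Properties as ℕ using ()
  import Data.Nat.Tactic.RingSolver as ℕ-Solver
  open import Data.Fin using (Fin)
  open import Data.Integer as ℤ using (ℤ; +_; -_; _+_; _*_; _-_; _^_; ∣_∣; +0; +[1+_]; -[1+_])
  open import Data.Integer.Properties as ℤ using ()
  open import Data.Integer.Tactic.RingSolver using (solve-∀)
  open import Data.Rational as ℚ using (ℚ; mkℚ)
  open import Data.Rational.Properties as ℚ using ()
  open import Data.Rational.Unnormalised using (mkℚᵘ; *≡*)
  open import Data.Nat.Coprimality as Coprime using (1-coprimeTo)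
  open import Data.List using (List; []; _∷_; _++_; replicate; length; map; foldr)
  open import Data.Nat.ListAction using (sum)
  open import Data.List.Properties using (length-++; length-replicate; map-++; map-replicate)
  open import Data.Product using (_,_; proj₁; proj₂)
  open import Function.Base using (const)
  open import Relation.Binary.Structures using (IsEquivalence)
  open import Relation.Binary.PropositionalEquality using (_≡_; _≢_; refl; sym; trans; cong; cong₂; subst; module ≡-Reasoning)
  open ≡-Reasoning

  sumℤ : List ℤ → ℤ
  sumℤ = foldr _+_ (+ 0)

  length-multiset : ∀ xs → length (multiset xs) ≡ sum (map proj₂ xs)
  length-multiset []             = refl
  length-multiset ((a , k) ∷ xs) = trans (length-++ (replicate k a)) (cong₂ ℕ._+_ (length-replicate k) (length-multiset xs))

  prodℤ-++ : ∀ xs ys → prodℤ (xs ++ ys) ≡ prodℤ xs * prodℤ ys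
  prodℤ-++ []       ys = sym (ℤ.*-identityˡ (prodℤ ys))
  prodℤ-++ (x ∷ xs) ys = trans (cong (x *_) (prodℤ-++ xs ys)) (sym (ℤ.*-assoc x (prodℤ xs) (prodℤ ys)))

  prodℤ-replicate : ∀ k x → prodℤ (replicate k x) ≡ x ^ k
  prodℤ-replicate zero    x = refl
  prodℤ-replicate (suc k) x = cong (x *_) (prodℤ-replicate k x)

  sumℤ-++ : ∀ xs ys → sumℤ (xs ++ ys) ≡ sumℤ xs + sumℤ ys
  sumℤ-++ []       ys = sym (ℤ.+-identityˡ (sumℤ ys))
  sumℤ-++ (x ∷ xs) ys = trans (cong (_+_ x) (sumℤ-++ xs ys)) (sym (ℤ.+-assoc x (sumℤ xs) (sumℤ ys)))

  sumℤ-replicate : ∀ k x → sumℤ (replicate k x) ≡ + k * x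
  sumℤ-replicate zero    x = sym (ℤ.*-zeroˡ x)
  sumℤ-replicate (suc k) x = trans (cong (_+_ x) (sumℤ-replicate k x)) (x+kx≡[1+k]x (+ k) x)
    where
    x+kx≡[1+k]x : ∀ k x → x + k * x ≡ (+ 1 + k) * x
    x+kx≡[1+k]x = solve-∀

  prodℤ-map-multiset : ∀ (f : ℤ → ℤ) xs → prodℤ (map f (multiset xs)) ≡ prodℤ (map (λ ak → f (proj₁ ak) ^ proj₂ ak) xs)
  prodℤ-map-multiset f []             = refl
  prodℤ-map-multiset f ((a , k) ∷ xs) = begin
    prodℤ (map f (replicate k a ++ multiset xs))
      ≡⟨ cong prodℤ (map-++ f (replicate k a) (multiset xs)) ⟩
    prodℤ (map f (replicate k a) ++ map f (multiset xs))
      ≡⟨ prodℤ-++ (map f (replicate k a)) (map f (multiset xs)) ⟩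
    prodℤ (map f (replicate k a)) * prodℤ (map f (multiset xs))
      ≡⟨ cong₂ _*_ (trans (cong prodℤ (map-replicate f k a)) (prodℤ-replicate k (f a)))
                                                                             (prodℤ-map-multiset f xs) ⟩
    f a ^ k * prodℤ (map (λ ak → f (proj₁ ak) ^ proj₂ ak) xs)    ∎

  sumℤ-map-multiset : ∀ (f : ℤ → ℤ) xs → sumℤ (map f (multiset xs)) ≡ sumℤ (map (λ ak → + proj₂ ak * f (proj₁ ak)) xs)
  sumℤ-map-multiset f []             = refl
  sumℤ-map-multiset f ((a , k) ∷ xs) = begin
    sumℤ (map f (replicate k a ++ multiset xs))
      ≡⟨ cong sumℤ (map-++ f (replicate k a) (multiset xs)) ⟩
    sumℤ (map f (replicate k a) ++ map f (multiset xs))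
      ≡⟨ sumℤ-++ (map f (replicate k a)) (map f (multiset xs)) ⟩
    sumℤ (map f (replicate k a)) + sumℤ (map f (multiset xs))
      ≡⟨ cong₂ _+_ (trans (cong sumℤ (map-replicate f k a)) (sumℤ-replicate k (f a)))
                                                                           (sumℤ-map-multiset f xs) ⟩
    + k * f a + sumℤ (map (λ ak → + proj₂ ak * f (proj₁ ak)) xs) ∎

  ℤtoℚ-mkℚ : ∀ a → ℤtoℚ a ≡ mkℚ a 0 (Coprime.sym (1-coprimeTo ∣ a ∣))
  ℤtoℚ-mkℚ a = ℚ.↥p/↧p≡p (mkℚ a 0 (Coprime.sym (1-coprimeTo ∣ a ∣)))

  ℤtoℚ-+ : ∀ a b → ℤtoℚ a ℚ.+ ℤtoℚ b ≡ ℤtoℚ (a + b)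
  ℤtoℚ-+ a b = trans (cong₂ ℚ._+_ (ℤtoℚ-mkℚ a) (ℤtoℚ-mkℚ b)) (cong (λ x → x ℚ./ 1) (cong₂ _+_ (ℤ.*-identityʳ a) (ℤ.*-identityʳ b)))

  ℤtoℚ-∣∣ : ∀ a → ℚ.∣ ℤtoℚ a ∣ ≡ ℤtoℚ (+ ∣ a ∣)
  ℤtoℚ-∣∣ a = trans (cong ℚ.∣_∣ (ℤtoℚ-mkℚ a)) (sym (ℤtoℚ-mkℚ (+ ∣ a ∣)))

  ℤtoℚ-neg : ∀ a → ℚ.- ℤtoℚ a ≡ ℤtoℚ (- a)
  ℤtoℚ-neg a = trans (cong ℚ.-_ (ℤtoℚ-mkℚ a)) (trans (neg-mkℚ a) (sym (ℤtoℚ-mkℚ (- a))))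
    where
    neg-mkℚ : ∀ a → ℚ.- mkℚ a 0 (Coprime.sym (1-coprimeTo ∣ a ∣)) ≡ mkℚ (- a) 0 (Coprime.sym (1-coprimeTo ∣ - a ∣))
    neg-mkℚ +0       = refl
    neg-mkℚ +[1+ n ] = refl
    neg-mkℚ -[1+ n ] = refl

  ℤtoℚ-- : ∀ a b → ℤtoℚ a ℚ.- ℤtoℚ b ≡ ℤtoℚ (a - b)
  ℤtoℚ-- a b = trans (cong (ℤtoℚ a ℚ.+_) (ℤtoℚ-neg b)) (ℤtoℚ-+ a (- b))

  sumℚ-map-ℤtoℚ : ∀ (h : ℤ → ℚ) (g : ℤ → ℤ) → (∀ a → h a ≡ ℤtoℚ (g a)) → ∀ xs → sumℚ (map h xs) ≡ ℤtoℚ (sumℤ (map g xs))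
  sumℚ-map-ℤtoℚ h g h≗g []       = refl
  sumℚ-map-ℤtoℚ h g h≗g (x ∷ xs) = trans (cong₂ ℚ._+_ (h≗g x) (sumℚ-map-ℤtoℚ h g h≗g xs)) (ℤtoℚ-+ (g x) (sumℤ (map g xs)))

  avgDegree-regular : ∀ {m} (A : Matrix m) d → .{{NonZero m}} → (∀ i → degree A i ≡ + d) → avgDegree A ≡ ℤtoℚ (+ d)
  avgDegree-regular {suc m} A d deg≡d = trans
    (cong (λ x → x ℚ./ suc m) (trans (ΣFin-cong deg≡d) (trans (ΣFin-const (suc m) (+ d)) (sym (ℤ.pos-* (suc m) d)))))
    (ℚ.fromℚᵘ-cong {mkℚᵘ (+ (suc m ℕ.* d)) m} {mkℚᵘ (+ d) 0}
      (*≡* (trans (ℤ.*-identityʳ (+ (suc m ℕ.* d))) (trans (ℤ.pos-* (suc m) d) (ℤ.*-comm (+ suc m) (+ d))))))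

  record CompleteMultipartite {m} (A : Matrix m) (parts size : ℕ) : Set where
    field
      sameSide      : Fin m → Fin m → Bool
      isEquivalence : IsEquivalence (λ i j → sameSide i j ≡ true)
      adjacency     : ∀ i j → A i j ≡ + 1 - ind (sameSide i j)
      partSize      : ∀ i → ΣFin (λ j → ind (sameSide i j)) ≡ + size
      order         : m ≡ parts ℕ.* size

  module CompleteMultipartite-spectra {m} {A : Matrix m} {q n : ℕ} .{{n≢0 : NonZero n}}
                                      (K : CompleteMultipartite A (q ℕ.+ 1) n) where

    open CompleteMultipartite K

    private
      k : ℕ
      k = (q ℕ.+ 1) ℕ.* (n ∸ 1)

      nq : ℤ
      nq = + (n ℕ.* q)

      nq≡ : nq ≡ + n * + q
      nq≡ = ℤ.pos-* n q

      k+q+1≡m : k ℕ.+ (q ℕ.+ 1) ≡ m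
      k+q+1≡m = begin
        (q ℕ.+ 1) ℕ.* (n ∸ 1) ℕ.+ (q ℕ.+ 1)   ≡⟨ ℕ.+-comm k (q ℕ.+ 1) ⟩
        (q ℕ.+ 1) ℕ.+ (q ℕ.+ 1) ℕ.* (n ∸ 1)   ≡⟨ sym (ℕ.*-suc (q ℕ.+ 1) (n ∸ 1)) ⟩
        (q ℕ.+ 1) ℕ.* suc (n ∸ 1)             ≡⟨ cong ((q ℕ.+ 1) ℕ.*_) (ℕ.suc-pred n) ⟩
        (q ℕ.+ 1) ℕ.* n                       ≡⟨ sym order ⟩
        m                                     ∎

      m∸[1+q]≡k : m ∸ suc q ≡ k
      m∸[1+q]≡k = begin
        m ∸ suc q                  ≡⟨ cong₂ _∸_ (sym k+q+1≡m) (ℕ.+-comm 1 q) ⟩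
        k ℕ.+ (q ℕ.+ 1) ∸ (q ℕ.+ 1) ≡⟨ ℕ.m+n∸n≡m k (q ℕ.+ 1) ⟩
        k                          ∎

      sizes≡ : ΣFin (λ (_ : Fin m) → + 1) ≡ + suc q * + n
      sizes≡ = begin
        ΣFin (λ (_ : Fin m) → + 1)  ≡⟨ ΣFin-const m (+ 1) ⟩
        + m * + 1                   ≡⟨ ℤ.*-identityʳ (+ m) ⟩
        + m                         ≡⟨ cong +_ (trans order (cong (ℕ._* n) (ℕ.+-comm q 1))) ⟩
        + (suc q ℕ.* n)             ≡⟨ ℤ.pos-* (suc q) n ⟩
        + suc q * + n               ∎

      partWeight : ∀ i → ΣFin (λ j → ind (sameSide i j) * + 1) ≡ + n
      partWeight i = trans (ΣFin-cong (λ j → ℤ.*-identityʳ (ind (sameSide i j)))) (partSize i)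

      n≢0ℤ : + n ≢ + 0
      n≢0ℤ n≡0 = ℕ.≢-nonZero⁻¹ n (ℤ.+-injective n≡0)

    degree≡ : ∀ i → degree A i ≡ nq
    degree≡ i = begin
      ΣFin (A i)                                         ≡⟨ ΣFin-cong (adjacency i) ⟩
      ΣFin (λ j → + 1 - ind (sameSide i j))              ≡⟨ ΣFin-- (const (+ 1)) (λ j → ind (sameSide i j)) ⟩
      ΣFin (λ (_ : Fin m) → + 1) - ΣFin (λ j → ind (sameSide i j)) ≡⟨ cong₂ _-_ sizes≡ (partSize i) ⟩
      + suc q * + n - + n                                ≡⟨ [1+q]n-n (+ q) (+ n) ⟩
      + n * + q                                          ≡⟨ sym nq≡ ⟩
      nq                                                 ∎
      where
      [1+q]n-n : ∀ q n → (+ 1 + q) * n - n ≡ n * q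
      [1+q]n-n = solve-∀

    avgDegree≡ : avgDegree A ≡ ℤtoℚ nq
    avgDegree≡ = avgDegree-regular A (n ℕ.* q) {{subst NonZero (sym order) (ℕ.m*n≢0 (q ℕ.+ 1) n {{ℕ.≢-nonZero (ℕ.m+1+n≢0 q)}})}} degree≡

    det-shifted : ∀ (M : Matrix m) (s β γ : ℤ) → (∀ i j → M i j ≡ classMatrix s β γ sameSide (const (+ 1)) i j) →
                  det M ≡ s ^ k * ((s + γ * + n) ^ q * (s + γ * + n + β * + n * + suc q))
    det-shifted M s β γ M≗ = begin
      det M
        ≡⟨ det-cong M≗ ⟩
      det (classMatrix s β γ sameSide (const (+ 1)))
        ≡⟨ proj₂ (det-classMatrix q s β γ (+ n) n≢0ℤ sameSide (const (+ 1)) isEquivalence partWeight sizes≡) ⟩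
      s ^ (m ∸ suc q) * ((s + γ * + n) ^ q * (s + γ * + n + β * + n * + suc q))
        ≡⟨ cong (λ e → s ^ e * G) m∸[1+q]≡k ⟩
      s ^ k * ((s + γ * + n) ^ q * (s + γ * + n + β * + n * + suc q)) ∎
      where
      G = (s + γ * + n) ^ q * (s + γ * + n + β * + n * + suc q)

    private
      1+q≡ : + suc q ≡ + 1 + + q
      1+q≡ = ℤ.pos-+ 1 q

      2nq≡ : + (2 ℕ.* n ℕ.* q) ≡ + 2 * + n * + q
      2nq≡ = trans (ℤ.pos-* (2 ℕ.* n) q) (cong (_* + q) (ℤ.pos-* 2 n))

      factors-cong : ∀ {s X z a Y c} → s ≡ a → X ≡ Y → z ≡ c → s ^ k * (X * z) ≡ a ^ k * (Y * c)
      factors-cong refl refl refl = refl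

    spectrum : HasSpectrum A (multiset ((+ 0 , k) ∷ (- (+ n) , q) ∷ (+ (n ℕ.* q) , 1) ∷ []))
    spectrum =
      trans (length-multiset ((+ 0 , k) ∷ (- (+ n) , q) ∷ (+ (n ℕ.* q) , 1) ∷ [])) k+q+1≡m ,
      λ t → begin
        det (λ i j → t * δ i j - A i j)
          ≡⟨ det-shifted _ t (- + 1) (+ 1) (shift t) ⟩
        t ^ k * ((t + + 1 * + n) ^ q * (t + + 1 * + n + - + 1 * + n * + suc q))
          ≡⟨ factors-cong (t≡t-0 t) (cong (_^ q) (t+n≡t--n t (+ n))) (last t) ⟩
        (t - + 0) ^ k * ((t - - + n) ^ q * ((t - nq) ^ 1 * + 1))
          ≡⟨ sym (prodℤ-map-multiset (λ l → t - l) ((+ 0 , k) ∷ (- (+ n) , q) ∷ (+ (n ℕ.* q) , 1) ∷ [])) ⟩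
        prodℤ (map (λ l → t - l) (multiset ((+ 0 , k) ∷ (- (+ n) , q) ∷ (+ (n ℕ.* q) , 1) ∷ []))) ∎
      where
      shift : ∀ t i j → t * δ i j - A i j ≡ classMatrix t (- + 1) (+ 1) sameSide (const (+ 1)) i j
      shift t i j = trans (cong (λ a → t * δ i j - a) (adjacency i j)) (rearrange t (δ i j) (ind (sameSide i j)))
        where
        rearrange : ∀ t d e → t * d - (+ 1 - e) ≡ t * d + + 1 * (- + 1 + + 1 * e)
        rearrange = solve-∀
      t≡t-0 : ∀ t → t ≡ t - + 0
      t≡t-0 = solve-∀
      t+n≡t--n : ∀ t n → t + + 1 * n ≡ t - - n
      t+n≡t--n = solve-∀
      last : ∀ t → t + + 1 * + n + - + 1 * + n * + suc q ≡ (t - nq) ^ 1 * + 1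
      last t = begin
        t + + 1 * + n + - + 1 * + n * + suc q        ≡⟨ cong (λ x → t + + 1 * + n + - + 1 * + n * x) 1+q≡ ⟩
        t + + 1 * + n + - + 1 * + n * (+ 1 + + q)    ≡⟨ collect t (+ n) (+ q) ⟩
        (t - + n * + q) ^ 1 * + 1                    ≡⟨ cong (λ y → (t - y) ^ 1 * + 1) (sym nq≡) ⟩
        (t - nq) ^ 1 * + 1                           ∎
        where
        collect : ∀ t n q → t + + 1 * n + - + 1 * n * (+ 1 + q) ≡ (t - n * q) * + 1 * + 1
        collect = solve-∀

    laplacianSpectrum : HasSpectrum (laplacian A) (multiset ((+ 0 , 1) ∷ (+ (n ℕ.* q) , k) ∷ (+ ((q ℕ.+ 1) ℕ.* n) , q) ∷ []))
    laplacianSpectrum =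
      trans (length-multiset ((+ 0 , 1) ∷ (+ (n ℕ.* q) , k) ∷ (+ ((q ℕ.+ 1) ℕ.* n) , q) ∷ [])) (trans (reorder k q) k+q+1≡m) ,
      λ t → begin
        det (λ i j → t * δ i j - laplacian A i j)
          ≡⟨ det-shifted _ (t - nq) (+ 1) (- + 1) (shift t) ⟩
        (t - nq) ^ k * ((t - nq + - + 1 * + n) ^ q * (t - nq + - + 1 * + n + + 1 * + n * + suc q))
          ≡⟨ factors-cong refl (cong (_^ q) (middle t)) (last t) ⟩
        (t - nq) ^ k * ((t - + ((q ℕ.+ 1) ℕ.* n)) ^ q * t)
          ≡⟨ move-t t ((t - nq) ^ k) ((t - + ((q ℕ.+ 1) ℕ.* n)) ^ q) ⟩
        (t - + 0) ^ 1 * ((t - nq) ^ k * ((t - + ((q ℕ.+ 1) ℕ.* n)) ^ q * + 1))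
          ≡⟨ sym (prodℤ-map-multiset (λ l → t - l) ((+ 0 , 1) ∷ (+ (n ℕ.* q) , k) ∷ (+ ((q ℕ.+ 1) ℕ.* n) , q) ∷ [])) ⟩
        prodℤ (map (λ l → t - l) (multiset ((+ 0 , 1) ∷ (+ (n ℕ.* q) , k) ∷ (+ ((q ℕ.+ 1) ℕ.* n) , q) ∷ []))) ∎
      where
      reorder : ∀ k q → 1 ℕ.+ (k ℕ.+ (q ℕ.+ 0)) ≡ k ℕ.+ (q ℕ.+ 1)
      reorder = ℕ-Solver.solve-∀
      shift : ∀ t i j → t * δ i j - laplacian A i j ≡ classMatrix (t - nq) (+ 1) (- + 1) sameSide (const (+ 1)) i j
      shift t i j = trans (cong₂ (λ d a → t * δ i j - (δ i j * d - a)) (degree≡ i) (adjacency i j)) (rearrange t (δ i j) nq (ind (sameSide i j)))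
        where
        rearrange : ∀ t d D e → t * d - (d * D - (+ 1 - e)) ≡ (t - D) * d + + 1 * (+ 1 + - + 1 * e)
        rearrange = solve-∀
      middle : ∀ t → t - nq + - + 1 * + n ≡ t - + ((q ℕ.+ 1) ℕ.* n)
      middle t = begin
        t - nq + - + 1 * + n
          ≡⟨ cong (λ y → t - y + - + 1 * + n) nq≡ ⟩
        t - + n * + q + - + 1 * + n
          ≡⟨ collect t (+ n) (+ q) ⟩
        t - (+ q + + 1) * + n
          ≡⟨ cong (λ y → t - y) (sym (trans (ℤ.pos-* (q ℕ.+ 1) n) (cong (_* + n) (ℤ.pos-+ q 1)))) ⟩
        t - + ((q ℕ.+ 1) ℕ.* n) ∎
        where
        collect : ∀ t n q → t - n * q + - + 1 * n ≡ t - (q + + 1) * n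
        collect = solve-∀
      last : ∀ t → t - nq + - + 1 * + n + + 1 * + n * + suc q ≡ t
      last t = begin
        t - nq + - + 1 * + n + + 1 * + n * + suc q
          ≡⟨ cong₂ (λ y z → t - y + - + 1 * + n + + 1 * + n * z) nq≡ 1+q≡ ⟩
        t - + n * + q + - + 1 * + n + + 1 * + n * (+ 1 + + q)
          ≡⟨ cancel t (+ n) (+ q) ⟩
        t ∎
        where
        cancel : ∀ t n q → t - n * q + - + 1 * n + + 1 * n * (+ 1 + q) ≡ t
        cancel = solve-∀
      move-t : ∀ t P X → P * (X * t) ≡ (t - + 0) * + 1 * (P * (X * + 1))
      move-t = solve-∀

    signlessLaplacianSpectrum : HasSpectrum (signlessLaplacian A) (multiset ((+ (n ℕ.* q) , k) ∷ (+ (n ℕ.* (q ∸ 1)) , q) ∷ (+ (2 ℕ.* n ℕ.* q) , 1) ∷ []))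
    signlessLaplacianSpectrum =
      trans (length-multiset ((+ (n ℕ.* q) , k) ∷ (+ (n ℕ.* (q ∸ 1)) , q) ∷ (+ (2 ℕ.* n ℕ.* q) , 1) ∷ [])) k+q+1≡m ,
      λ t → begin
        det (λ i j → t * δ i j - signlessLaplacian A i j)
          ≡⟨ det-shifted _ (t - nq) (- + 1) (+ 1) (shift t) ⟩
        (t - nq) ^ k * ((t - nq + + 1 * + n) ^ q * (t - nq + + 1 * + n + - + 1 * + n * + suc q))
          ≡⟨ factors-cong refl (middle q refl t) (last t) ⟩
        (t - nq) ^ k * ((t - + (n ℕ.* (q ∸ 1))) ^ q * ((t - + (2 ℕ.* n ℕ.* q)) ^ 1 * + 1))
          ≡⟨ sym (prodℤ-map-multiset (λ l → t - l) ((+ (n ℕ.* q) , k) ∷ (+ (n ℕ.* (q ∸ 1)) , q) ∷ (+ (2 ℕ.* n ℕ.* q) , 1) ∷ [])) ⟩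
        prodℤ (map (λ l → t - l) (multiset ((+ (n ℕ.* q) , k) ∷ (+ (n ℕ.* (q ∸ 1)) , q) ∷ (+ (2 ℕ.* n ℕ.* q) , 1) ∷ []))) ∎
      where
      shift : ∀ t i j → t * δ i j - signlessLaplacian A i j ≡ classMatrix (t - nq) (- + 1) (+ 1) sameSide (const (+ 1)) i j
      shift t i j = trans (cong₂ (λ d a → t * δ i j - (δ i j * d + a)) (degree≡ i) (adjacency i j)) (rearrange t (δ i j) nq (ind (sameSide i j)))
        where
        rearrange : ∀ t d D e → t * d - (d * D + (+ 1 - e)) ≡ (t - D) * d + + 1 * (- + 1 + + 1 * e)
        rearrange = solve-∀
      -- Only relevant for q ≥ 1: for q = 0 both sides are empty products.
      middle : ∀ r → r ≡ q → ∀ t → (t - nq + + 1 * + n) ^ r ≡ (t - + (n ℕ.* (r ∸ 1))) ^ r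
      middle zero    _    t = refl
      middle (suc r) refl t = cong (_^ suc r) (begin
        t - + (n ℕ.* suc r) + + 1 * + n       ≡⟨ cong (λ y → t - + y + + 1 * + n) (ℕ.*-suc n r) ⟩
        t - + (n ℕ.+ n ℕ.* r) + + 1 * + n     ≡⟨ cong (λ y → t - y + + 1 * + n) (ℤ.pos-+ n (n ℕ.* r)) ⟩
        t - (+ n + + (n ℕ.* r)) + + 1 * + n   ≡⟨ cancel t (+ n) (+ (n ℕ.* r)) ⟩
        t - + (n ℕ.* r)                       ∎)
        where
        cancel : ∀ t n x → t - (n + x) + + 1 * n ≡ t - x
        cancel = solve-∀
      last : ∀ t → t - nq + + 1 * + n + - + 1 * + n * + suc q ≡ (t - + (2 ℕ.* n ℕ.* q)) * + 1 * + 1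
      last t = begin
        t - nq + + 1 * + n + - + 1 * + n * + suc q
          ≡⟨ cong₂ (λ y z → t - y + + 1 * + n + - + 1 * + n * z) nq≡ 1+q≡ ⟩
        t - + n * + q + + 1 * + n + - + 1 * + n * (+ 1 + + q)
          ≡⟨ collect t (+ n) (+ q) ⟩
        (t - + 2 * + n * + q) * + 1 * + 1
          ≡⟨ cong (λ y → (t - y) * + 1 * + 1) (sym 2nq≡) ⟩
        (t - + (2 ℕ.* n ℕ.* q)) * + 1 * + 1 ∎
        where
        collect : ∀ t n q → t - n * q + + 1 * n + - + 1 * n * (+ 1 + q) ≡ (t - + 2 * n * q) * + 1 * + 1
        collect = solve-∀

    private
      ∣x-avgDegree∣ : ∀ b → ℚ.∣ ℤtoℚ b ℚ.- avgDegree A ∣ ≡ ℤtoℚ (+ ∣ b - nq ∣)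
      ∣x-avgDegree∣ b = trans (cong (λ x → ℚ.∣ ℤtoℚ b ℚ.- x ∣) avgDegree≡) (trans (cong ℚ.∣_∣ (ℤtoℚ-- b nq)) (ℤtoℚ-∣∣ (b - nq)))

      ∣x-x∣ : ∀ x → ∣ x - x ∣ ≡ 0
      ∣x-x∣ x = cong ∣_∣ (ℤ.+-inverseʳ x)

    energy : Energy A (ℤtoℚ (+ (2 ℕ.* n ℕ.* q)))
    energy = multiset αs , spectrum , (begin
      sumℚ (map (λ a → ℚ.∣ ℤtoℚ a ∣) (multiset αs))
        ≡⟨ sumℚ-map-ℤtoℚ (λ a → ℚ.∣ ℤtoℚ a ∣) (λ a → + ∣ a ∣) ℤtoℚ-∣∣ (multiset αs) ⟩
      ℤtoℚ (sumℤ (map (λ a → + ∣ a ∣) (multiset αs)))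
        ≡⟨ cong ℤtoℚ (sumℤ-map-multiset (λ a → + ∣ a ∣) αs) ⟩
      ℤtoℚ (+ k * + 0 + (+ q * + ∣ - + n ∣ + (+ 1 * nq + + 0)))
        ≡⟨ cong (λ a → ℤtoℚ (+ k * + 0 + (+ q * + a + (+ 1 * nq + + 0)))) (ℤ.∣-i∣≡∣i∣ (+ n)) ⟩
      ℤtoℚ (+ k * + 0 + (+ q * + n + (+ 1 * nq + + 0)))
        ≡⟨ cong ℤtoℚ (trans (cong (λ y → + k * + 0 + (+ q * + n + (+ 1 * y + + 0))) nq≡) (total (+ k) (+ n) (+ q))) ⟩
      ℤtoℚ (+ 2 * + n * + q)
        ≡⟨ cong ℤtoℚ (sym 2nq≡) ⟩
      ℤtoℚ (+ (2 ℕ.* n ℕ.* q)) ∎)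
      where
      αs = ((+ 0 , k) ∷ (- (+ n) , q) ∷ (+ (n ℕ.* q) , 1) ∷ [])
      total : ∀ k n q → k * + 0 + (q * n + (+ 1 * (n * q) + + 0)) ≡ + 2 * n * q
      total = solve-∀

    laplacianEnergy : LaplacianEnergy A (ℤtoℚ (+ (2 ℕ.* n ℕ.* q)))
    laplacianEnergy = multiset βs , laplacianSpectrum , (begin
      sumℚ (map (λ b → ℚ.∣ ℤtoℚ b ℚ.- avgDegree A ∣) (multiset βs))
        ≡⟨ sumℚ-map-ℤtoℚ (λ b → ℚ.∣ ℤtoℚ b ℚ.- avgDegree A ∣) (λ b → + ∣ b - nq ∣) ∣x-avgDegree∣ (multiset βs) ⟩
      ℤtoℚ (sumℤ (map (λ b → + ∣ b - nq ∣) (multiset βs)))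
        ≡⟨ cong ℤtoℚ (sumℤ-map-multiset (λ b → + ∣ b - nq ∣) βs) ⟩
      ℤtoℚ (+ 1 * + ∣ + 0 - nq ∣ + (+ k * + ∣ nq - nq ∣ + (+ q * + ∣ + ((q ℕ.+ 1) ℕ.* n) - nq ∣ + + 0)))
        ≡⟨ cong ℤtoℚ (cong₃ ∣0-nq∣ (∣x-x∣ nq) ∣[q+1]n-nq∣) ⟩
      ℤtoℚ (+ 1 * + (n ℕ.* q) + (+ k * + 0 + (+ q * + n + + 0)))
        ≡⟨ cong ℤtoℚ (trans (cong (λ y → + 1 * y + (+ k * + 0 + (+ q * + n + + 0))) nq≡) (total (+ k) (+ n) (+ q))) ⟩
      ℤtoℚ (+ 2 * + n * + q)
        ≡⟨ cong ℤtoℚ (sym 2nq≡) ⟩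
      ℤtoℚ (+ (2 ℕ.* n ℕ.* q)) ∎)
      where
      βs = ((+ 0 , 1) ∷ (+ (n ℕ.* q) , k) ∷ (+ ((q ℕ.+ 1) ℕ.* n) , q) ∷ [])
      cong₃ : ∀ {a b c a′ b′ c′} → a ≡ a′ → b ≡ b′ → c ≡ c′ →
              + 1 * + a + (+ k * + b + (+ q * + c + + 0)) ≡ + 1 * + a′ + (+ k * + b′ + (+ q * + c′ + + 0))
      cong₃ refl refl refl = refl
      ∣0-nq∣ : ∣ + 0 - nq ∣ ≡ n ℕ.* q
      ∣0-nq∣ = trans (cong ∣_∣ (ℤ.+-identityˡ (- nq))) (ℤ.∣-i∣≡∣i∣ nq)
      ∣[q+1]n-nq∣ : ∣ + ((q ℕ.+ 1) ℕ.* n) - nq ∣ ≡ n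
      ∣[q+1]n-nq∣ = cong ∣_∣ (begin
        + ((q ℕ.+ 1) ℕ.* n) - nq   ≡⟨ cong₂ _-_ (trans (ℤ.pos-* (q ℕ.+ 1) n) (cong (_* + n) (ℤ.pos-+ q 1))) nq≡ ⟩
        (+ q + + 1) * + n - + n * + q ≡⟨ cancel (+ n) (+ q) ⟩
        + n                        ∎)
        where
        cancel : ∀ n q → (q + + 1) * n - n * q ≡ n
        cancel = solve-∀
      total : ∀ k n q → + 1 * (n * q) + (k * + 0 + (q * n + + 0)) ≡ + 2 * n * q
      total = solve-∀

    signlessLaplacianEnergy : SignlessLaplacianEnergy A (ℤtoℚ (+ (2 ℕ.* n ℕ.* q)))
    signlessLaplacianEnergy = multiset γs , signlessLaplacianSpectrum , (begin
      sumℚ (map (λ b → ℚ.∣ ℤtoℚ b ℚ.- avgDegree A ∣) (multiset γs))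
        ≡⟨ sumℚ-map-ℤtoℚ (λ b → ℚ.∣ ℤtoℚ b ℚ.- avgDegree A ∣) (λ b → + ∣ b - nq ∣) ∣x-avgDegree∣ (multiset γs) ⟩
      ℤtoℚ (sumℤ (map (λ b → + ∣ b - nq ∣) (multiset γs)))
        ≡⟨ cong ℤtoℚ (sumℤ-map-multiset (λ b → + ∣ b - nq ∣) γs) ⟩
      ℤtoℚ (+ k * + ∣ nq - nq ∣ + (+ q * + ∣ + (n ℕ.* (q ∸ 1)) - nq ∣ + (+ 1 * + ∣ + (2 ℕ.* n ℕ.* q) - nq ∣ + + 0)))
        ≡⟨ cong ℤtoℚ (cong₃ (cong +_ (∣x-x∣ nq)) (q∣n[q-1]-nq∣ q refl) (cong +_ ∣2nq-nq∣)) ⟩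
      ℤtoℚ (+ k * + 0 + (+ q * + n + (+ 1 * + (n ℕ.* q) + + 0)))
        ≡⟨ cong ℤtoℚ (trans (cong (λ y → + k * + 0 + (+ q * + n + (+ 1 * y + + 0))) nq≡) (total (+ k) (+ n) (+ q))) ⟩
      ℤtoℚ (+ 2 * + n * + q)
        ≡⟨ cong ℤtoℚ (sym 2nq≡) ⟩
      ℤtoℚ (+ (2 ℕ.* n ℕ.* q)) ∎)
      where
      γs = ((+ (n ℕ.* q) , k) ∷ (+ (n ℕ.* (q ∸ 1)) , q) ∷ (+ (2 ℕ.* n ℕ.* q) , 1) ∷ [])
      cong₃ : ∀ {a b c a′ b′ c′} → a ≡ a′ → b ≡ b′ → c ≡ c′ →
              + k * a + (b + (+ 1 * c + + 0)) ≡ + k * a′ + (b′ + (+ 1 * c′ + + 0))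
      cong₃ refl refl refl = refl
      q∣n[q-1]-nq∣ : ∀ r → r ≡ q → + r * + ∣ + (n ℕ.* (r ∸ 1)) - nq ∣ ≡ + r * + n
      q∣n[q-1]-nq∣ zero    _    = refl
      q∣n[q-1]-nq∣ (suc r) refl = cong (λ a → + suc r * + a) (begin
        ∣ + (n ℕ.* r) - + (n ℕ.* suc r) ∣         ≡⟨ cong (λ y → ∣ + (n ℕ.* r) - + y ∣) (ℕ.*-suc n r) ⟩
        ∣ + (n ℕ.* r) - + (n ℕ.+ n ℕ.* r) ∣       ≡⟨ cong (λ y → ∣ + (n ℕ.* r) - y ∣) (ℤ.pos-+ n (n ℕ.* r)) ⟩
        ∣ + (n ℕ.* r) - (+ n + + (n ℕ.* r)) ∣     ≡⟨ cong ∣_∣ (cancel (+ n) (+ (n ℕ.* r))) ⟩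
        ∣ - + n ∣                                 ≡⟨ ℤ.∣-i∣≡∣i∣ (+ n) ⟩
        n                                         ∎)
        where
        cancel : ∀ n x → x - (n + x) ≡ - n
        cancel = solve-∀
      ∣2nq-nq∣ : ∣ + (2 ℕ.* n ℕ.* q) - nq ∣ ≡ n ℕ.* q
      ∣2nq-nq∣ = cong ∣_∣ (trans (cong₂ _-_ 2nq≡ nq≡) (trans (cancel (+ n) (+ q)) (sym nq≡)))
        where
        cancel : ∀ n q → + 2 * n * q - n * q ≡ n * q
        cancel = solve-∀
      total : ∀ k n q → k * + 0 + (q * n + (+ 1 * (n * q) + + 0)) ≡ + 2 * n * q
      total = solve-∀

module Congruence (p : ℕ) (p-prime : Prime p) where

  open import Data.Nat as ℕ using (ℕ; zero; suc; _%_; _/_; _∸_)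
  open import Data.Nat.Primality using (Prime; prime⇒nonZero; euclidsLemma)

  open import Data.Nat.Properties as ℕ using ()
  open import Data.Nat.DivMod as ℕ using ()
  open import Data.Nat.Divisibility as ℕ using ()
  open import Data.Nat.Coprimality using (prime⇒coprime; coprime-Bézout)
  open import Data.Nat.GCD using (module Bézout)
  open import Data.Integer as ℤ using (ℤ; +_; -_; _+_; _*_; _-_; ∣_∣)
  open import Data.Integer.Properties as ℤ using ()
  open import Data.Integer.DivMod as ℤ using (_%ℕ_; _/ℕ_)
  open import Data.Integer.Divisibility.Signed as ℤ∣ using ()
  open import Data.Integer.Tactic.RingSolver using (solve-∀)
  open import Data.Fin using (Fin; toℕ; fromℕ<)
  open import Data.Fin.Properties using (toℕ<n; toℕ-injective; toℕ-fromℕ<)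
  open FinSum
  import Relation.Binary.Reasoning.Setoid
  open import Data.Product using (∃; _×_; _,_; proj₁; proj₂)
  open import Data.Sum using (inj₁; inj₂)
  open import Function.Base using (_∘_)
  open import Relation.Binary.Bundles using (Setoid)
  open import Relation.Binary.Structures using (IsEquivalence)
  open import Relation.Binary.PropositionalEquality using (_≡_; _≢_; refl; sym; trans; cong; subst; module ≡-Reasoning)
  open import Relation.Nullary using (¬_; Dec; yes; no)
  open import Relation.Nullary.Decidable using (map′)
  open import Relation.Nullary.Negation using (contradiction)

  instance
    p≢0 : ℕ.NonZero p
    p≢0 = prime⇒nonZero p-prime

  -- Congruence modulo p, as a record so that a and b can be inferred from a proof.
  infix 4 _≈_
  record _≈_ (a b : ℤ) : Set where
    constructor mk≈
    field
      divides : + p ℤ∣.∣ (a - b)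

  ≈-intro : ∀ {a b} (k : ℤ) → a ≡ b + k * + p → a ≈ b
  ≈-intro {a} {b} k a≡b+kp = mk≈ (ℤ∣.divides k (trans (cong (_- b) a≡b+kp) (b+x-b≡x b (k * + p))))
    where
    b+x-b≡x : ∀ b x → b + x - b ≡ x
    b+x-b≡x = solve-∀

  ≈-elim : ∀ {a b} → a ≈ b → ∃ λ k → a ≡ b + k * + p
  ≈-elim {a} {b} (mk≈ (ℤ∣.divides k a-b≡kp)) = k , trans (a≡b+[a-b] a b) (cong (_+_ b) a-b≡kp)
    where
    a≡b+[a-b] : ∀ a b → a ≡ b + (a - b)
    a≡b+[a-b] = solve-∀

  ≈-refl : ∀ {a} → a ≈ a
  ≈-refl {a} = ≈-intro (+ 0) (a≡a+0p a (+ p))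
    where
    a≡a+0p : ∀ a p → a ≡ a + + 0 * p
    a≡a+0p = solve-∀

  ≈-reflexive : ∀ {a b} → a ≡ b → a ≈ b
  ≈-reflexive refl = ≈-refl

  ≈-sym : ∀ {a b} → a ≈ b → b ≈ a
  ≈-sym {b = b} h with ≈-elim h
  ... | k , refl = ≈-intro (- k) (b≡b+kp-kp b k (+ p))
    where
    b≡b+kp-kp : ∀ b k p → b ≡ b + k * p + (- k) * p
    b≡b+kp-kp = solve-∀

  ≈-trans : ∀ {a b c} → a ≈ b → b ≈ c → a ≈ c
  ≈-trans {c = c} h₁ h₂ with ≈-elim h₁ | ≈-elim h₂
  ... | k₁ , refl | k₂ , refl = ≈-intro (k₁ + k₂) (regroup c k₁ k₂ (+ p))
    where
    regroup : ∀ c k₁ k₂ p → c + k₂ * p + k₁ * p ≡ c + (k₁ + k₂) * p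
    regroup = solve-∀

  ≈-isEquivalence : IsEquivalence _≈_
  ≈-isEquivalence = record { refl = ≈-refl ; sym = ≈-sym ; trans = ≈-trans }

  ≈-setoid : Setoid _ _
  ≈-setoid = record { isEquivalence = ≈-isEquivalence }

  +-cong : ∀ {a a′ b b′} → a ≈ a′ → b ≈ b′ → a + b ≈ a′ + b′
  +-cong {a′ = a} {b′ = b} h₁ h₂ with ≈-elim h₁ | ≈-elim h₂
  ... | k₁ , refl | k₂ , refl = ≈-intro (k₁ + k₂) (regroup a b k₁ k₂ (+ p))
    where
    regroup : ∀ a b k₁ k₂ p → a + k₁ * p + (b + k₂ * p) ≡ a + b + (k₁ + k₂) * p
    regroup = solve-∀

  *-cong : ∀ {a a′ b b′} → a ≈ a′ → b ≈ b′ → a * b ≈ a′ * b′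
  *-cong {a′ = a} {b′ = b} h₁ h₂ with ≈-elim h₁ | ≈-elim h₂
  ... | k₁ , refl | k₂ , refl = ≈-intro (a * k₂ + k₁ * b + k₁ * k₂ * + p) (expand a b k₁ k₂ (+ p))
    where
    expand : ∀ a b k₁ k₂ p → (a + k₁ * p) * (b + k₂ * p) ≡ a * b + (a * k₂ + k₁ * b + k₁ * k₂ * p) * p
    expand = solve-∀

  +-cancelʳ-≈ : ∀ {a b} c → a + c ≈ b + c → a ≈ b
  +-cancelʳ-≈ {a} {b} c h = ≈-trans (≈-reflexive (a≡a+c-c a c)) (≈-trans (+-cong h (≈-refl { - c})) (≈-reflexive (sym (a≡a+c-c b c))))
    where
    a≡a+c-c : ∀ a c → a ≡ a + c + - c
    a≡a+c-c = solve-∀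

  %-≈ : ∀ a → + (a % p) ≈ + a
  %-≈ a = ≈-sym (≈-intro (+ (a / p)) (begin
    + a                          ≡⟨ cong +_ (ℕ.m≡m%n+[m/n]*n a p) ⟩
    + (a % p ℕ.+ a / p ℕ.* p)    ≡⟨ ℤ.pos-+ (a % p) (a / p ℕ.* p) ⟩
    + (a % p) + + (a / p ℕ.* p)  ≡⟨ cong (_+_ (+ (a % p))) (ℤ.pos-* (a / p) p) ⟩
    + (a % p) + + (a / p) * + p  ∎))
    where open ≡-Reasoning

  %ℕ-≈ : ∀ a → + (a %ℕ p) ≈ a
  %ℕ-≈ a = ≈-sym (≈-intro (a /ℕ p) (ℤ.a≡a%ℕn+[a/ℕn]*n a p))

  <p∧∣⇒≡0 : ∀ {d} → d ℕ.< p → p ℕ.∣ d → d ≡ 0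
  <p∧∣⇒≡0 {zero}  _   _   = refl
  <p∧∣⇒≡0 {suc d} d<p p∣d = contradiction (ℕ.∣⇒≤ p∣d) (ℕ.<⇒≱ d<p)

  private
    difference≡0 : ∀ {x y} → y ℕ.≤ x → x ℕ.< p → + x ≈ + y → x ∸ y ≡ 0
    difference≡0 {x} {y} y≤x x<p (mk≈ p∣x-y) = <p∧∣⇒≡0 (ℕ.≤-<-trans (ℕ.m∸n≤m x y) x<p)
      (subst (λ z → p ℕ.∣ ∣ z ∣) (trans (ℤ.m-n≡m⊖n x y) (ℤ.⊖-≥ y≤x)) (ℤ∣.∣⇒∣ᵤ p∣x-y))

  ≈⇒≡ : ∀ {a b} → a ℕ.< p → b ℕ.< p → + a ≈ + b → a ≡ b
  ≈⇒≡ {a} {b} a<p b<p a≈b with ℕ.≤-total b a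
  ... | inj₁ b≤a = ℕ.≤-antisym (ℕ.m∸n≡0⇒m≤n (difference≡0 b≤a a<p a≈b)) b≤a
  ... | inj₂ a≤b = ℕ.≤-antisym a≤b (ℕ.m∸n≡0⇒m≤n (difference≡0 a≤b b<p (≈-sym a≈b)))

  %≡⇒≈ : ∀ a b → a % p ≡ b % p → + a ≈ + b
  %≡⇒≈ a b a%p≡b%p = ≈-trans (≈-sym (%-≈ a)) (≈-trans (≈-reflexive (cong +_ a%p≡b%p)) (%-≈ b))

  ≈⇒%≡ : ∀ a b → + a ≈ + b → a % p ≡ b % p
  ≈⇒%≡ a b a≈b = ≈⇒≡ (ℕ.m%n<n a p) (ℕ.m%n<n b p) (≈-trans (%-≈ a) (≈-trans a≈b (≈-sym (%-≈ b))))

  <p⇒∤ : ∀ {a} → a ℕ.< p → a ≢ 0 → ¬ (p ℕ.∣ a)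
  <p⇒∤ a<p a≢0 = a≢0 ∘ <p∧∣⇒≡0 a<p

  *-cancelˡ-≈ : ∀ a {x y} → ¬ (p ℕ.∣ a) → + a * x ≈ + a * y → x ≈ y
  *-cancelˡ-≈ a {x} {y} p∤a (mk≈ p∣ax-ay) with euclidsLemma a ∣ x - y ∣ p-prime p∣a∣x-y∣
    where
    ax-ay≡a[x-y] : ∀ a x y → a * x - a * y ≡ a * (x - y)
    ax-ay≡a[x-y] = solve-∀
    p∣a∣x-y∣ : p ℕ.∣ a ℕ.* ∣ x - y ∣
    p∣a∣x-y∣ = subst (p ℕ.∣_) (ℤ.abs-* (+ a) (x - y)) (ℤ∣.∣⇒∣ᵤ (subst (+ p ℤ∣.∣_) (ax-ay≡a[x-y] (+ a) x y) p∣ax-ay))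
  ... | inj₁ p∣a   = contradiction p∣a p∤a
  ... | inj₂ p∣x-y = mk≈ (ℤ∣.∣ᵤ⇒∣ p∣x-y)

  inverse : ∀ a → ¬ (p ℕ.∣ a) → ∃ λ x → + x * + a ≈ + 1
  inverse a p∤a = proj₁ inv %ℕ p , ≈-trans (*-cong (%ℕ-≈ (proj₁ inv)) (≈-sym (%-≈ a))) (proj₂ inv)
    where
    r = a % p
    r≢0 : r ≢ 0
    r≢0 r≡0 = p∤a (ℕ.m%n≡0⇒n∣m a p r≡0)
    inv : ∃ λ e → e * + r ≈ + 1
    inv with coprime-Bézout (prime⇒coprime p-prime {{ℕ.≢-nonZero r≢0}} (ℕ.m%n<n a p))
    ... | Bézout.+- x y 1+yr≡xp = - + y , ≈-intro (- + x) (begin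
      - + y * + r
        ≡⟨ rearrange (+ y) (+ r) ⟩
      + 1 - (+ 1 + + y * + r)
        ≡⟨ cong (λ z → + 1 - z) (trans (cong (_+_ (+ 1)) (sym (ℤ.pos-* y r))) (trans (cong +_ 1+yr≡xp) (ℤ.pos-* x p))) ⟩
      + 1 - + x * + p
        ≡⟨ rearrange′ (+ x) (+ p) ⟩
      + 1 + - + x * + p ∎)
      where
      open ≡-Reasoning
      rearrange : ∀ y r → - y * r ≡ + 1 - (+ 1 + y * r)
      rearrange = solve-∀
      rearrange′ : ∀ x p → + 1 - x * p ≡ + 1 + - x * p
      rearrange′ = solve-∀
    ... | Bézout.-+ x y 1+xp≡yr = + y , ≈-intro (+ x) (begin
      + y * + r                 ≡⟨ sym (ℤ.pos-* y r) ⟩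
      + (y ℕ.* r)               ≡⟨ cong +_ (sym 1+xp≡yr) ⟩
      + (1 ℕ.+ x ℕ.* p)         ≡⟨ ℤ.pos-+ 1 (x ℕ.* p) ⟩
      + 1 + + (x ℕ.* p)         ≡⟨ cong (_+_ (+ 1)) (ℤ.pos-* x p) ⟩
      + 1 + + x * + p           ∎)
      where open ≡-Reasoning

  _≈?_ : ∀ a b → Dec (+ a ≈ + b)
  a ≈? b = map′ (%≡⇒≈ a b) (≈⇒%≡ a b) (a % p ℕ.≟ b % p)

  ∣∸⇒≈ : ∀ {a b} → a ℕ.≤ b → p ℕ.∣ b ∸ a → + b ≈ + a
  ∣∸⇒≈ {a} {b} a≤b (ℕ.divides k b∸a≡kp) = ≈-intro (+ k) (begin
    + b                    ≡⟨ cong +_ (sym (ℕ.m+[n∸m]≡n a≤b)) ⟩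
    + (a ℕ.+ (b ∸ a))      ≡⟨ cong (λ d → + (a ℕ.+ d)) b∸a≡kp ⟩
    + (a ℕ.+ k ℕ.* p)      ≡⟨ ℤ.pos-+ a (k ℕ.* p) ⟩
    + a + + (k ℕ.* p)      ≡⟨ cong (_+_ (+ a)) (ℤ.pos-* k p) ⟩
    + a + + k * + p        ∎)
    where open ≡-Reasoning

  line-size : ∀ a b → a ℕ.< p → b ℕ.< p → ¬ (a ≡ 0 × b ≡ 0) →
              ΣFin (λ (u : Fin p) → ΣFin (λ (v : Fin p) → χ ((b ℕ.* toℕ u) ≈? (toℕ v ℕ.* a)))) ≡ + p
  line-size a b a<p b<p ¬a≡0×b≡0 with a ℕ.≟ 0
  ... | no a≢0 = trans (ΣFin-cong {p} one-v) (trans (ΣFin-const p (+ 1)) (ℤ.*-identityʳ (+ p)))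
    where
    k = proj₁ (inverse a (<p⇒∤ a<p a≢0))
    v-of : Fin p → Fin p
    v-of u = fromℕ< (ℕ.m%n<n (k ℕ.* (b ℕ.* toℕ u)) p)
    on-line : ∀ u → + (b ℕ.* toℕ u) ≈ + (toℕ (v-of u) ℕ.* a)
    on-line u = ≈-sym (begin
      + (toℕ (v-of u) ℕ.* a)
        ≡⟨ ℤ.pos-* (toℕ (v-of u)) a ⟩
      + toℕ (v-of u) * + a
        ≈⟨ *-cong (≈-trans (≈-reflexive (cong +_ (toℕ-fromℕ< _))) (%-≈ _)) (≈-refl {+ a}) ⟩
      + (k ℕ.* (b ℕ.* toℕ u)) * + a
        ≡⟨ cong (_* + a) (ℤ.pos-* k (b ℕ.* toℕ u)) ⟩
      + k * + (b ℕ.* toℕ u) * + a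
        ≡⟨ regroup (+ k) (+ (b ℕ.* toℕ u)) (+ a) ⟩
      + k * + a * + (b ℕ.* toℕ u)
        ≈⟨ *-cong (proj₂ (inverse a (<p⇒∤ a<p a≢0))) (≈-refl {+ (b ℕ.* toℕ u)}) ⟩
      + 1 * + (b ℕ.* toℕ u)
        ≡⟨ ℤ.*-identityˡ _ ⟩
      + (b ℕ.* toℕ u) ∎)
      where
      open Relation.Binary.Reasoning.Setoid ≈-setoid
      regroup : ∀ k x a → k * x * a ≡ k * a * x
      regroup = solve-∀
    only-v : ∀ u v → + (b ℕ.* toℕ u) ≈ + (toℕ v ℕ.* a) → v ≡ v-of u
    only-v u v bu≈va = toℕ-injective (≈⇒≡ (toℕ<n v) (toℕ<n (v-of u)) (*-cancelˡ-≈ a (<p⇒∤ a<p a≢0)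
      (≈-trans (≈-reflexive (*-comm-pos a (toℕ v))) (≈-trans (≈-sym bu≈va) (≈-trans (on-line u) (≈-reflexive (sym (*-comm-pos a (toℕ (v-of u))))))))))
      where
      *-comm-pos : ∀ a v → + a * + v ≡ + (v ℕ.* a)
      *-comm-pos a v = trans (ℤ.*-comm (+ a) (+ v)) (sym (ℤ.pos-* v a))
    one-v : ∀ u → ΣFin (λ (v : Fin p) → χ ((b ℕ.* toℕ u) ≈? (toℕ v ℕ.* a))) ≡ + 1
    one-v u = trans (ΣFin-single (v-of u) _ (λ v v≢ → χ-no ((b ℕ.* toℕ u) ≈? (toℕ v ℕ.* a)) (v≢ ∘ only-v u v)))
                    (χ-yes ((b ℕ.* toℕ u) ≈? (toℕ (v-of u) ℕ.* a)) (on-line u))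
  ... | yes a≡0 = begin
    ΣFin (λ (u : Fin p) → ΣFin (λ (v : Fin p) → χ ((b ℕ.* toℕ u) ≈? (toℕ v ℕ.* a))))
      ≡⟨ ΣFin-single 0ₚ (λ (u : Fin p) → ΣFin (λ (v : Fin p) → χ ((b ℕ.* toℕ u) ≈? (toℕ v ℕ.* a)))) only-u≡0 ⟩
    ΣFin (λ (v : Fin p) → χ ((b ℕ.* toℕ 0ₚ) ≈? (toℕ v ℕ.* a)))
      ≡⟨ ΣFin-cong {p} all-v ⟩
    ΣFin (λ (v : Fin p) → + 1)
      ≡⟨ ΣFin-const p (+ 1) ⟩
    + p * + 1
      ≡⟨ ℤ.*-identityʳ (+ p) ⟩
    + p ∎
    where
    open ≡-Reasoning
    0<p : 0 ℕ.< p
    0<p = ℕ.n≢0⇒n>0 (ℕ.≢-nonZero⁻¹ p)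
    0ₚ : Fin p
    0ₚ = fromℕ< 0<p
    b≢0 : b ≢ 0
    b≢0 b≡0 = ¬a≡0×b≡0 (a≡0 , b≡0)
    va≡b0 : ∀ v → toℕ v ℕ.* a ≡ b ℕ.* 0
    va≡b0 v = trans (cong (toℕ v ℕ.*_) a≡0) (trans (ℕ.*-zeroʳ (toℕ v)) (sym (ℕ.*-zeroʳ b)))
    all-v : ∀ v → χ ((b ℕ.* toℕ 0ₚ) ≈? (toℕ v ℕ.* a)) ≡ + 1
    all-v v = χ-yes ((b ℕ.* toℕ 0ₚ) ≈? (toℕ v ℕ.* a)) (≈-reflexive (cong +_ (trans (cong (b ℕ.*_) (toℕ-fromℕ< 0<p)) (sym (va≡b0 v)))))
    u≡0 : ∀ u v → + (b ℕ.* toℕ u) ≈ + (toℕ v ℕ.* a) → u ≡ 0ₚ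
    u≡0 u v bu≈va = toℕ-injective (trans (≈⇒≡ (toℕ<n u) 0<p (*-cancelˡ-≈ b (<p⇒∤ b<p b≢0)
      (≈-trans (≈-reflexive (sym (ℤ.pos-* b (toℕ u)))) (≈-trans bu≈va (≈-reflexive (trans (cong +_ (va≡b0 v)) (ℤ.pos-* b 0)))))))
      (sym (toℕ-fromℕ< 0<p)))
    only-u≡0 : ∀ u → u ≢ 0ₚ → ΣFin (λ (v : Fin p) → χ ((b ℕ.* toℕ u) ≈? (toℕ v ℕ.* a))) ≡ + 0
    only-u≡0 u u≢0 = ΣFin-zero _ (λ (v : Fin p) → χ-no ((b ℕ.* toℕ u) ≈? (toℕ v ℕ.* a)) (u≢0 ∘ u≡0 u v))

module FiniteGroup {N : ℕ} {_∙_ : Fin N → Fin N → Fin N} {ε : Fin N} {_⁻¹ : Fin N → Fin N}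
  (isGroup : IsGroup _≡_ _∙_ ε _⁻¹) where

  open import Data.Nat as ℕ using (ℕ; zero; suc)
  open import Data.Fin as Fin using (Fin)
  open import Algebra.Structures using (IsGroup)
  open import Relation.Binary.PropositionalEquality

  open FinSum
  open import Data.Integer as ℤ using (ℤ; +_; _+_; _*_; _-_)
  open import Data.Integer.Properties as ℤ using ()
  open import Data.Product using (_,_; proj₁; proj₂)
  open import Function.Base using (_∘_)
  open import Function.Bundles using (_⇔_; mk⇔; Equivalence)
  open import Level using (0ℓ)
  open import Algebra.Bundles using (Group)
  import Algebra.Properties.Group as GroupProperties
  import Algebra.Properties.Monoid.Mult as MonoidMult
  import Algebra.Solver.Monoid as MonoidSolver
  open import Relation.Nullary using (Dec; yes; no)

  open FinGroup _∙_ ε _⁻¹ using (Central; central?; centerSize; Conj; conj?; ClassReps)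
  open IsGroup isGroup using (assoc; identityˡ; identityʳ; inverseˡ; inverseʳ)

  group : Group 0ℓ 0ℓ
  group = record { isGroup = isGroup }

  open GroupProperties group using (∙-cancelˡ; ∙-cancelʳ; \\-leftDividesˡ; \\-leftDividesʳ; ε⁻¹≈ε; ⁻¹-involutive; ⁻¹-anti-homo-∙)
  open MonoidMult (Group.monoid group) using (×-homo-+; ×-assocˡ) renaming (_×_ to _×ᴹ_)
  open MonoidSolver (Group.monoid group) using (solve; _⊜_) renaming (_⊕_ to _⊛_)
  open ≡-Reasoning

  central-ε : Central ε
  central-ε y = trans (identityˡ y) (sym (identityʳ y))

  central-∙ : ∀ {z w} → Central z → Central w → Central (z ∙ w)
  central-∙ {z} {w} z-central w-central y = begin
    (z ∙ w) ∙ y   ≡⟨ assoc z w y ⟩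
    z ∙ (w ∙ y)   ≡⟨ cong (z ∙_) (w-central y) ⟩
    z ∙ (y ∙ w)   ≡⟨ sym (assoc z y w) ⟩
    (z ∙ y) ∙ w   ≡⟨ cong (_∙ w) (z-central y) ⟩
    (y ∙ z) ∙ w   ≡⟨ assoc y z w ⟩
    y ∙ (z ∙ w)   ∎

  infixr 30 _^_
  _^_ : Fin N → ℕ → Fin N
  x ^ k = k ×ᴹ x

  ^-+ : ∀ x k l → x ^ (k ℕ.+ l) ≡ x ^ k ∙ x ^ l
  ^-+ x k l = ×-homo-+ x k l

  ^-* : ∀ x k l → x ^ (k ℕ.* l) ≡ (x ^ l) ^ k
  ^-* x k l = sym (×-assocˡ x k l)

  ε^ : ∀ k → ε ^ k ≡ ε
  ε^ zero    = refl
  ε^ (suc k) = trans (identityˡ (ε ^ k)) (ε^ k)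

  central-^ : ∀ {z} → Central z → ∀ k → Central (z ^ k)
  central-^ z-central zero    = central-ε
  central-^ z-central (suc k) = central-∙ z-central (central-^ z-central k)

  conj : Fin N → Fin N → Fin N
  conj x g = (g ∙ x) ∙ (g ⁻¹)

  conj-∙ : ∀ x g h → conj x (g ∙ h) ≡ g ∙ (conj x h ∙ (g ⁻¹))
  conj-∙ x g h = trans (cong (((g ∙ h) ∙ x) ∙_) (⁻¹-anti-homo-∙ g h))
    (solve 5 (λ a b c d e → ((a ⊛ b) ⊛ c) ⊛ (d ⊛ e) ⊜ a ⊛ (((b ⊛ c) ⊛ d) ⊛ e)) refl g h x (h ⁻¹) (g ⁻¹))

  conj-refl : ∀ x → Conj x x
  conj-refl x = ε , sym (trans (cong₂ _∙_ (identityˡ x) ε⁻¹≈ε) (identityʳ x))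

  conj-sym : ∀ {x y} → Conj x y → Conj y x
  conj-sym {x} {y} (g , y≡gxg⁻¹) = g ⁻¹ , sym (begin
    ((g ⁻¹) ∙ y) ∙ ((g ⁻¹) ⁻¹)
      ≡⟨ cong₂ (λ s t → ((g ⁻¹) ∙ s) ∙ t) y≡gxg⁻¹ (⁻¹-involutive g) ⟩
    ((g ⁻¹) ∙ ((g ∙ x) ∙ (g ⁻¹))) ∙ g
      ≡⟨ solve 4 (λ a b c d → (a ⊛ ((b ⊛ c) ⊛ d)) ⊛ b ⊜ ((a ⊛ b) ⊛ c) ⊛ (d ⊛ b)) refl (g ⁻¹) g x (g ⁻¹) ⟩
    (((g ⁻¹) ∙ g) ∙ x) ∙ ((g ⁻¹) ∙ g)
      ≡⟨ cong₂ (λ s t → (s ∙ x) ∙ t) (inverseˡ g) (inverseˡ g) ⟩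
    (ε ∙ x) ∙ ε
      ≡⟨ trans (identityʳ _) (identityˡ x) ⟩
    x ∎)

  conj-trans : ∀ {x y w} → Conj x y → Conj y w → Conj x w
  conj-trans {x} (g , y≡xᵍ) (h , w≡yʰ) = h ∙ g , trans w≡yʰ (trans (cong (λ t → (h ∙ t) ∙ (h ⁻¹)) y≡xᵍ)
    (trans (assoc h (conj x g) (h ⁻¹)) (sym (conj-∙ x h g))))

  central-conj : ∀ {x y} → Central x → Conj x y → y ≡ x
  central-conj {x} x-central (g , y≡xᵍ) = trans y≡xᵍ (trans (cong (_∙ (g ⁻¹)) (sym (x-central g)))
    (trans (assoc x g (g ⁻¹)) (trans (cong (x ∙_) (inverseʳ g)) (identityʳ x))))

  conj≡⇔commute : ∀ x g h → (conj x (g ∙ h) ≡ conj x g) ⇔ (h ∙ x ≡ x ∙ h)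
  conj≡⇔commute x g h = mk⇔
    (λ xᵍʰ≡xᵍ → fixed⇒commute (∙-cancelʳ (g ⁻¹) _ _ (∙-cancelˡ g _ _ (trans (sym (conj-∙ x g h)) (trans xᵍʰ≡xᵍ (assoc g x (g ⁻¹)))))))
    (λ hx≡xh → trans (conj-∙ x g h) (trans (cong (λ t → g ∙ (t ∙ (g ⁻¹))) (commute⇒fixed hx≡xh)) (sym (assoc g x (g ⁻¹)))))
    where
    fixed⇒commute : conj x h ≡ x → h ∙ x ≡ x ∙ h
    fixed⇒commute xʰ≡x = trans (sym (trans (assoc (h ∙ x) (h ⁻¹) h) (trans (cong ((h ∙ x) ∙_) (inverseˡ h)) (identityʳ (h ∙ x))))) (cong (_∙ h) xʰ≡x)
    commute⇒fixed : h ∙ x ≡ x ∙ h → conj x h ≡ x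
    commute⇒fixed hx≡xh = trans (cong (_∙ (h ⁻¹)) hx≡xh) (trans (assoc x h (h ⁻¹)) (trans (cong (x ∙_) (inverseʳ h)) (identityʳ x)))

  classSize centralizerSize : Fin N → ℤ
  classSize x = ΣFin (λ y → χ (conj? x y))
  centralizerSize x = ΣFin (λ h → χ ((h ∙ x) Fin.≟ (x ∙ h)))

  private
    ΣFin-δ-conj : ∀ x y → ΣFin (λ g → δ (conj x g) y) ≡ χ (conj? x y) * centralizerSize x
    ΣFin-δ-conj x y with conj? x y
    ... | yes (g , y≡xᵍ) = begin
      ΣFin (λ h → δ (conj x h) y)
        ≡⟨ sym (ΣFin-permute (g ∙_) ((g ⁻¹) ∙_) (\\-leftDividesˡ g) (\\-leftDividesʳ g) (λ h → δ (conj x h) y)) ⟩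
      ΣFin (λ h → δ (conj x (g ∙ h)) y)
        ≡⟨ ΣFin-cong (λ h → χ-cong (conj x (g ∙ h) Fin.≟ y) ((h ∙ x) Fin.≟ (x ∙ h))
                                                   (λ xᵍʰ≡y → Equivalence.to (conj≡⇔commute x g h) (trans xᵍʰ≡y y≡xᵍ))
                                                   (λ hx≡xh → trans (Equivalence.from (conj≡⇔commute x g h) hx≡xh) (sym y≡xᵍ))) ⟩
      centralizerSize x
        ≡⟨ sym (ℤ.*-identityˡ (centralizerSize x)) ⟩
      + 1 * centralizerSize x ∎
    ... | no ¬x~y = trans (ΣFin-zero _ (λ g → δ-≢ (λ xᵍ≡y → ¬x~y (g , sym xᵍ≡y)))) (sym (ℤ.*-zeroˡ (centralizerSize x)))

  orbit-stabilizer : ∀ x → + N ≡ classSize x * centralizerSize x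
  orbit-stabilizer x = begin
    + N
      ≡⟨ sym (trans (ΣFin-const N (+ 1)) (ℤ.*-identityʳ (+ N))) ⟩
    ΣFin (λ (g : Fin N) → + 1)
      ≡⟨ ΣFin-cong (λ g → sym (trans (ΣFin-single (conj x g) (δ (conj x g)) (λ y y≢xᵍ → δ-≢ (y≢xᵍ ∘ sym))) (δ-refl (conj x g)))) ⟩
    ΣFin (λ g → ΣFin (λ y → δ (conj x g) y))
      ≡⟨ ΣFin-swap (λ g y → δ (conj x g) y) ⟩
    ΣFin (λ y → ΣFin (λ g → δ (conj x g) y))
      ≡⟨ ΣFin-cong (ΣFin-δ-conj x) ⟩
    ΣFin (λ y → χ (conj? x y) * centralizerSize x)
      ≡⟨ ΣFin-*ʳ (centralizerSize x) (λ y → χ (conj? x y)) ⟩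
    classSize x * centralizerSize x ∎

  centerSize≡ΣFin : + centerSize ≡ ΣFin (λ x → χ (central? x))
  centerSize≡ΣFin = length-filter-tabulate central? (λ x → x)

  module _ {m} (R : ClassReps m) where
    open ClassReps R

    ΣFin-reps : ∀ y → ΣFin (λ j → χ (conj? (rep j) y)) ≡ + 1 - χ (central? y)
    ΣFin-reps y = by-centrality (central? y)
      where
      by-centrality : (d : Dec (Central y)) → ΣFin (λ j → χ (conj? (rep j) y)) ≡ + 1 - χ d
      by-centrality (yes y-central) = ΣFin-zero _ (λ j → χ-no (conj? (rep j) y)
        (λ rⱼ~y → nonCentral j (subst Central (sym (central-conj y-central (conj-sym rⱼ~y))) y-central)))
      by-centrality (no y-noncentral) = trans
        (ΣFin-single i (λ j → χ (conj? (rep j) y))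
          (λ j j≢i → χ-no (conj? (rep j) y) (λ rⱼ~y → j≢i (sym (distinct i j (conj-trans rᵢ~y (conj-sym rⱼ~y)))))))
        (χ-yes (conj? (rep i) y) rᵢ~y)
        where
        i = proj₁ (cover y y-noncentral)
        rᵢ~y = proj₂ (cover y y-noncentral)

    class-equation : ∀ s → (∀ j → classSize (rep j) ≡ + s) → + m * + s ≡ + N - + centerSize
    class-equation s classSize≡s = begin
      + m * + s
        ≡⟨ sym (ΣFin-const m (+ s)) ⟩
      ΣFin (λ (j : Fin m) → + s)
        ≡⟨ ΣFin-cong (λ j → sym (classSize≡s j)) ⟩
      ΣFin (λ j → ΣFin (λ y → χ (conj? (rep j) y)))
        ≡⟨ ΣFin-swap (λ j y → χ (conj? (rep j) y)) ⟩
      ΣFin (λ y → ΣFin (λ j → χ (conj? (rep j) y)))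
        ≡⟨ ΣFin-cong ΣFin-reps ⟩
      ΣFin (λ y → + 1 - χ (central? y))
        ≡⟨ ΣFin-- (λ _ → + 1) (λ y → χ (central? y)) ⟩
      ΣFin (λ (y : Fin N) → + 1) - ΣFin (λ y → χ (central? y))
        ≡⟨ cong₂ _-_ (trans (ΣFin-const N (+ 1)) (ℤ.*-identityʳ (+ N))) (sym centerSize≡ΣFin) ⟩
      + N - + centerSize ∎

module CentralQuotient (p : ℕ) (p-prime : Prime p) {N : ℕ} {_∙_ : Fin N → Fin N → Fin N} {ε : Fin N} {_⁻¹ : Fin N → Fin N}
  (isGroup : IsGroup _≡_ _∙_ ε _⁻¹) (quotient : FinGroup.CentralQuotientIsZp×Zp _∙_ ε _⁻¹ p p-prime) where

  open import Data.Nat as ℕ using (ℕ; zero; suc; _%_; _∸_)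
  open import Data.Nat.Primality using (Prime; prime⇒nonTrivial)
  open import Data.Fin as Fin using (Fin; toℕ; fromℕ<)
  open import Algebra.Structures using (IsGroup)
  open import Relation.Binary.PropositionalEquality

  open Congruence p p-prime
  open CompleteMultipartiteGraphs using (CompleteMultipartite)
  open FinSum
  open import Data.Nat.Properties as ℕ using ()
  open import Data.Nat.DivMod as ℕ using ()
  open import Data.Nat.Divisibility as ℕ using ()
  open import Data.Fin.Properties using (toℕ<n; toℕ-injective; toℕ-fromℕ<; ¬Fin0)
  open import Data.Product.Properties using (≡-dec)
  open import Data.Integer as ℤ using (ℤ; +_; _+_; _*_; _-_)
  open import Data.Integer.Properties as ℤ using ()
  open import Data.Integer.Tactic.RingSolver using (solve-∀)
  open import Data.Product using (_×_; _,_; proj₁; proj₂)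
  open import Function.Base using (_∘_)
  open import Function.Bundles using (_⇔_; mk⇔; Equivalence)
  open import Algebra.Bundles using (Group)
  import Algebra.Properties.Group as GroupProperties
  import Algebra.Solver.Monoid as MonoidSolver
  import Relation.Binary.Reasoning.Setoid
  open import Relation.Nullary using (¬_; Dec; yes; no; does; ¬?)
  open import Relation.Nullary.Negation using (contradiction)
  open import Data.Sum using (inj₁; inj₂; [_,_]′)
  open import Data.Bool using (Bool; true)
  open import Data.List using (length; filter; tabulate)
  open import Relation.Binary.Structures using (IsEquivalence)
  open import Relation.Nullary.Decidable using (dec-true)

  open FinGroup _∙_ ε _⁻¹ using (Central; Abelian; central?; centerSize; Conj; conj?; ClassReps; Adjacent; adjacent?; adjMatrix)
  open FinGroup.CentralQuotientIsZp×Zp quotient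
  open IsGroup isGroup using (assoc; identityˡ; identityʳ; inverseˡ)
  module ≈-Reasoning = Relation.Binary.Reasoning.Setoid ≈-setoid

  private
    _⊕_ : Fin p × Fin p → Fin p × Fin p → Fin p × Fin p
    _⊕_ = FinGroup._⊕_ _∙_ ε _⁻¹ p p-prime

  open FiniteGroup isGroup
  open GroupProperties group using (∙-cancelˡ; ∙-cancelʳ; \\-leftDividesˡ; \\-leftDividesʳ)
  open MonoidSolver (Group.monoid group) using (solve; _⊜_) renaming (_⊕_ to _⊛_)

  c₁ c₂ : Fin N → ℕ
  c₁ x = toℕ (proj₁ (φ x))
  c₂ x = toℕ (proj₂ (φ x))

  c₁-homo : ∀ x y → + c₁ (x ∙ y) ≈ + c₁ x + + c₁ y
  c₁-homo x y = ≈-trans (≈-reflexive (cong +_ (trans (cong (toℕ ∘ proj₁) (hom x y)) (toℕ-fromℕ< _)))) (%-≈ (c₁ x ℕ.+ c₁ y))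

  c₂-homo : ∀ x y → + c₂ (x ∙ y) ≈ + c₂ x + + c₂ y
  c₂-homo x y = ≈-trans (≈-reflexive (cong +_ (trans (cong (toℕ ∘ proj₂) (hom x y)) (toℕ-fromℕ< _)))) (%-≈ (c₂ x ℕ.+ c₂ y))

  φ-≈-injective : ∀ {x y} → + c₁ x ≈ + c₁ y → + c₂ x ≈ + c₂ y → φ x ≡ φ y
  φ-≈-injective c₁≈ c₂≈ = cong₂ _,_ (toℕ-injective (≈⇒≡ (toℕ<n _) (toℕ<n _) c₁≈)) (toℕ-injective (≈⇒≡ (toℕ<n _) (toℕ<n _) c₂≈))

  c₁-ε : + c₁ ε ≈ + 0
  c₁-ε = +-cancelʳ-≈ (+ c₁ ε) (≈-trans (≈-sym (c₁-homo ε ε))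
    (≈-reflexive (trans (cong (+_ ∘ c₁) (identityˡ ε)) (sym (ℤ.+-identityˡ (+ c₁ ε))))))

  c₂-ε : + c₂ ε ≈ + 0
  c₂-ε = +-cancelʳ-≈ (+ c₂ ε) (≈-trans (≈-sym (c₂-homo ε ε))
    (≈-reflexive (trans (cong (+_ ∘ c₂) (identityˡ ε)) (sym (ℤ.+-identityˡ (+ c₂ ε))))))

  central⇐φ≡φε : ∀ x → φ x ≡ φ ε → Central x
  central⇐φ≡φε x = Equivalence.to (kernel x)

  central⇒φ≡φε : ∀ x → Central x → φ x ≡ φ ε
  central⇒φ≡φε x = Equivalence.from (kernel x)

  central⇐c≈0 : ∀ x → + c₁ x ≈ + 0 → + c₂ x ≈ + 0 → Central x
  central⇐c≈0 x c₁≈0 c₂≈0 = central⇐φ≡φε x (φ-≈-injective (≈-trans c₁≈0 (≈-sym c₁-ε)) (≈-trans c₂≈0 (≈-sym c₂-ε)))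

  φ-comm : ∀ x y → φ (x ∙ y) ≡ φ (y ∙ x)
  φ-comm x y = φ-≈-injective
    (≈-trans (c₁-homo x y) (≈-trans (≈-reflexive (ℤ.+-comm (+ c₁ x) (+ c₁ y))) (≈-sym (c₁-homo y x))))
    (≈-trans (c₂-homo x y) (≈-trans (≈-reflexive (ℤ.+-comm (+ c₂ x) (+ c₂ y))) (≈-sym (c₂-homo y x))))

  central-\\ : ∀ x y → φ x ≡ φ y → Central ((x ⁻¹) ∙ y)
  central-\\ x y φx≡φy = central⇐φ≡φε ((x ⁻¹) ∙ y) (begin
    φ ((x ⁻¹) ∙ y)        ≡⟨ hom (x ⁻¹) y ⟩
    φ (x ⁻¹) ⊕ φ y      ≡⟨ cong (φ (x ⁻¹) ⊕_) (sym φx≡φy) ⟩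
    φ (x ⁻¹) ⊕ φ x      ≡⟨ sym (hom (x ⁻¹) x) ⟩
    φ ((x ⁻¹) ∙ x)        ≡⟨ cong φ (inverseˡ x) ⟩
    φ ε                 ∎)
    where open ≡-Reasoning

  c₁-^ : ∀ x k → + c₁ (x ^ k) ≈ + k * + c₁ x
  c₁-^ x zero    = ≈-trans c₁-ε (≈-reflexive (sym (ℤ.*-zeroˡ (+ c₁ x))))
  c₁-^ x (suc k) = ≈-trans (c₁-homo x (x ^ k)) (≈-trans (+-cong (≈-refl {+ c₁ x}) (c₁-^ x k)) (≈-reflexive (sym (ℤ.suc-* (+ k) (+ c₁ x)))))

  c₂-^ : ∀ x k → + c₂ (x ^ k) ≈ + k * + c₂ x
  c₂-^ x zero    = ≈-trans c₂-ε (≈-reflexive (sym (ℤ.*-zeroˡ (+ c₂ x))))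
  c₂-^ x (suc k) = ≈-trans (c₂-homo x (x ^ k)) (≈-trans (+-cong (≈-refl {+ c₂ x}) (c₂-^ x k)) (≈-reflexive (sym (ℤ.suc-* (+ k) (+ c₂ x)))))

  private
    1<p : 1 ℕ.< p
    1<p = ℕ.nonTrivial⇒n>1 p {{prime⇒nonTrivial p-prime}}

    0<p : 0 ℕ.< p
    0<p = ℕ.<-trans ℕ.0<1+n 1<p

    0ₚ 1ₚ : Fin p
    0ₚ = fromℕ< 0<p
    1ₚ = fromℕ< 1<p

  e₁ e₂ : Fin N
  e₁ = proj₁ (surjective (1ₚ , 0ₚ))
  e₂ = proj₁ (surjective (0ₚ , 1ₚ))

  c₁-e₁ : c₁ e₁ ≡ 1
  c₁-e₁ = trans (cong (toℕ ∘ proj₁) (proj₂ (surjective (1ₚ , 0ₚ)))) (toℕ-fromℕ< 1<p)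

  c₂-e₁ : c₂ e₁ ≡ 0
  c₂-e₁ = trans (cong (toℕ ∘ proj₂) (proj₂ (surjective (1ₚ , 0ₚ)))) (toℕ-fromℕ< 0<p)

  c₁-e₂ : c₁ e₂ ≡ 0
  c₁-e₂ = trans (cong (toℕ ∘ proj₁) (proj₂ (surjective (0ₚ , 1ₚ)))) (toℕ-fromℕ< 0<p)

  c₂-e₂ : c₂ e₂ ≡ 1
  c₂-e₂ = trans (cong (toℕ ∘ proj₂) (proj₂ (surjective (0ₚ , 1ₚ)))) (toℕ-fromℕ< 1<p)

  normalForm : Fin N → Fin N
  normalForm g = e₁ ^ c₁ g ∙ e₂ ^ c₂ g

  φ-normalForm : ∀ g → φ (normalForm g) ≡ φ g
  φ-normalForm g = φ-≈-injective
    (begin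
      + c₁ (e₁ ^ c₁ g ∙ e₂ ^ c₂ g)               ≈⟨ c₁-homo (e₁ ^ c₁ g) (e₂ ^ c₂ g) ⟩
      + c₁ (e₁ ^ c₁ g) + + c₁ (e₂ ^ c₂ g)        ≈⟨ +-cong (c₁-^ e₁ (c₁ g)) (c₁-^ e₂ (c₂ g)) ⟩
      + c₁ g * + c₁ e₁ + + c₂ g * + c₁ e₂        ≡⟨ cong₂ (λ u v → + c₁ g * + u + + c₂ g * + v) c₁-e₁ c₁-e₂ ⟩
      + c₁ g * + 1 + + c₂ g * + 0                ≡⟨ k*1+l*0≡k (+ c₁ g) (+ c₂ g) ⟩
      + c₁ g                                     ∎)
    (begin
      + c₂ (e₁ ^ c₁ g ∙ e₂ ^ c₂ g)               ≈⟨ c₂-homo (e₁ ^ c₁ g) (e₂ ^ c₂ g) ⟩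
      + c₂ (e₁ ^ c₁ g) + + c₂ (e₂ ^ c₂ g)        ≈⟨ +-cong (c₂-^ e₁ (c₁ g)) (c₂-^ e₂ (c₂ g)) ⟩
      + c₁ g * + c₂ e₁ + + c₂ g * + c₂ e₂        ≡⟨ cong₂ (λ u v → + c₁ g * + u + + c₂ g * + v) c₂-e₁ c₂-e₂ ⟩
      + c₁ g * + 0 + + c₂ g * + 1                ≡⟨ k*0+l*1≡l (+ c₁ g) (+ c₂ g) ⟩
      + c₂ g                                     ∎)
    where
    open ≈-Reasoning
    k*1+l*0≡k : ∀ k l → k * + 1 + l * + 0 ≡ k
    k*1+l*0≡k = solve-∀
    k*0+l*1≡l : ∀ k l → k * + 0 + l * + 1 ≡ l
    k*0+l*1≡l = solve-∀

  centralPart : Fin N → Fin N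
  centralPart g = (normalForm g ⁻¹) ∙ g

  central-centralPart : ∀ g → Central (centralPart g)
  central-centralPart g = central-\\ (normalForm g) g (φ-normalForm g)

  normalForm∙centralPart : ∀ g → normalForm g ∙ centralPart g ≡ g
  normalForm∙centralPart g = \\-leftDividesˡ (normalForm g) g

  ∙-central-interchange : ∀ x y {z w} → Central z → Central w → (x ∙ z) ∙ (y ∙ w) ≡ (x ∙ y) ∙ (z ∙ w)
  ∙-central-interchange x y {z} {w} z-central w-central = begin
    (x ∙ z) ∙ (y ∙ w)   ≡⟨ solve 4 (λ x z y w → (x ⊛ z) ⊛ (y ⊛ w) ⊜ x ⊛ ((z ⊛ y) ⊛ w)) refl x z y w ⟩
    x ∙ ((z ∙ y) ∙ w)   ≡⟨ cong (λ t → x ∙ (t ∙ w)) (z-central y) ⟩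
    x ∙ ((y ∙ z) ∙ w)   ≡⟨ solve 4 (λ x y z w → x ⊛ ((y ⊛ z) ⊛ w) ⊜ (x ⊛ y) ⊛ (z ⊛ w)) refl x y z w ⟩
    (x ∙ y) ∙ (z ∙ w)   ∎
    where open ≡-Reasoning

  commute-up-to-central : ∀ x y {z w} → Central z → Central w →
                          ((x ∙ z) ∙ (y ∙ w) ≡ (y ∙ w) ∙ (x ∙ z)) ⇔ (x ∙ y ≡ y ∙ x)
  commute-up-to-central x y {z} {w} z-central w-central = mk⇔
    (λ xz∙yw≡yw∙xz → ∙-cancelʳ (z ∙ w) (x ∙ y) (y ∙ x) (begin
      (x ∙ y) ∙ (z ∙ w)   ≡⟨ sym (∙-central-interchange x y z-central w-central) ⟩
      (x ∙ z) ∙ (y ∙ w)   ≡⟨ xz∙yw≡yw∙xz ⟩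
      (y ∙ w) ∙ (x ∙ z)   ≡⟨ ∙-central-interchange y x w-central z-central ⟩
      (y ∙ x) ∙ (w ∙ z)   ≡⟨ cong ((y ∙ x) ∙_) (w-central z) ⟩
      (y ∙ x) ∙ (z ∙ w)   ∎))
    (λ xy≡yx → begin
      (x ∙ z) ∙ (y ∙ w)   ≡⟨ ∙-central-interchange x y z-central w-central ⟩
      (x ∙ y) ∙ (z ∙ w)   ≡⟨ cong₂ _∙_ xy≡yx (z-central w) ⟩
      (y ∙ x) ∙ (w ∙ z)   ≡⟨ sym (∙-central-interchange y x w-central z-central) ⟩
      (y ∙ w) ∙ (x ∙ z)   ∎)
    where open ≡-Reasoning

  commutator : Fin N
  commutator = ((e₂ ∙ e₁) ⁻¹) ∙ (e₁ ∙ e₂)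

  central-commutator : Central commutator
  central-commutator = central-\\ (e₂ ∙ e₁) (e₁ ∙ e₂) (φ-comm e₂ e₁)

  e₁∙e₂ : e₁ ∙ e₂ ≡ (e₂ ∙ e₁) ∙ commutator
  e₁∙e₂ = sym (\\-leftDividesˡ (e₂ ∙ e₁) (e₁ ∙ e₂))

  e₁∙e₂^ : ∀ j → e₁ ∙ e₂ ^ j ≡ (e₂ ^ j ∙ e₁) ∙ commutator ^ j
  e₁∙e₂^ zero    = trans (identityʳ e₁) (sym (trans (identityʳ (ε ∙ e₁)) (identityˡ e₁)))
  e₁∙e₂^ (suc j) = begin
    e₁ ∙ (e₂ ∙ B)
      ≡⟨ sym (assoc e₁ e₂ B) ⟩
    (e₁ ∙ e₂) ∙ B
      ≡⟨ cong (_∙ B) e₁∙e₂ ⟩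
    ((e₂ ∙ e₁) ∙ κ) ∙ B
      ≡⟨ solve 4 (λ x y u v → ((x ⊛ y) ⊛ u) ⊛ v ⊜ (x ⊛ y) ⊛ (u ⊛ v)) refl e₂ e₁ κ B ⟩
    (e₂ ∙ e₁) ∙ (κ ∙ B)
      ≡⟨ cong ((e₂ ∙ e₁) ∙_) (central-commutator B) ⟩
    (e₂ ∙ e₁) ∙ (B ∙ κ)
      ≡⟨ solve 4 (λ x y u v → (x ⊛ y) ⊛ (u ⊛ v) ⊜ x ⊛ ((y ⊛ u) ⊛ v)) refl e₂ e₁ B κ ⟩
    e₂ ∙ ((e₁ ∙ B) ∙ κ)
      ≡⟨ cong (λ t → e₂ ∙ (t ∙ κ)) (e₁∙e₂^ j) ⟩
    e₂ ∙ (((B ∙ e₁) ∙ κ ^ j) ∙ κ)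
      ≡⟨ solve 5 (λ x y u v w → x ⊛ (((y ⊛ u) ⊛ v) ⊛ w) ⊜ ((x ⊛ y) ⊛ u) ⊛ (v ⊛ w)) refl e₂ B e₁ (κ ^ j) κ ⟩
    ((e₂ ∙ B) ∙ e₁) ∙ (κ ^ j ∙ κ)
      ≡⟨ cong (((e₂ ∙ B) ∙ e₁) ∙_) (central-^ central-commutator j κ) ⟩
    ((e₂ ∙ B) ∙ e₁) ∙ (κ ∙ κ ^ j) ∎
    where
    open ≡-Reasoning
    κ = commutator
    B = e₂ ^ j

  e₁^∙e₂^ : ∀ k j → e₁ ^ k ∙ e₂ ^ j ≡ (e₂ ^ j ∙ e₁ ^ k) ∙ commutator ^ (k ℕ.* j)
  e₁^∙e₂^ zero    j = trans (identityˡ (e₂ ^ j)) (sym (trans (identityʳ (e₂ ^ j ∙ ε)) (identityʳ (e₂ ^ j))))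
  e₁^∙e₂^ (suc k) j = begin
    (e₁ ∙ A) ∙ B
      ≡⟨ assoc e₁ A B ⟩
    e₁ ∙ (A ∙ B)
      ≡⟨ cong (e₁ ∙_) (e₁^∙e₂^ k j) ⟩
    e₁ ∙ ((B ∙ A) ∙ κ ^ (k ℕ.* j))
      ≡⟨ solve 4 (λ x y u v → x ⊛ ((y ⊛ u) ⊛ v) ⊜ ((x ⊛ y) ⊛ u) ⊛ v) refl e₁ B A (κ ^ (k ℕ.* j)) ⟩
    ((e₁ ∙ B) ∙ A) ∙ κ ^ (k ℕ.* j)
      ≡⟨ cong (λ t → (t ∙ A) ∙ κ ^ (k ℕ.* j)) (e₁∙e₂^ j) ⟩
    (((B ∙ e₁) ∙ κ ^ j) ∙ A) ∙ κ ^ (k ℕ.* j)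
      ≡⟨ solve 5 (λ x y u v w → (((x ⊛ y) ⊛ u) ⊛ v) ⊛ w ⊜ ((x ⊛ y) ⊛ (u ⊛ v)) ⊛ w)
                                                 refl B e₁ (κ ^ j) A (κ ^ (k ℕ.* j)) ⟩
    ((B ∙ e₁) ∙ (κ ^ j ∙ A)) ∙ κ ^ (k ℕ.* j)
      ≡⟨ cong (λ t → ((B ∙ e₁) ∙ t) ∙ κ ^ (k ℕ.* j)) (central-^ central-commutator j A) ⟩
    ((B ∙ e₁) ∙ (A ∙ κ ^ j)) ∙ κ ^ (k ℕ.* j)
      ≡⟨ solve 5 (λ x y u v w → ((x ⊛ y) ⊛ (u ⊛ v)) ⊛ w ⊜ (x ⊛ (y ⊛ u)) ⊛ (v ⊛ w))
                                                 refl B e₁ A (κ ^ j) (κ ^ (k ℕ.* j)) ⟩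
    (B ∙ (e₁ ∙ A)) ∙ (κ ^ j ∙ κ ^ (k ℕ.* j))
      ≡⟨ cong ((B ∙ (e₁ ∙ A)) ∙_) (sym (^-+ κ j (k ℕ.* j))) ⟩
    (B ∙ (e₁ ∙ A)) ∙ κ ^ (j ℕ.+ k ℕ.* j) ∎
    where
    open ≡-Reasoning
    κ = commutator
    A = e₁ ^ k
    B = e₂ ^ j

  normalForm-∙ : ∀ i j k l → ((e₁ ^ i ∙ e₂ ^ j) ∙ (e₁ ^ k ∙ e₂ ^ l)) ∙ commutator ^ (j ℕ.* k) ≡ e₁ ^ (i ℕ.+ k) ∙ e₂ ^ (j ℕ.+ l)
  normalForm-∙ i j k l = begin
    ((Aᵢ ∙ Bⱼ) ∙ (Aₖ ∙ Bₗ)) ∙ C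
      ≡⟨ solve 5 (λ x y u v w → ((x ⊛ y) ⊛ (u ⊛ v)) ⊛ w ⊜ x ⊛ ((y ⊛ u) ⊛ (v ⊛ w))) refl Aᵢ Bⱼ Aₖ Bₗ C ⟩
    Aᵢ ∙ ((Bⱼ ∙ Aₖ) ∙ (Bₗ ∙ C))
      ≡⟨ cong (λ t → Aᵢ ∙ ((Bⱼ ∙ Aₖ) ∙ t)) (sym (central-^ central-commutator (j ℕ.* k) Bₗ)) ⟩
    Aᵢ ∙ ((Bⱼ ∙ Aₖ) ∙ (C ∙ Bₗ))
      ≡⟨ solve 5 (λ x y u v w → x ⊛ ((y ⊛ u) ⊛ (v ⊛ w)) ⊜ x ⊛ (((y ⊛ u) ⊛ v) ⊛ w)) refl Aᵢ Bⱼ Aₖ C Bₗ ⟩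
    Aᵢ ∙ (((Bⱼ ∙ Aₖ) ∙ C) ∙ Bₗ)
      ≡⟨ cong (λ e → Aᵢ ∙ (((Bⱼ ∙ Aₖ) ∙ commutator ^ e) ∙ Bₗ)) (ℕ.*-comm j k) ⟩
    Aᵢ ∙ (((Bⱼ ∙ Aₖ) ∙ commutator ^ (k ℕ.* j)) ∙ Bₗ)
      ≡⟨ cong (λ t → Aᵢ ∙ (t ∙ Bₗ)) (sym (e₁^∙e₂^ k j)) ⟩
    Aᵢ ∙ ((Aₖ ∙ Bⱼ) ∙ Bₗ)
      ≡⟨ solve 4 (λ x y u v → x ⊛ ((y ⊛ u) ⊛ v) ⊜ (x ⊛ y) ⊛ (u ⊛ v)) refl Aᵢ Aₖ Bⱼ Bₗ ⟩
    (Aᵢ ∙ Aₖ) ∙ (Bⱼ ∙ Bₗ)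
      ≡⟨ sym (cong₂ _∙_ (^-+ e₁ i k) (^-+ e₂ j l)) ⟩
    e₁ ^ (i ℕ.+ k) ∙ e₂ ^ (j ℕ.+ l) ∎
    where
    open ≡-Reasoning
    Aᵢ = e₁ ^ i
    Bⱼ = e₂ ^ j
    Aₖ = e₁ ^ k
    Bₗ = e₂ ^ l
    C = commutator ^ (j ℕ.* k)

  -- Both products have normal form e₁ ^ (i + k) ∙ e₂ ^ (j + l), up to different powers of the commutator.
  commute⇔ : ∀ g h → (g ∙ h ≡ h ∙ g) ⇔ (commutator ^ (c₂ g ℕ.* c₁ h) ≡ commutator ^ (c₂ h ℕ.* c₁ g))
  commute⇔ g h = mk⇔
    (λ gh≡hg → ∙-cancelˡ (x ∙ y) _ _ (trans same-normal-form (cong (_∙ commutator ^ (c₂ h ℕ.* c₁ g)) (sym (to reduce (split gh≡hg))))))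
    (λ κ≡κ → unsplit (from reduce (∙-cancelʳ _ (x ∙ y) (y ∙ x) (trans same-normal-form (cong ((y ∙ x) ∙_) (sym κ≡κ))))))
    where
    open Equivalence
    x = normalForm g
    y = normalForm h
    reduce = commute-up-to-central x y (central-centralPart g) (central-centralPart h)
    same-normal-form : (x ∙ y) ∙ commutator ^ (c₂ g ℕ.* c₁ h) ≡ (y ∙ x) ∙ commutator ^ (c₂ h ℕ.* c₁ g)
    same-normal-form = trans (normalForm-∙ (c₁ g) (c₂ g) (c₁ h) (c₂ h))
      (trans (cong₂ (λ u v → e₁ ^ u ∙ e₂ ^ v) (ℕ.+-comm (c₁ g) (c₁ h)) (ℕ.+-comm (c₂ g) (c₂ h)))
             (sym (normalForm-∙ (c₁ h) (c₂ h) (c₁ g) (c₂ g))))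
    split : g ∙ h ≡ h ∙ g → (x ∙ centralPart g) ∙ (y ∙ centralPart h) ≡ (y ∙ centralPart h) ∙ (x ∙ centralPart g)
    split gh≡hg = trans (cong₂ _∙_ (normalForm∙centralPart g) (normalForm∙centralPart h))
                        (trans gh≡hg (sym (cong₂ _∙_ (normalForm∙centralPart h) (normalForm∙centralPart g))))
    unsplit : (x ∙ centralPart g) ∙ (y ∙ centralPart h) ≡ (y ∙ centralPart h) ∙ (x ∙ centralPart g) → g ∙ h ≡ h ∙ g
    unsplit e = trans (sym (cong₂ _∙_ (normalForm∙centralPart g) (normalForm∙centralPart h)))
                      (trans e (cong₂ _∙_ (normalForm∙centralPart h) (normalForm∙centralPart g)))

  commute-respects-φ : ∀ {x x′ y y′} → φ x ≡ φ x′ → φ y ≡ φ y′ → x ∙ y ≡ y ∙ x → x′ ∙ y′ ≡ y′ ∙ x′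
  commute-respects-φ {x} {x′} {y} {y′} φx≡ φy≡ xy≡yx = Equivalence.from (commute⇔ x′ y′)
    (subst₂ (λ u v → commutator ^ u ≡ commutator ^ v) (cong₂ ℕ._*_ (c₂≡ φx≡) (c₁≡ φy≡)) (cong₂ ℕ._*_ (c₂≡ φy≡) (c₁≡ φx≡))
      (Equivalence.to (commute⇔ x y) xy≡yx))
    where
    c₁≡ : ∀ {u v} → φ u ≡ φ v → c₁ u ≡ c₁ v
    c₁≡ = cong (toℕ ∘ proj₁)
    c₂≡ : ∀ {u v} → φ u ≡ φ v → c₂ u ≡ c₂ v
    c₂≡ = cong (toℕ ∘ proj₂)

  commutator^p : commutator ^ p ≡ ε
  commutator^p = begin
    commutator ^ p
      ≡⟨ cong (commutator ^_) (sym (ℕ.*-identityʳ p)) ⟩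
    commutator ^ (p ℕ.* 1)
      ≡⟨ ∙-cancelˡ (e₂ ^ 1 ∙ e₁ ^ p) _ _ (trans (sym (e₁^∙e₂^ p 1)) (trans e₁^p-central (sym (identityʳ _)))) ⟩
    ε ∎
    where
    open ≡-Reasoning
    e₁^p-central : e₁ ^ p ∙ e₂ ^ 1 ≡ e₂ ^ 1 ∙ e₁ ^ p
    e₁^p-central = central⇐c≈0 (e₁ ^ p)
      (≈-trans (c₁-^ e₁ p) (≈-intro (+ 1) (trans (cong (λ u → + p * + u) c₁-e₁) (p*1≡0+1*p (+ p)))))
      (≈-trans (c₂-^ e₁ p) (≈-reflexive (trans (cong (λ u → + p * + u) c₂-e₁) (ℤ.*-zeroʳ (+ p)))))
      (e₂ ^ 1)
      where
      p*1≡0+1*p : ∀ p → p * + 1 ≡ + 0 + + 1 * p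
      p*1≡0+1*p = solve-∀

  commutator^-mod : ∀ e → commutator ^ e ≡ commutator ^ (e % p)
  commutator^-mod e = begin
    commutator ^ e
      ≡⟨ cong (commutator ^_) (ℕ.m≡m%n+[m/n]*n e p) ⟩
    commutator ^ (e % p ℕ.+ e ℕ./ p ℕ.* p)
      ≡⟨ ^-+ commutator (e % p) (e ℕ./ p ℕ.* p) ⟩
    commutator ^ (e % p) ∙ commutator ^ (e ℕ./ p ℕ.* p)
      ≡⟨ cong (commutator ^ (e % p) ∙_) (trans (^-* commutator (e ℕ./ p) p) (trans (cong (_^ (e ℕ./ p)) commutator^p) (ε^ (e ℕ./ p)))) ⟩
    commutator ^ (e % p) ∙ ε
      ≡⟨ identityʳ _ ⟩
    commutator ^ (e % p) ∎
    where open ≡-Reasoning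

  commutator^-cong : ∀ {e f} → + e ≈ + f → commutator ^ e ≡ commutator ^ f
  commutator^-cong {e} {f} e≈f = trans (commutator^-mod e) (trans (cong (commutator ^_) (≈⇒%≡ e f e≈f)) (sym (commutator^-mod f)))

  private
    _≟₂_ : (u v : Fin p × Fin p) → Dec (u ≡ v)
    _≟₂_ = ≡-dec Fin._≟_ Fin._≟_

    z : ℕ
    z = centerSize

  ΣFin²-χ : ∀ (u : Fin p × Fin p) (f : Fin p × Fin p → ℤ) →
            ΣFin (λ v₁ → ΣFin (λ v₂ → χ (u ≟₂ (v₁ , v₂)) * f (v₁ , v₂))) ≡ f u
  ΣFin²-χ (u₁ , u₂) f = begin
    ΣFin (λ v₁ → ΣFin (λ v₂ → χ ((u₁ , u₂) ≟₂ (v₁ , v₂)) * f (v₁ , v₂)))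
      ≡⟨ ΣFin-single u₁ _ (λ v₁ v₁≢u₁ → ΣFin-zero _ (λ v₂ → vanish (v₁ , v₂) (v₁≢u₁ ∘ sym ∘ cong proj₁))) ⟩
    ΣFin (λ v₂ → χ ((u₁ , u₂) ≟₂ (u₁ , v₂)) * f (u₁ , v₂))
      ≡⟨ ΣFin-single u₂ _ (λ v₂ v₂≢u₂ → vanish (u₁ , v₂) (v₂≢u₂ ∘ sym ∘ cong proj₂)) ⟩
    χ ((u₁ , u₂) ≟₂ (u₁ , u₂)) * f (u₁ , u₂)
      ≡⟨ cong (_* f (u₁ , u₂)) (χ-yes ((u₁ , u₂) ≟₂ (u₁ , u₂)) refl) ⟩
    + 1 * f (u₁ , u₂)
      ≡⟨ ℤ.*-identityˡ (f (u₁ , u₂)) ⟩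
    f (u₁ , u₂) ∎
    where
    open ≡-Reasoning
    vanish : ∀ v → (u₁ , u₂) ≢ v → χ ((u₁ , u₂) ≟₂ v) * f v ≡ + 0
    vanish v u≢v = trans (cong (_* f v) (χ-no ((u₁ , u₂) ≟₂ v) u≢v)) (ℤ.*-zeroˡ (f v))

  fiberSize : ∀ v → ΣFin (λ x → χ (φ x ≟₂ v)) ≡ + z
  fiberSize v = begin
    ΣFin (λ x → χ (φ x ≟₂ v))
      ≡⟨ sym (ΣFin-permute (g ∙_) ((g ⁻¹) ∙_) (\\-leftDividesˡ g) (\\-leftDividesʳ g) (λ x → χ (φ x ≟₂ v))) ⟩
    ΣFin (λ x → χ (φ (g ∙ x) ≟₂ v))
      ≡⟨ ΣFin-cong (λ x → χ-cong (φ (g ∙ x) ≟₂ v) (central? x) (to-center x) (from-center x)) ⟩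
    ΣFin (λ x → χ (central? x))
      ≡⟨ sym centerSize≡ΣFin ⟩
    + z ∎
    where
    open ≡-Reasoning
    g = proj₁ (surjective v)
    φg≡v : φ g ≡ v
    φg≡v = proj₂ (surjective v)
    to-center : ∀ x → φ (g ∙ x) ≡ v → Central x
    to-center x φgx≡v = subst Central (\\-leftDividesʳ g x) (central-\\ g (g ∙ x) (trans φg≡v (sym φgx≡v)))
    from-center : ∀ x → Central x → φ (g ∙ x) ≡ v
    from-center x x-central = begin
      φ (g ∙ x)       ≡⟨ hom g x ⟩
      φ g ⊕ φ x       ≡⟨ cong (φ g ⊕_) (central⇒φ≡φε x x-central) ⟩
      φ g ⊕ φ ε       ≡⟨ sym (hom g ε) ⟩
      φ (g ∙ ε)       ≡⟨ cong φ (identityʳ g) ⟩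
      φ g             ≡⟨ φg≡v ⟩
      v               ∎

  ΣFin-φ : ∀ (f : Fin p × Fin p → ℤ) → ΣFin (λ x → f (φ x)) ≡ + z * ΣFin (λ v₁ → ΣFin (λ v₂ → f (v₁ , v₂)))
  ΣFin-φ f = begin
    ΣFin (λ x → f (φ x))
      ≡⟨ ΣFin-cong (λ x → sym (ΣFin²-χ (φ x) f)) ⟩
    ΣFin (λ x → ΣFin (λ v₁ → ΣFin (λ v₂ → χ (φ x ≟₂ (v₁ , v₂)) * f (v₁ , v₂))))
      ≡⟨ ΣFin-swap (λ x v₁ → ΣFin (λ v₂ → χ (φ x ≟₂ (v₁ , v₂)) * f (v₁ , v₂))) ⟩
    ΣFin (λ v₁ → ΣFin (λ x → ΣFin (λ v₂ → χ (φ x ≟₂ (v₁ , v₂)) * f (v₁ , v₂))))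
      ≡⟨ ΣFin-cong (λ v₁ → ΣFin-swap (λ x v₂ → χ (φ x ≟₂ (v₁ , v₂)) * f (v₁ , v₂))) ⟩
    ΣFin (λ v₁ → ΣFin (λ v₂ → ΣFin (λ x → χ (φ x ≟₂ (v₁ , v₂)) * f (v₁ , v₂))))
      ≡⟨ ΣFin-cong (λ v₁ → ΣFin-cong (λ v₂ → ΣFin-*ʳ (f (v₁ , v₂)) (λ x → χ (φ x ≟₂ (v₁ , v₂))))) ⟩
    ΣFin (λ v₁ → ΣFin (λ v₂ → ΣFin (λ x → χ (φ x ≟₂ (v₁ , v₂))) * f (v₁ , v₂)))
      ≡⟨ ΣFin-cong (λ v₁ → ΣFin-cong (λ v₂ → cong (_* f (v₁ , v₂)) (fiberSize (v₁ , v₂)))) ⟩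
    ΣFin (λ v₁ → ΣFin (λ v₂ → + z * f (v₁ , v₂)))
      ≡⟨ ΣFin-cong (λ v₁ → ΣFin-*ˡ (+ z) (λ v₂ → f (v₁ , v₂))) ⟩
    ΣFin (λ v₁ → + z * ΣFin (λ v₂ → f (v₁ , v₂)))
      ≡⟨ ΣFin-*ˡ (+ z) (λ v₁ → ΣFin (λ v₂ → f (v₁ , v₂))) ⟩
    + z * ΣFin (λ v₁ → ΣFin (λ v₂ → f (v₁ , v₂))) ∎
    where open ≡-Reasoning

  order≡ : + N ≡ + p * (+ p * + z)
  order≡ = begin
    + N
      ≡⟨ sym (trans (ΣFin-const N (+ 1)) (ℤ.*-identityʳ (+ N))) ⟩
    ΣFin (λ (x : Fin N) → + 1)
      ≡⟨ ΣFin-φ (λ _ → + 1) ⟩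
    + z * ΣFin (λ (v₁ : Fin p) → ΣFin (λ (v₂ : Fin p) → + 1))
      ≡⟨ cong (+ z *_) (trans (ΣFin-cong {p} (λ _ → trans (ΣFin-const p (+ 1)) (ℤ.*-identityʳ (+ p)))) (ΣFin-const p (+ p))) ⟩
    + z * (+ p * + p)
      ≡⟨ rearrange (+ z) (+ p) ⟩
    + p * (+ p * + z) ∎
    where
    open ≡-Reasoning
    rearrange : ∀ z p → z * (p * p) ≡ p * (p * z)
    rearrange = solve-∀

  centerSize≢0 : z ≢ 0
  centerSize≢0 z≡0 = ¬Fin0 (subst Fin N≡0 ε)
    where
    N≡0 : N ≡ 0
    N≡0 = ℤ.+-injective (trans order≡ (trans (cong (λ t → + p * (+ p * + t)) z≡0) (p*[p*0]≡0 (+ p))))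
      where
      p*[p*0]≡0 : ∀ p → p * (p * + 0) ≡ + 0
      p*[p*0]≡0 = solve-∀

  φ-conj : ∀ {x y} → Conj x y → φ y ≡ φ x
  φ-conj {x} (g , y≡xᵍ) = trans (cong φ y≡xᵍ) (trans (φ-comm (g ∙ x) (g ⁻¹)) (cong φ (\\-leftDividesʳ g x)))

  commute? : ∀ x y → Dec (x ∙ y ≡ y ∙ x)
  commute? x y = (x ∙ y) Fin.≟ (y ∙ x)

  zp-z≡[p-1]z : + z * + p - + z ≡ + ((p ∸ 1) ℕ.* z)
  zp-z≡[p-1]z = begin
    + z * + p - + z                  ≡⟨ cong (λ q → + z * + q - + z) (sym (ℕ.suc-pred p)) ⟩
    + z * + suc (p ∸ 1) - + z        ≡⟨ cong (λ q → + z * q - + z) (ℤ.pos-+ 1 (p ∸ 1)) ⟩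
    + z * (+ 1 + + (p ∸ 1)) - + z    ≡⟨ cancel (+ z) (+ (p ∸ 1)) ⟩
    + (p ∸ 1) * + z                  ≡⟨ sym (ℤ.pos-* (p ∸ 1) z) ⟩
    + ((p ∸ 1) ℕ.* z)                ∎
    where
    open ≡-Reasoning
    cancel : ∀ z q → z * (+ 1 + q) - z ≡ q * z
    cancel = solve-∀

  module _ (nonabelian : ¬ Abelian) where

    commutator≢ε : commutator ≢ ε
    commutator≢ε κ≡ε = nonabelian λ g h → Equivalence.from (commute⇔ g h)
      (trans (κ^≡ε (c₂ g ℕ.* c₁ h)) (sym (κ^≡ε (c₂ h ℕ.* c₁ g))))
      where
      κ^≡ε : ∀ e → commutator ^ e ≡ ε
      κ^≡ε e = trans (cong (_^ e) κ≡ε) (ε^ e)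

    commutator^≡ε⇒p∣ : ∀ d → commutator ^ d ≡ ε → p ℕ.∣ d
    commutator^≡ε⇒p∣ d κ^d≡ε with p ℕ.∣? d
    ... | yes p∣d = p∣d
    ... | no  p∤d = contradiction κ≡ε commutator≢ε
      where
      x = proj₁ (inverse d p∤d)
      κ≡ε : commutator ≡ ε
      κ≡ε = begin
        commutator
          ≡⟨ sym (identityʳ commutator) ⟩
        commutator ^ 1
          ≡⟨ commutator^-cong (≈-sym (≈-trans (≈-reflexive (ℤ.pos-* x d)) (proj₂ (inverse d p∤d)))) ⟩
        commutator ^ (x ℕ.* d)
          ≡⟨ ^-* commutator x d ⟩
        (commutator ^ d) ^ x
          ≡⟨ cong (_^ x) κ^d≡ε ⟩
        ε ^ x
          ≡⟨ ε^ x ⟩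
        ε ∎
        where open ≡-Reasoning

    private
      κ^[f∸e]≡ε : ∀ {e f} → e ℕ.≤ f → commutator ^ e ≡ commutator ^ f → commutator ^ (f ∸ e) ≡ ε
      κ^[f∸e]≡ε {e} {f} e≤f κ^e≡κ^f = sym (∙-cancelˡ (commutator ^ e) ε _
        (trans (identityʳ _) (trans κ^e≡κ^f (trans (cong (commutator ^_) (sym (ℕ.m+[n∸m]≡n e≤f))) (^-+ commutator e (f ∸ e))))))

    commutator^-injective : ∀ e f → commutator ^ e ≡ commutator ^ f → + e ≈ + f
    commutator^-injective e f κ^e≡κ^f with ℕ.≤-total e f
    ... | inj₁ e≤f = ≈-sym (∣∸⇒≈ e≤f (commutator^≡ε⇒p∣ (f ∸ e) (κ^[f∸e]≡ε e≤f κ^e≡κ^f)))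
    ... | inj₂ f≤e = ∣∸⇒≈ f≤e (commutator^≡ε⇒p∣ (e ∸ f) (κ^[f∸e]≡ε f≤e (sym κ^e≡κ^f)))

    commute⇔≈ : ∀ g h → (g ∙ h ≡ h ∙ g) ⇔ (+ (c₂ g ℕ.* c₁ h) ≈ + (c₂ h ℕ.* c₁ g))
    commute⇔≈ g h = mk⇔ (commutator^-injective _ _ ∘ Equivalence.to (commute⇔ g h)) (Equivalence.from (commute⇔ g h) ∘ commutator^-cong)

    -- x₂w₁ ≡ w₂x₁ follows after multiplying by a nonzero coordinate of y, which is invertible mod p.
    commute-trans : ∀ {x y w} → ¬ Central y → x ∙ y ≡ y ∙ x → y ∙ w ≡ w ∙ y → x ∙ w ≡ w ∙ x
    commute-trans {x} {y} {w} y-noncentral xy≡yx yw≡wy = Equivalence.from (commute⇔≈ x w)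
      (≈-trans (≈-reflexive (ℤ.pos-* (c₂ x) (c₁ w))) (≈-trans x₂w₁≈w₂x₁ (≈-reflexive (sym (ℤ.pos-* (c₂ w) (c₁ x))))))
      where
      open ≈-Reasoning
      X₁ X₂ Y₁ Y₂ W₁ W₂ : ℤ
      X₁ = + c₁ x
      X₂ = + c₂ x
      Y₁ = + c₁ y
      Y₂ = + c₂ y
      W₁ = + c₁ w
      W₂ = + c₂ w
      x₂y₁≈y₂x₁ : X₂ * Y₁ ≈ Y₂ * X₁
      x₂y₁≈y₂x₁ = ≈-trans (≈-reflexive (sym (ℤ.pos-* (c₂ x) (c₁ y))))
                          (≈-trans (Equivalence.to (commute⇔≈ x y) xy≡yx) (≈-reflexive (ℤ.pos-* (c₂ y) (c₁ x))))
      y₂w₁≈w₂y₁ : Y₂ * W₁ ≈ W₂ * Y₁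
      y₂w₁≈w₂y₁ = ≈-trans (≈-reflexive (sym (ℤ.pos-* (c₂ y) (c₁ w))))
                          (≈-trans (Equivalence.to (commute⇔≈ y w) yw≡wy) (≈-reflexive (ℤ.pos-* (c₂ w) (c₁ y))))
      x₂w₁≈w₂x₁ : X₂ * W₁ ≈ W₂ * X₁
      x₂w₁≈w₂x₁ with c₁ y ℕ.≟ 0
      ... | no c₁y≢0 = *-cancelˡ-≈ (c₁ y) (<p⇒∤ (toℕ<n _) c₁y≢0) (begin
        Y₁ * (X₂ * W₁)   ≡⟨ swap Y₁ X₂ W₁ ⟩
        W₁ * (X₂ * Y₁)   ≈⟨ *-cong (≈-refl {W₁}) x₂y₁≈y₂x₁ ⟩
        W₁ * (Y₂ * X₁)   ≡⟨ swap W₁ Y₂ X₁ ⟩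
        X₁ * (Y₂ * W₁)   ≈⟨ *-cong (≈-refl {X₁}) y₂w₁≈w₂y₁ ⟩
        X₁ * (W₂ * Y₁)   ≡⟨ swap X₁ W₂ Y₁ ⟩
        Y₁ * (W₂ * X₁)   ∎)
        where
        swap : ∀ a b c → a * (b * c) ≡ c * (b * a)
        swap = solve-∀
      ... | yes c₁y≡0 = *-cancelˡ-≈ (c₂ y) (<p⇒∤ (toℕ<n _) c₂y≢0) (begin
        Y₂ * (X₂ * W₁)   ≡⟨ swap Y₂ X₂ W₁ ⟩
        X₂ * (Y₂ * W₁)   ≈⟨ *-cong (≈-refl {X₂}) y₂w₁≈w₂y₁ ⟩
        X₂ * (W₂ * Y₁)   ≡⟨ swap X₂ W₂ Y₁ ⟩
        W₂ * (X₂ * Y₁)   ≈⟨ *-cong (≈-refl {W₂}) x₂y₁≈y₂x₁ ⟩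
        W₂ * (Y₂ * X₁)   ≡⟨ swap W₂ Y₂ X₁ ⟩
        Y₂ * (W₂ * X₁)   ∎)
        where
        swap : ∀ a b c → a * (b * c) ≡ b * (a * c)
        swap = solve-∀
        c₂y≢0 : c₂ y ≢ 0
        c₂y≢0 c₂y≡0 = y-noncentral (central⇐c≈0 y (≈-reflexive (cong +_ c₁y≡0)) (≈-reflexive (cong +_ c₂y≡0)))


    centralizerSize≡ : ∀ x → ¬ Central x → centralizerSize x ≡ + z * + p
    centralizerSize≡ x x-noncentral = begin
      ΣFin (λ h → χ ((h ∙ x) Fin.≟ (x ∙ h)))
        ≡⟨ ΣFin-cong (λ h → χ-cong ((h ∙ x) Fin.≟ (x ∙ h)) (line (φ h))
                                                                        (Equivalence.to (commute⇔≈ x h) ∘ sym) (sym ∘ Equivalence.from (commute⇔≈ x h))) ⟩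
      ΣFin (λ h → χ (line (φ h)))
        ≡⟨ ΣFin-φ (χ ∘ line) ⟩
      + z * ΣFin (λ v₁ → ΣFin (λ v₂ → χ (line (v₁ , v₂))))
        ≡⟨ cong (+ z *_) (line-size (c₁ x) (c₂ x) (toℕ<n _) (toℕ<n _) c≢0) ⟩
      + z * + p ∎
      where
      open ≡-Reasoning
      line : (v : Fin p × Fin p) → Dec (+ (c₂ x ℕ.* toℕ (proj₁ v)) ≈ + (toℕ (proj₂ v) ℕ.* c₁ x))
      line v = (c₂ x ℕ.* toℕ (proj₁ v)) ≈? (toℕ (proj₂ v) ℕ.* c₁ x)
      c≢0 : ¬ (c₁ x ≡ 0 × c₂ x ≡ 0)
      c≢0 (c₁x≡0 , c₂x≡0) = x-noncentral (central⇐c≈0 x (≈-reflexive (cong +_ c₁x≡0)) (≈-reflexive (cong +_ c₂x≡0)))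

    classSize≡p : ∀ x → ¬ Central x → classSize x ≡ + p
    classSize≡p x x-noncentral = ℤ.*-cancelʳ-≡ (classSize x) (+ p) (+ z * + p) {{zp≢0}} (begin
      classSize x * (+ z * + p)           ≡⟨ cong (classSize x *_) (sym (centralizerSize≡ x x-noncentral)) ⟩
      classSize x * centralizerSize x     ≡⟨ sym (orbit-stabilizer x) ⟩
      + N                                 ≡⟨ order≡ ⟩
      + p * (+ p * + z)                   ≡⟨ cong (+ p *_) (ℤ.*-comm (+ p) (+ z)) ⟩
      + p * (+ z * + p)                   ∎)
      where
      open ≡-Reasoning
      zp≢0 : ℤ.NonZero (+ z * + p)
      zp≢0 = subst ℤ.NonZero (ℤ.pos-* z p) (ℕ.m*n≢0 z p {{ℕ.≢-nonZero centerSize≢0}} {{p≢0}})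

    module _ {m} (R : ClassReps m) where
      open ClassReps R

      -- Every noncentral class has p elements and commuting with rep i is a class function, so
      -- p times the number of representatives commuting with rep i counts C(rep i) ∖ Z(G).
      commutingReps : ∀ i → ΣFin (λ j → χ (commute? (rep i) (rep j))) * + p ≡ + z * + p - + z
      commutingReps i = begin
        ΣFin (λ j → χ (commute? x (rep j))) * + p
          ≡⟨ sym (ΣFin-*ʳ (+ p) (λ j → χ (commute? x (rep j)))) ⟩
        ΣFin (λ j → χ (commute? x (rep j)) * + p)
          ≡⟨ ΣFin-cong (λ j → cong (χ (commute? x (rep j)) *_) (sym (classSize≡p (rep j) (nonCentral j)))) ⟩
        ΣFin (λ j → χ (commute? x (rep j)) * classSize (rep j))
          ≡⟨ ΣFin-cong (λ j → sym (ΣFin-*ˡ (χ (commute? x (rep j))) (λ y → χ (conj? (rep j) y)))) ⟩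
        ΣFin (λ j → ΣFin (λ y → χ (commute? x (rep j)) * χ (conj? (rep j) y)))
          ≡⟨ ΣFin-cong (λ j → ΣFin-cong (λ y → conj-invariant j y)) ⟩
        ΣFin (λ j → ΣFin (λ y → χ (commute? x y) * χ (conj? (rep j) y)))
          ≡⟨ ΣFin-swap (λ j y → χ (commute? x y) * χ (conj? (rep j) y)) ⟩
        ΣFin (λ y → ΣFin (λ j → χ (commute? x y) * χ (conj? (rep j) y)))
          ≡⟨ ΣFin-cong (λ y → trans (ΣFin-*ˡ (χ (commute? x y)) (λ j → χ (conj? (rep j) y))) (cong (χ (commute? x y) *_) (ΣFin-reps R y))) ⟩
        ΣFin (λ y → χ (commute? x y) * (+ 1 - χ (central? y)))
          ≡⟨ ΣFin-cong (λ y → noncentral-part y) ⟩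
        ΣFin (λ y → χ (commute? x y) - χ (central? y))
          ≡⟨ ΣFin-- (λ y → χ (commute? x y)) (λ y → χ (central? y)) ⟩
        ΣFin (λ y → χ (commute? x y)) - ΣFin (λ y → χ (central? y))
          ≡⟨ cong₂ _-_ (trans (ΣFin-cong (λ y → χ-cong (commute? x y) ((y ∙ x) Fin.≟ (x ∙ y)) sym sym))
                              (centralizerSize≡ x (nonCentral i)))
                       (sym centerSize≡ΣFin) ⟩
        + z * + p - + z ∎
        where
        open ≡-Reasoning
        x = rep i
        conj-invariant : ∀ j y → χ (commute? x (rep j)) * χ (conj? (rep j) y) ≡ χ (commute? x y) * χ (conj? (rep j) y)
        conj-invariant j y with conj? (rep j) y
        ... | yes rⱼ~y = cong (_* + 1) (χ-cong (commute? x (rep j)) (commute? x y)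
                           (commute-respects-φ refl (sym (φ-conj rⱼ~y))) (commute-respects-φ refl (φ-conj rⱼ~y)))
        ... | no  _    = trans (ℤ.*-zeroʳ (χ (commute? x (rep j)))) (sym (ℤ.*-zeroʳ (χ (commute? x y))))
        noncentral-part : ∀ y → χ (commute? x y) * (+ 1 - χ (central? y)) ≡ χ (commute? x y) - χ (central? y)
        noncentral-part y = by-centrality (central? y)
          where
          by-centrality : (d : Dec (Central y)) → χ (commute? x y) * (+ 1 - χ d) ≡ χ (commute? x y) - χ d
          by-centrality (yes y-central) = trans (ℤ.*-zeroʳ (χ (commute? x y))) (sym (cong (_- + 1) (χ-yes (commute? x y) (sym (y-central x)))))
          by-centrality (no _)          = trans (ℤ.*-identityʳ (χ (commute? x y))) (sym (ℤ.+-identityʳ (χ (commute? x y))))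

      sameSide : Fin m → Fin m → Bool
      sameSide i j = does (commute? (rep i) (rep j))

      private
        sameSide⇒commute : ∀ {i j} → sameSide i j ≡ true → rep i ∙ rep j ≡ rep j ∙ rep i
        sameSide⇒commute {i} {j} = true⇒witness (commute? (rep i) (rep j))
          where
          true⇒witness : ∀ {P : Set} (d : Dec P) → does d ≡ true → P
          true⇒witness (yes p) _  = p
          true⇒witness (no _)  ()

        commute⇒sameSide : ∀ {i j} → rep i ∙ rep j ≡ rep j ∙ rep i → sameSide i j ≡ true
        commute⇒sameSide {i} {j} = dec-true (commute? (rep i) (rep j))

      sameSide-isEquivalence : IsEquivalence (λ i j → sameSide i j ≡ true)
      sameSide-isEquivalence = record
        { refl  = commute⇒sameSide refl
        ; sym   = commute⇒sameSide ∘ sym ∘ sameSide⇒commute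
        ; trans = λ {i} {j} {k} ij jk → commute⇒sameSide (commute-trans (nonCentral j) (sameSide⇒commute ij) (sameSide⇒commute jk))
        }

      adjacency : ∀ i j → adjMatrix R i j ≡ + 1 - ind (sameSide i j)
      adjacency i j = trans (χ-cong (adjacent? R i j) (¬? (commute? (rep i) (rep j))) adjacent⇒¬commute ¬commute⇒adjacent)
                            (χ-¬ (commute? (rep i) (rep j)))
        where
        adjacent⇒¬commute : Adjacent R i j → ¬ (rep i ∙ rep j ≡ rep j ∙ rep i)
        adjacent⇒¬commute (_ , never-commute) = never-commute (rep i) (rep j) (conj-refl (rep i)) (conj-refl (rep j))
        ¬commute⇒adjacent : ¬ (rep i ∙ rep j ≡ rep j ∙ rep i) → Adjacent R i j
        ¬commute⇒adjacent ¬comm = (λ { refl → ¬comm refl })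
                                , (λ x y rᵢ~x rⱼ~y xy≡yx → ¬comm (commute-respects-φ (φ-conj rᵢ~x) (φ-conj rⱼ~y) xy≡yx))

      commutingCount : Fin m → ℕ
      commutingCount i = length (filter (commute? (rep i)) (tabulate rep))

      commutingCount*p : ∀ i → commutingCount i ℕ.* p ≡ (p ∸ 1) ℕ.* z
      commutingCount*p i = ℤ.+-injective (begin
        + (commutingCount i ℕ.* p)
          ≡⟨ ℤ.pos-* (commutingCount i) p ⟩
        + commutingCount i * + p
          ≡⟨ cong (_* + p) (length-filter-tabulate (commute? (rep i)) rep) ⟩
        ΣFin (λ j → χ (commute? (rep i) (rep j))) * + p
          ≡⟨ commutingReps i ⟩
        + z * + p - + z
          ≡⟨ zp-z≡[p-1]z ⟩
        + ((p ∸ 1) ℕ.* z) ∎)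
        where open ≡-Reasoning

      n : ℕ
      n = nParam p p-prime z

      commutingCount≡n : ∀ i → commutingCount i ≡ n
      commutingCount≡n i = sym (trans (cong (ℕ._/ p) (sym (commutingCount*p i))) (ℕ.m*n/n≡m (commutingCount i) p))

      n*p≡[p-1]z : n ℕ.* p ≡ (p ∸ 1) ℕ.* z
      n*p≡[p-1]z = trans (cong (ℕ._* p) (sym (commutingCount≡n i₀))) (commutingCount*p i₀)
        where
        e₁-noncentral : ¬ Central e₁
        e₁-noncentral e₁-central = commutator≢ε (∙-cancelˡ (e₂ ∙ e₁) commutator ε
          (trans (sym e₁∙e₂) (trans (e₁-central e₂) (sym (identityʳ (e₂ ∙ e₁))))))
        i₀ : Fin m
        i₀ = proj₁ (cover e₁ e₁-noncentral)

      instance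
        n≢0 : ℕ.NonZero n
        n≢0 = ℕ.≢-nonZero λ n≡0 → [ p∸1≢0 , centerSize≢0 ]′ (ℕ.m*n≡0⇒m≡0∨n≡0 (p ∸ 1) (trans (sym n*p≡[p-1]z) (cong (ℕ._* p) n≡0)))
          where
          p∸1≢0 : p ∸ 1 ≢ 0
          p∸1≢0 p∸1≡0 = ℕ.<⇒≢ 1<p (sym (trans (sym (ℕ.suc-pred p)) (cong suc p∸1≡0)))

      partSize : ∀ i → ΣFin (λ j → ind (sameSide i j)) ≡ + n
      partSize i = trans (sym (length-filter-tabulate (commute? (rep i)) rep)) (cong +_ (commutingCount≡n i))

      order : m ≡ (p ℕ.+ 1) ℕ.* n
      order = ℕ.*-cancelʳ-≡ m ((p ℕ.+ 1) ℕ.* n) p (ℤ.+-injective (begin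
        + (m ℕ.* p)
          ≡⟨ ℤ.pos-* m p ⟩
        + m * + p
          ≡⟨ class-equation R p (λ j → classSize≡p (rep j) (nonCentral j)) ⟩
        + N - + z
          ≡⟨ cong (_- + z) order≡ ⟩
        + p * (+ p * + z) - + z
          ≡⟨ factor (+ p) (+ z) ⟩
        (+ p + + 1) * (+ z * + p - + z)
          ≡⟨ cong ((+ p + + 1) *_) (trans zp-z≡[p-1]z (cong +_ (sym n*p≡[p-1]z))) ⟩
        (+ p + + 1) * + (n ℕ.* p)
          ≡⟨ sym (trans (ℤ.pos-* ((p ℕ.+ 1) ℕ.* n) p) (trans (cong (_* + p) (trans (ℤ.pos-* (p ℕ.+ 1) n) (cong (_* + n) (ℤ.pos-+ p 1))))
                                                 (trans (ℤ.*-assoc (+ p + + 1) (+ n) (+ p)) (cong ((+ p + + 1) *_) (sym (ℤ.pos-* n p)))))) ⟩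
        + ((p ℕ.+ 1) ℕ.* n ℕ.* p)           ∎))
        where
        open ≡-Reasoning
        factor : ∀ p z → p * (p * z) - z ≡ (p + + 1) * (z * p - z)
        factor = solve-∀

      completeMultipartite : CompleteMultipartite (adjMatrix R) (p ℕ.+ 1) n
      completeMultipartite = record
        { sameSide      = sameSide
        ; isEquivalence = sameSide-isEquivalence
        ; adjacency     = adjacency
        ; partSize      = partSize
        ; order         = order
        }

-- Imported only here: in the modules above, _+_ and _*_ are the integer operations.
open import Data.Nat using (_+_; _*_; _∸_)
open import Data.Integer using (+_; -_)
open import Data.List using ([]; _∷_)
open import Data.Product using (_×_; _,_)
open import Relation.Nullary using (¬_)
open CompleteMultipartiteGraphs using (module CompleteMultipartite-spectra)

theorem2p3 : (p : ℕ) (pp : Prime p)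
    (N : ℕ) (_∙_ : Fin N → Fin N → Fin N) (ε : Fin N) (_⁻¹ : Fin N → Fin N)
    → IsGroup _≡_ _∙_ ε _⁻¹
    → ¬ FinGroup.Abelian _∙_ ε _⁻¹
    → FinGroup.CentralQuotientIsZp×Zp _∙_ ε _⁻¹ p pp
    → (m : ℕ) (R : FinGroup.ClassReps _∙_ ε _⁻¹ m)
    → let z = FinGroup.centerSize _∙_ ε _⁻¹
          n = nParam p pp z
          A = FinGroup.adjMatrix _∙_ ε _⁻¹ R
      in HasSpectrum A
           (multiset ((+ 0 , (p + 1) * (n ∸ 1)) ∷ (- (+ n) , p) ∷ (+ (n * p) , 1) ∷ []))
         × HasSpectrum (laplacian A)
           (multiset ((+ 0 , 1) ∷ (+ (n * p) , (p + 1) * (n ∸ 1)) ∷ (+ ((p + 1) * n) , p) ∷ []))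
         × HasSpectrum (signlessLaplacian A)
           (multiset ((+ (n * p) , (p + 1) * (n ∸ 1)) ∷ (+ (n * (p ∸ 1)) , p) ∷ (+ (2 * n * p) , 1) ∷ []))
         × Energy A (ℤtoℚ (+ (2 * n * p)))
         × LaplacianEnergy A (ℤtoℚ (+ (2 * n * p)))
         × SignlessLaplacianEnergy A (ℤtoℚ (+ (2 * n * p)))
theorem2p3 p pp N _∙_ ε _⁻¹ isGroup nonabelian quotient m R =
  spectrum , laplacianSpectrum , signlessLaplacianSpectrum , energy , laplacianEnergy , signlessLaplacianEnergy
  where
  open CentralQuotient p pp isGroup quotient using (completeMultipartite; n≢0)
  open CompleteMultipartite-spectra {{n≢0 nonabelian R}} (completeMultipartite nonabelian R)
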